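{- Let $k\in\mathbb{N}$ and let $\mathsf{D}$ be a finite, coherent, interface-respecting DP-core with identity cleaning, equipped with a witness action. Then the Relabeled Inclusion Test (described in the context) terminates. Moreover, it returns "Inclusion Holds" if and only if every graph of treewidth at most $k$ belongs to $\mathcal{P}(\mathsf{D})$, and otherwise it returns a canonized $(k,\mathsf{D})$-refutation.
   Context: Graphs are triples $(V,E,\rho)$ with $V,E$ finite subsets of $\mathbb{N}$, $\rho\subseteq E\times V$, each edge incident to exactly two distinct vertices (parallel edges allowed); graph properties are isomorphism-closed sets of graphs. Instructive decompositions: the $k$-instructive alphabet has $\mathtt{Leaf}$ (arity 0), $\mathtt{IntroVertex}_u$, $\mathtt{ForgetVertex}_u$ ($u\in[k+1]$), $\mathtt{IntroEdge}_{u,v}$ (distinct $u,v$) of arity 1 and $\mathtt{Join}$ of arity 2; $\mathcal{T}_k$ is the set of terms legal w.r.t. bags (Leaf: $\emptyset$; IntroVertex$_u$ needs $u\notin$ bag, adds $u$; ForgetVertex$_u$ needs $u\in$ bag, removes $u$; IntroEdge$_{u,v}$ needs $u,v\in$ bag; Join needs equal child bags). $G(\tau)$ is the graph built: Leaf empty; IntroVertex$_u$ adds a fresh isolated vertex labeled $u$; ForgetVertex$_u$ removes label $u$; IntroEdge$_{u,v}$ adds an edge between the vertices labeled $u,v$; Join is the disjoint union of the children identifying vertices with the same bag label (edges never identified). A graph has treewidth $\le k$ iff it is isomorphic to some $G(\tau)$, $\tau\in\mathcal{T}_k$. DP-cores: $\mathsf{D}[k]$ consists of a decidable set $\mathcal{W}_k\subseteq\{0,1\}^*$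 of witnesses, $\mathtt{Final}_k:\mathcal{W}_k\to\{0,1\}$, a finite set $\mathtt{Leaf}_k$, transition functions $\mathtt{IntroVertex}_u,\mathtt{ForgetVertex}_u,\mathtt{IntroEdge}_{u,v}:\mathcal{W}_k\to$ finite subsets, $\mathtt{Join}:\mathcal{W}_k^2\to$ finite subsets (lifted to finite sets by union), and $\mathtt{Clean}_k$. The dynamization $\mathrm{Dyn}_k(\tau)$ is computed bottom-up ($\mathtt{Leaf}_k$ at leaves, then lifted transition followed by $\mathtt{Clean}_k$); $\mathsf{D}[k]$ accepts $\tau$ if $\mathrm{Dyn}_k(\tau)$ contains $w$ with $\mathtt{Final}_k(w)=1$ (final witness). $\mathcal{P}(\mathsf{D})=\bigcup_k$ iso-closure of accepted graphs. Finite: each $\mathcal{W}_k$ finite. Identity cleaning: $\mathtt{Clean}_k=\mathrm{id}$. Coherent: acceptance of $\tau\in\mathcal{T}_k$ and $\tau'\in\mathcal{T}_{k'}$ agree whenever $G(\tau)\cong G(\tau')$. Labels: each $w$ has $\mathrm{Lbl}_k(w)\subseteq[k+1]$; $\mathrm{Lbl}_k(S)=\bigcup_{w\in S}\mathrm{Lbl}_k(w)$. A state $(b,S)$ ($b\subseteq[k+1]$, $S\subseteq\mathcal{W}_k$ finite) is well-formed if $\mathrm{Lbl}_k(S)\subseteq b$; inconsistent if $S$ contains no final witness; initial state $(\emptyset,\mathtt{Leaf}_k)$. Interface-respecting: $\mathrm{Lbl}_k(\mathtt{Leaf}_k)=\emptyset$ and whenever $\mathrm{Lbl}_k(S),\mathrm{Lbl}_k(S')\subseteq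 b$: $\mathrm{Lbl}_k(\mathtt{IntroVertex}_u(S))\subseteq b\cup\{u\}$ ($u\notin b$), $\mathrm{Lbl}_k(\mathtt{ForgetVertex}_u(S))\subseteq b\setminus\{u\}$ ($u\in b$), $\mathrm{Lbl}_k(\mathtt{IntroEdge}_{u,v}(S))\subseteq b$ ($u,v\in b$), $\mathrm{Lbl}_k(\mathtt{Join}(S,S'))\subseteq b$, $\mathrm{Lbl}_k(\mathtt{Clean}_k(S))\subseteq b$. Relabelings and actions: $\mathcal{F}_k$ = injective maps $f:b\to[k+1]$, $b\subseteq[k+1]$; $f^{ -1}$ inverse on image; $f\circ g$ partial composition. A witness action is a partial map $\rho(f,w)$ defined iff $\mathrm{Lbl}_k(w)\subseteq\mathrm{dom}(f)$, extended pointwise to sets, preserving finality, with $\mathrm{Lbl}_k(\rho(f,w))=f(\mathrm{Lbl}_k(w))$, $\rho(f^{ -1},\rho(f,w))=w$, $\rho(f\circ f',w)=\rho(f,\rho(f',w))$, $\rho(f',w)=\rho(f,w)$ if $f'$ extends $f$, and commuting with transitions ($\rho(f,\mathtt{IntroVertex}_u(w))=\mathtt{IntroVertex}_{f(u)}(\rho(f,w))$, same for ForgetVertex, $\rho(f,\mathtt{IntroEdge}_{u,v}(w))=\mathtt{IntroEdge}_{f(u),f(v)}(\rho(f,w))$, $\rho(f,\mathtt{Join}(w,w'))=\mathtt{Join}(\rho(f,w),\rho(f,w'))$). Canonization: fix a total order on $\mathcal{W}_k$; order pairs $(b,S)$ lexicographically by (increasing enumeration of $b$, increasing enumeration of $S$),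 with proper prefixes smaller. For well-formed $(b,S)$, $\mathrm{CAN}(b,S)=\min\{(f(b),\rho(f,S)):f\in\mathcal{F}_k,\mathrm{dom}(f)=b\}$; $(b,S)$ is canonical if it equals $\mathrm{CAN}(b,S)$. A canonized $(k,\mathsf{D})$-refutation is a sequence of canonical well-formed states $(b_0,S_0),\dots,(b_m,S_m)$ with the first initial, the last inconsistent, and each $(b_i,S_i)$, $i\ge1$, obtained for some injective $f_i$ and some $j<i$ as $(f_i(b_j\cup\{u\}),\rho(f_i,\mathtt{IntroVertex}_u(S_j)))$ ($u\notin b_j$), $(f_i(b_j\setminus\{u\}),\rho(f_i,\mathtt{ForgetVertex}_u(S_j)))$ ($u\in b_j$), $(f_i(b_j),\rho(f_i,\mathtt{IntroEdge}_{u,v}(S_j)))$ ($u\ne v\in b_j$), or $(f_i(b_j),\rho(f_i,\mathtt{Join}(S_j,\rho(\pi,S_l))))$ ($l<i$, $b_l=b_j$, $\pi$ a permutation of $b_j$), with $\mathrm{dom}(f_i)$ the bag to which it is applied. Relabeled Inclusion Test: initialize an empty list $R$, $Init=\mathrm{CAN}(\emptyset,\mathtt{Leaf}_k)$, a FIFO queue $Y=[Init]$ and $Seen=\{Init\}$. While $Y$ is nonempty: remove the next pair $(b,S)$ from $Y$ and append it to $R$; if it is inconsistent, return $R$; otherwise generate the successors $(b\cup\{u\},\mathtt{IntroVertex}_u(S))$ for $u\in[k+1]\setminus b$, $(b\setminus\{u\},\mathtt{ForgetVertex}_u(S))$ for $u\in b$, $(b,\mathtt{IntroEdge}_{u,v}(S))$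 for distinct $u,v\in b$, and, for every $(b',S')\in R$ with $b'=b$ and every permutation $\pi$ of $b$, both $(b,\mathtt{Join}(S,\rho(\pi,S')))$ and $(b,\mathtt{Join}(S',\rho(\pi,S)))$; each successor $X$ is replaced by $\mathrm{CAN}(X)$, and if not in $Seen$ it is added to $Seen$ and appended to $Y$. When $Y$ is empty, return "Inclusion Holds". -}

module Defs where

open import Level using (0ℓ)
open import Data.Bool using (Bool; true; false; T; T?; not; _∧_; _∨_; if_then_else_)
open import Data.Nat using (ℕ; zero; suc; _+_; _⊔_)
import Data.Nat as ℕ
open import Data.Fin using (Fin; zero; suc)
import Data.Fin as F
import Data.Fin.Properties as FP
open import Data.Fin.Subset using (Subset; ⁅_⁆; _∪_; _-_)
  renaming (⊥ to ∅ₛ; _∈_ to _∈ₛ_; _∉_ to _∉ₛ_; _⊆_ to _⊆ₛ_)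
open import Data.Fin.Subset.Properties using (_∈?_)
open import Data.Vec using (Vec; []; _∷_; lookup; tabulate)
import Data.Vec as V
import Data.Vec.Properties as VP
open import Data.List using (List; []; _∷_; _++_; map; concatMap; filter; mapMaybe; foldr; foldl; allFin)
open import Data.Bool.ListAction using (any; all)
import Data.List.Properties as LP
open import Data.List.Membership.Propositional using (_∈_)
open import Data.Maybe using (Maybe; just; nothing; is-just; _>>=_)
import Data.Maybe as M
open import Data.Product using (Σ; _×_; _,_; proj₁; proj₂; ∃)
open import Data.Sum using (_⊎_)
open import Data.Unit using (⊤)
open import Relation.Binary.PropositionalEquality using (_≡_; _≢_; refl)
open import Relation.Binary using (Rel; IsStrictTotalOrder; Tri; tri<; tri≈; tri>)
open import Relation.Nullary using (Dec; yes; no; ¬?)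
open import Relation.Nullary.Decidable using (⌊_⌋)

-- Graphs  (V, E, ρ): V, E finite subsets of ℕ (as lists, read as sets),
-- ρ ⊆ E × V the incidence relation (as a list of pairs, read as a set).

record Graph : Set where
  constructor mkGraph
  field
    V : List ℕ
    E : List ℕ
    ρ : List (ℕ × ℕ)
open Graph public

record IsGraph (G : Graph) : Set where
  field
    inc-dom  : ∀ {e v} → (e , v) ∈ ρ G → (e ∈ E G) × (v ∈ V G)
    two-ends : ∀ {e} → e ∈ E G →
      Σ ℕ λ x → Σ ℕ λ y → (x ≢ y) × ((e , x) ∈ ρ G) × ((e , y) ∈ ρ G)
        × (∀ z → (e , z) ∈ ρ G → (z ≡ x) ⊎ (z ≡ y))

record _≅_ (G H : Graph) : Set where
  field
    fV gV fE gE : ℕ → ℕ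
    fV∈ : ∀ {v} → v ∈ V G → fV v ∈ V H
    gV∈ : ∀ {v} → v ∈ V H → gV v ∈ V G
    gfV : ∀ {v} → v ∈ V G → gV (fV v) ≡ v
    fgV : ∀ {v} → v ∈ V H → fV (gV v) ≡ v
    fE∈ : ∀ {e} → e ∈ E G → fE e ∈ E H
    gE∈ : ∀ {e} → e ∈ E H → gE e ∈ E G
    gfE : ∀ {e} → e ∈ E G → gE (fE e) ≡ e
    fgE : ∀ {e} → e ∈ E H → fE (gE e) ≡ e
    inc→ : ∀ {e v} → e ∈ E G → v ∈ V G → (e , v) ∈ ρ G → (fE e , fV v) ∈ ρ H
    inc← : ∀ {e v} → e ∈ E G → v ∈ V G → (fE e , fV v) ∈ ρ H → (e , v) ∈ ρ G

-- k-instructive terms. Labels [k+1] are represented by Fin (suc k).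

data Term (k : ℕ) : Set where
  leaf    : Term k
  introV  : Fin (suc k) → Term k → Term k
  forgetV : Fin (suc k) → Term k → Term k
  introE  : Fin (suc k) → Fin (suc k) → Term k → Term k
  join    : Term k → Term k → Term k

-- legality w.r.t. bags: Legal t b  means t is legal with root bag b
data Legal {k : ℕ} : Term k → Subset (suc k) → Set where
  leaf    : Legal leaf ∅ₛ
  introV  : ∀ {t b u} → Legal t b → u ∉ₛ b → Legal (introV u t) (b ∪ ⁅ u ⁆)
  forgetV : ∀ {t b u} → Legal t b → u ∈ₛ b → Legal (forgetV u t) (b - u)
  introE  : ∀ {t b u v} → Legal t b → u ≢ v → u ∈ₛ b → v ∈ₛ b → Legal (introE u v t) b
  join    : ∀ {t t' b} → Legal t b → Legal t' b → Legal (join t t') b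

InTk : (k : ℕ) → Term k → Set
InTk k t = Σ (Subset (suc k)) (Legal t)

maxL : List ℕ → ℕ
maxL = foldr _⊔_ 0

fresh : List ℕ → ℕ
fresh xs = suc (maxL xs)

findFin : ∀ {n} → (Fin n → Bool) → Maybe (Fin n)
findFin {n} p = go (allFin n)
  where
  go : List (Fin _) → Maybe (Fin _)
  go [] = nothing
  go (x ∷ xs) = if p x then just x else go xs

eqℕ : ℕ → ℕ → Bool
eqℕ x y = ⌊ x ℕ.≟ y ⌋

hitsℕ : Maybe ℕ → ℕ → Bool
hitsℕ (just x) y = eqℕ x y
hitsℕ nothing  y = false

Labeling : ℕ → Set
Labeling k = Fin (suc k) → Maybe ℕ

update : ∀ {k} → Labeling k → Fin (suc k) → Maybe ℕ → Labeling k
update l u m v = if ⌊ v F.≟ u ⌋ then m else l v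

-- build τ = (graph, current labeling of bag labels by vertices)
build : ∀ {k} → Term k → Graph × Labeling k
build leaf = mkGraph [] [] [] , (λ _ → nothing)
build (introV u t) with build t
... | mkGraph Vs Es ρs , l = mkGraph (fresh Vs ∷ Vs) Es ρs , update l u (just (fresh Vs))
build (forgetV u t) with build t
... | g , l = g , update l u nothing
build (introE u v t) with build t
... | mkGraph Vs Es ρs , l with l u | l v
...   | just x | just y = mkGraph Vs (fresh Es ∷ Es) ((fresh Es , x) ∷ (fresh Es , y) ∷ ρs) , l
...   | _      | _      = mkGraph Vs Es ρs , l
build {k} (join t t') with build t | build t'
... | mkGraph V₁ E₁ ρ₁ , l₁ | mkGraph V₂ E₂ ρ₂ , l₂ =
  mkGraph (V₁ ++ map (_+ oV) (filter (λ x → ¬? (labeled x)) V₂))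
          (E₁ ++ map (_+ oE) E₂)
          (ρ₁ ++ map (λ p → proj₁ p + oE , ren (proj₂ p)) ρ₂)
  , l₁
  where
  oV = fresh V₁
  oE = fresh E₁
  labOf : ℕ → Maybe (Fin (suc k))
  labOf x = findFin (λ u → hitsℕ (l₂ u) x)
  labeled : (x : ℕ) → Dec (T (is-just (labOf x)))
  labeled x = T? (is-just (labOf x))
  ren : ℕ → ℕ
  ren x with labOf x
  ... | nothing = x + oV
  ... | just u with l₁ u
  ...   | just y  = y
  ...   | nothing = x + oV

GraphOf : ∀ {k} → Term k → Graph
GraphOf t = proj₁ (build t)

TreewidthAtMost : ℕ → Graph → Set
TreewidthAtMost k G = Σ (Term k) λ t → InTk k t × (G ≅ GraphOf t)

-- DP-cores. 𝒲_k ⊆ {0,1}* is a decidable subset (given by inW k);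
-- finite subsets of 𝒲_k are represented by lists, read as sets.

record DPCore : Set₁ where
  field
    inW : ℕ → List Bool → Bool
  Wit : ℕ → Set
  Wit k = Σ (List Bool) (λ x → T (inW k x))
  field
    Final        : ∀ k → Wit k → Bool
    Leaf         : ∀ k → List (Wit k)
    IntroVertex  : ∀ k → Fin (suc k) → Wit k → List (Wit k)
    ForgetVertex : ∀ k → Fin (suc k) → Wit k → List (Wit k)
    IntroEdge    : ∀ k → Fin (suc k) → Fin (suc k) → Wit k → List (Wit k)
    Join         : ∀ k → Wit k → Wit k → List (Wit k)
    Clean        : ∀ k → List (Wit k) → List (Wit k)
    Lbl          : ∀ k → Wit k → Subset (suc k)
open DPCore public

_≈ˢ_ : ∀ {A : Set} → List A → List A → Set
S ≈ˢ S' = ∀ z → ((z ∈ S → z ∈ S') × (z ∈ S' → z ∈ S))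

module _ (D : DPCore) (k : ℕ) where
  liftIV : Fin (suc k) → List (Wit D k) → List (Wit D k)
  liftIV u = concatMap (IntroVertex D k u)
  liftFV : Fin (suc k) → List (Wit D k) → List (Wit D k)
  liftFV u = concatMap (ForgetVertex D k u)
  liftIE : Fin (suc k) → Fin (suc k) → List (Wit D k) → List (Wit D k)
  liftIE u v = concatMap (IntroEdge D k u v)
  liftJ : List (Wit D k) → List (Wit D k) → List (Wit D k)
  liftJ S S' = concatMap (λ w → concatMap (Join D k w) S') S

  LblIn : List (Wit D k) → Subset (suc k) → Set
  LblIn S b = ∀ {w} → w ∈ S → Lbl D k w ⊆ₛ b

  Dyn : Term k → List (Wit D k)
  Dyn leaf = Leaf D k
  Dyn (introV u t) = Clean D k (liftIV u (Dyn t))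
  Dyn (forgetV u t) = Clean D k (liftFV u (Dyn t))
  Dyn (introE u v t) = Clean D k (liftIE u v (Dyn t))
  Dyn (join t t') = Clean D k (liftJ (Dyn t) (Dyn t'))

  accepts : Term k → Bool
  accepts t = any (Final D k) (Dyn t)

InP : DPCore → Graph → Set
InP D G = Σ ℕ λ k' → Σ (Term k') λ t → InTk k' t × (accepts D k' t ≡ true) × (G ≅ GraphOf t)

FiniteDP : DPCore → Set
FiniteDP D = ∀ k → Σ (List (Wit D k)) λ l → ∀ w → w ∈ l

IdentityCleaning : DPCore → Set
IdentityCleaning D = ∀ k S → Clean D k S ≡ S

Coherent : DPCore → Set
Coherent D = ∀ k k' (t : Term k) (t' : Term k') → InTk k t → InTk k' t' →
  GraphOf t ≅ GraphOf t' → accepts D k t ≡ accepts D k' t'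

record InterfaceRespecting (D : DPCore) : Set where
  field
    leafLbl : ∀ k → LblIn D k (Leaf D k) ∅ₛ
    ivLbl : ∀ k b S u → LblIn D k S b → u ∉ₛ b → LblIn D k (liftIV D k u S) (b ∪ ⁅ u ⁆)
    fvLbl : ∀ k b S u → LblIn D k S b → u ∈ₛ b → LblIn D k (liftFV D k u S) (b - u)
    ieLbl : ∀ k b S u v → LblIn D k S b → u ≢ v → u ∈ₛ b → v ∈ₛ b → LblIn D k (liftIE D k u v S) b
    jLbl  : ∀ k b S S' → LblIn D k S b → LblIn D k S' b → LblIn D k (liftJ D k S S') b
    clLbl : ∀ k b S → LblIn D k S b → LblIn D k (Clean D k S) b

-- Relabelings: partial maps [k+1] ⇀ [k+1] as vectors of Maybe;
-- ℱ_k = the injective ones.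

Relabel : ℕ → Set
Relabel k = Vec (Maybe (Fin (suc k))) (suc k)

dom : ∀ {k} → Relabel k → Subset (suc k)
dom f = V.map is-just f

hits : ∀ {n} → Maybe (Fin n) → Fin n → Bool
hits (just x) y = ⌊ x F.≟ y ⌋
hits nothing  y = false

image : ∀ {k} → Relabel k → Subset (suc k) → Subset (suc k)
image {k} f b = tabulate λ y → any (λ x → ⌊ x ∈? b ⌋ ∧ hits (lookup f x) y) (allFin (suc k))

Injective : ∀ {k} → Relabel k → Set
Injective f = ∀ {x x' y} → lookup f x ≡ just y → lookup f x' ≡ just y → x ≡ x'

inv : ∀ {k} → Relabel k → Relabel k
inv f = tabulate λ y → findFin (λ x → hits (lookup f x) y)

comp : ∀ {k} → Relabel k → Relabel k → Relabel k
comp f g = tabulate λ x → lookup g x >>= lookup f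

Extends : ∀ {k} → Relabel k → Relabel k → Set
Extends f' f = ∀ {x y} → lookup f x ≡ just y → lookup f' x ≡ just y

IsPerm : ∀ {k} → Relabel k → Subset (suc k) → Set
IsPerm π b = Injective π × (dom π ≡ b) × (image π b ≡ b)

module _ (D : DPCore) where
  actSetWith : ∀ {k} → (Relabel k → Wit D k → Maybe (Wit D k)) →
               Relabel k → List (Wit D k) → Maybe (List (Wit D k))
  actSetWith r f [] = just []
  actSetWith r f (w ∷ S) = r f w >>= λ w' → actSetWith r f S >>= λ S' → just (w' ∷ S')

  record WitnessAction : Set where
    field
      act : ∀ k → Relabel k → Wit D k → Maybe (Wit D k)
    actSet : ∀ k → Relabel k → List (Wit D k) → Maybe (List (Wit D k))
    actSet k = actSetWith (act k)
    field
      defined : ∀ k f w → Injective f → Lbl D k w ⊆ₛ dom f → Σ (Wit D k) λ w' → act k f w ≡ just w'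
      onlyDefined : ∀ k f w w' → Injective f → act k f w ≡ just w' → Lbl D k w ⊆ₛ dom f
      finality : ∀ k f w w' → Injective f → act k f w ≡ just w' → Final D k w' ≡ Final D k w
      labels : ∀ k f w w' → Injective f → act k f w ≡ just w' → Lbl D k w' ≡ image f (Lbl D k w)
      inverse : ∀ k f w w' → Injective f → act k f w ≡ just w' → act k (inv f) w' ≡ just w
      compose : ∀ k f f' w → Injective f → Injective f' → act k (comp f f') w ≡ (act k f' w >>= act k f)
      extend : ∀ k f f' w w' → Injective f → Injective f' → Extends f' f →
               act k f w ≡ just w' → act k f' w ≡ just w'
      commIV : ∀ k f u u' w w' S → Injective f → lookup f u ≡ just u' → act k f w ≡ just w' →
               actSet k f (IntroVertex D k u w) ≡ just S → S ≈ˢ IntroVertex D k u' w'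
      commFV : ∀ k f u u' w w' S → Injective f → lookup f u ≡ just u' → act k f w ≡ just w' →
               actSet k f (ForgetVertex D k u w) ≡ just S → S ≈ˢ ForgetVertex D k u' w'
      commIE : ∀ k f u v u' v' w w' S → Injective f → u ≢ v → lookup f u ≡ just u' → lookup f v ≡ just v' →
               act k f w ≡ just w' →
               actSet k f (IntroEdge D k u v w) ≡ just S → S ≈ˢ IntroEdge D k u' v' w'
      commJ : ∀ k f w₁ w₂ w₁' w₂' S → Injective f → act k f w₁ ≡ just w₁' → act k f w₂ ≡ just w₂' →
              actSet k f (Join D k w₁ w₂) ≡ just S → S ≈ˢ Join D k w₁' w₂'

  record WitOrder : Set₁ where
    field
      _<ʷ_ : ∀ {k} → Rel (Wit D k) 0ℓ
      isSTO : ∀ k → IsStrictTotalOrder {A = Wit D k} _≡_ (_<ʷ_ {k})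

data Cmp : Set where
  lt eq gt : Cmp

fromTri : ∀ {a b c : Set} → Tri a b c → Cmp
fromTri (tri< _ _ _) = lt
fromTri (tri≈ _ _ _) = eq
fromTri (tri> _ _ _) = gt

lexCmp : ∀ {A : Set} → (A → A → Cmp) → List A → List A → Cmp
lexCmp c [] [] = eq
lexCmp c [] (_ ∷ _) = lt
lexCmp c (_ ∷ _) [] = gt
lexCmp c (x ∷ xs) (y ∷ ys) with c x y
... | lt = lt
... | gt = gt
... | eq = lexCmp c xs ys

cmpFin : ∀ {n} → Fin n → Fin n → Cmp
cmpFin x y = fromTri (FP.<-cmp x y)

enum : ∀ {n} → Subset n → List (Fin n)
enum {n} b = filter (_∈? b) (allFin n)

State : DPCore → ℕ → Set
State D k = Subset (suc k) × List (Wit D k)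

allVecs : ∀ {A : Set} → List A → (m : ℕ) → List (Vec A m)
allVecs xs zero = [] ∷ []
allVecs xs (suc m) = concatMap (λ x → map (x ∷_) (allVecs xs m)) xs

eqMF : ∀ {n} → Maybe (Fin n) → Maybe (Fin n) → Bool
eqMF (just x) (just y) = ⌊ x F.≟ y ⌋
eqMF _ _ = false

injB : ∀ {k} → Relabel k → Bool
injB {k} f = all (λ x → all (λ x' → ⌊ x F.≟ x' ⌋ ∨ not (eqMF (lookup f x) (lookup f x')))
                             (allFin (suc k))) (allFin (suc k))

eqSub : ∀ {n} → Subset n → Subset n → Bool
eqSub b b' = ⌊ VP.≡-dec Data.Bool._≟_ b b' ⌋
  where import Data.Bool

relabelsWithDom : ∀ {k} → Subset (suc k) → List (Relabel k)
relabelsWithDom {k} b =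
  filter (λ f → T? (eqSub (dom f) b ∧ injB f))
         (allVecs (nothing ∷ map just (allFin (suc k))) (suc k))

permsOf : ∀ {k} → Subset (suc k) → List (Relabel k)
permsOf {k} b = filter (λ f → T? (eqSub (image f b) b)) (relabelsWithDom b)

module Canon (D : DPCore) (O : WitOrder D) (A : WitnessAction D) (k : ℕ) where
  open WitOrder O
  open WitnessAction A
  open IsStrictTotalOrder (isSTO k) using (compare) renaming (_≟_ to _≟ʷ_)

  cmpW : Wit D k → Wit D k → Cmp
  cmpW w w' = fromTri (compare w w')

  insertW : Wit D k → List (Wit D k) → List (Wit D k)
  insertW x [] = x ∷ []
  insertW x (y ∷ ys) with cmpW x y
  ... | lt = x ∷ y ∷ ys
  ... | eq = y ∷ ys
  ... | gt = y ∷ insertW x ys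

  normalize : List (Wit D k) → List (Wit D k)
  normalize = foldr insertW []

  cmpState : State D k → State D k → Cmp
  cmpState (b , S) (b' , S') with lexCmp cmpFin (enum b) (enum b')
  ... | eq = lexCmp cmpW S S'
  ... | c  = c

  minState : State D k → List (State D k) → State D k
  minState d [] = d
  minState d (x ∷ xs) = foldl (λ m y → pick (cmpState y m) y m) x xs
    where
    pick : Cmp → State D k → State D k → State D k
    pick lt y m = y
    pick _  y m = m

  CAN : State D k → State D k
  CAN (b , S) = minState (b , normalize S) (mapMaybe cand (relabelsWithDom b))
    where
    cand : Relabel k → Maybe (State D k)
    cand f = M.map (λ S' → image f b , normalize S') (actSet k f S)

  eqState : State D k → State D k → Bool
  eqState (b , S) (b' , S') = eqSub b b' ∧ ⌊ LP.≡-dec _≟ʷ_ S S' ⌋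

  WellFormed : State D k → Set
  WellFormed (b , S) = LblIn D k S b

  Canonical : State D k → Set
  Canonical s = CAN s ≡ s

  Inconsistent : State D k → Set
  Inconsistent (b , S) = ∀ {w} → w ∈ S → Final D k w ≡ false

  Initial : State D k → Set
  Initial (b , S) = (b ≡ ∅ₛ) × (S ≈ˢ Leaf D k)

  data Derived (prev : List (State D k)) : State D k → Set where
    viaIV : ∀ {bj Sj b S S'} f u → (bj , Sj) ∈ prev → u ∉ₛ bj →
      Injective f → dom f ≡ bj ∪ ⁅ u ⁆ → actSet k f (liftIV D k u Sj) ≡ just S' →
      b ≡ image f (bj ∪ ⁅ u ⁆) → S ≈ˢ S' → Derived prev (b , S)
    viaFV : ∀ {bj Sj b S S'} f u → (bj , Sj) ∈ prev → u ∈ₛ bj →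
      Injective f → dom f ≡ bj - u → actSet k f (liftFV D k u Sj) ≡ just S' →
      b ≡ image f (bj - u) → S ≈ˢ S' → Derived prev (b , S)
    viaIE : ∀ {bj Sj b S S'} f u v → (bj , Sj) ∈ prev → u ≢ v → u ∈ₛ bj → v ∈ₛ bj →
      Injective f → dom f ≡ bj → actSet k f (liftIE D k u v Sj) ≡ just S' →
      b ≡ image f bj → S ≈ˢ S' → Derived prev (b , S)
    viaJ : ∀ {bj Sj Sl T b S S'} f π → (bj , Sj) ∈ prev → (bj , Sl) ∈ prev →
      IsPerm π bj → actSet k π Sl ≡ just T →
      Injective f → dom f ≡ bj → actSet k f (liftJ D k Sj T) ≡ just S' →
      b ≡ image f bj → S ≈ˢ S' → Derived prev (b , S)

  Chain : List (State D k) → List (State D k) → Set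
  Chain prev [] = ⊤
  Chain prev (s ∷ ss) = Derived prev s × Chain (prev ++ s ∷ []) ss

  lastOf : State D k → List (State D k) → State D k
  lastOf s [] = s
  lastOf s (x ∷ xs) = lastOf x xs

  record CanonRefutation (R : List (State D k)) : Set where
    field
      first : State D k
      rest  : List (State D k)
      shape : R ≡ first ∷ rest
      allCanonical  : ∀ {s} → s ∈ R → Canonical s
      allWellFormed : ∀ {s} → s ∈ R → WellFormed s
      firstInitial  : Initial first
      derivations   : Chain (first ∷ []) rest
      lastInconsistent : Inconsistent (lastOf first rest)

  data Output : Set where
    inclusionHolds : Output
    returns : List (State D k) → Output

  Config : Set
  Config = List (State D k) × List (State D k) × List (State D k)

  data StepRes : Set where
    halt : Output → StepRes
    next : Config → StepRes

  hasFinal : List (Wit D k) → Bool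
  hasFinal = any (Final D k)

  toList : ∀ {X : Set} → Maybe X → List X
  toList (just x) = x ∷ []
  toList nothing = []

  successors : List (State D k) → State D k → List (State D k)
  successors R (b , S) =
       map (λ u → b ∪ ⁅ u ⁆ , liftIV D k u S) (filter (λ u → ¬? (u ∈? b)) (allFin (suc k)))
    ++ map (λ u → b - u , liftFV D k u S) (enum b)
    ++ concatMap (λ u → concatMap (λ v → if ⌊ u F.≟ v ⌋ then [] else ((b , liftIE D k u v S) ∷ []))
                                  (enum b)) (enum b)
    ++ concatMap joinsWith R
    where
    joinsWith : State D k → List (State D k)
    joinsWith (b' , S') =
      if eqSub b' b
      then concatMap (λ π → toList (M.map (λ T → b , liftJ D k S T) (actSet k π S'))
                         ++ toList (M.map (λ T → b , liftJ D k S' T) (actSet k π S)))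
                     (permsOf b)
      else []

  memState : State D k → List (State D k) → Bool
  memState x = any (eqState x)

  addAll : List (State D k) → List (State D k) × List (State D k) → List (State D k) × List (State D k)
  addAll [] acc = acc
  addAll (x ∷ xs) (Y , Seen) =
    if memState x Seen then addAll xs (Y , Seen) else addAll xs (Y ++ x ∷ [] , x ∷ Seen)

  step : Config → StepRes
  step (R , [] , Seen) = halt inclusionHolds
  step (R , s ∷ Y , Seen) with R ++ s ∷ []
  ... | R' = if hasFinal (proj₂ s)
             then next (R' , proj₁ (addAll (map CAN (successors R' s)) (Y , Seen))
                           , proj₂ (addAll (map CAN (successors R' s)) (Y , Seen)))
             else halt (returns R')

  initState : State D k
  initState = CAN (∅ₛ , Leaf D k)

  initConfig : Config
  initConfig = [] , initState ∷ [] , initState ∷ []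

  runFrom : ℕ → Config → Maybe Output
  runFrom zero c = nothing
  runFrom (suc n) c with step c
  ... | halt o = just o
  ... | next c' = runFrom n c'

  -- the test run with a step budget n (nothing = budget exhausted)
  RIT : ℕ → Maybe Output
  RIT n = runFrom n initConfig

module Submission where

-- CAN (b , S)
-- is the least relabeling of (b , S), and relabelings commute with all transitions, so CAN is
-- invariant under relabeling.  Canonical states carry sorted witness lists over the finite 𝒲_k,
-- so there are finitely many of them, which bounds the number of iterations.
--
-- Every explored state is the canonized dynamization of some k-instructive term.  Hence an
-- inconsistent state exhibits a rejected term whose graph, by coherence, lies outside 𝒫(D), and
-- the explored states, each obtained from earlier ones by one relabeled step, form a refutation.
-- If no inconsistent state occurs, the explored states are closed under relabeled steps, and by
-- induction on terms they contain the canonized dynamization of every term of 𝒯_k (the canonical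
-- forms of two join arguments have the same bag and differ by a permutation of it), so every
-- such term is accepted.

open import Data.Bool using (Bool; true; false; T; T?; not; _∧_; _∨_; if_then_else_)
open import Data.Bool.Properties using (T-≡; T-∧)
open import Data.Bool.ListAction using (any; all)
open import Data.Empty using (⊥-elim)
open import Data.Fin using (Fin; zero; suc; punchOut)
import Data.Fin as F
import Data.Fin.Properties as FP
open import Data.Fin.Subset using (Subset; ⁅_⁆; _∪_; _-_; _─_)
  renaming (⊥ to ∅ₛ; _∈_ to _∈ₛ_; _∉_ to _∉ₛ_; _⊆_ to _⊆ₛ_)
open import Data.Fin.Subset.Properties
  using (_∈?_; ∉⊥; x∈⁅x⁆; x∈⁅y⁆⇒x≡y; ⊆-antisym; x∈p∪q⁺; x∈p∪q⁻; p⊆p∪q; p─q⊆p; x∈p∧x≢y⇒x∈p-y)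
open import Data.List using (List; []; _∷_; _++_; length; map; concatMap; filter; mapMaybe; foldl; allFin)
open import Data.List.Properties using (length-++; foldl-cong; ++-assoc; ++-identityʳ; ∷-injective)
  renaming (≡-dec to ≡-dec-List)
open import Data.List.Membership.Propositional using (_∈_; _∉_; find; lose)
open import Data.List.Membership.Propositional.Properties
  using (∈-++⁺ˡ; ∈-++⁺ʳ; ∈-++⁻; ∈-∃++; ∈-map⁺; ∈-map⁻; ∈-filter⁺; ∈-filter⁻; ∈-allFin;
         ∈-concatMap⁺; ∈-concatMap⁻)
open import Data.List.Relation.Binary.Subset.Propositional using (_⊆_)
open import Data.List.Relation.Unary.Any using (here; there)
open import Data.List.Relation.Unary.Any.Properties using (any⁺; any⁻)
open import Data.List.Relation.Unary.All using (All; []; _∷_)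
import Data.List.Relation.Unary.All as All
open import Data.List.Relation.Unary.All.Properties using (all⁺; all⁻)
open import Data.List.Relation.Unary.All.Properties.Core using (¬Any⇒All¬)
open import Data.List.Relation.Unary.Unique.Propositional using (Unique)
open import Data.List.Relation.Unary.AllPairs using (AllPairs; []; _∷_)
open import Data.Maybe using (Maybe; just; nothing; is-just; _>>=_)
import Data.Maybe as M
open import Data.Maybe.Properties using (just-injective)
  renaming (≡-dec to ≡-dec-Maybe)
open import Data.Nat using (ℕ; zero; suc; _+_; _≤_; _<_; z≤n; s≤s)
import Data.Nat as ℕ
import Data.Nat.Properties as NP
import Data.List.Membership.DecPropositional as DecMembership
open import Data.Product using (Σ; ∃-syntax; _×_; _,_; proj₁; proj₂)
open import Data.Sum using (_⊎_; inj₁; inj₂; [_,_]′)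
open import Data.Unit using (tt)
open import Data.Vec using (Vec; []; _∷_; lookup; tabulate; here; there)
import Data.Vec as V
import Data.Vec.Properties as VP
open import Function using (_∘_)
open import Function.Bundles using (Equivalence)
open import Relation.Binary using (Trichotomous; Transitive; IsStrictTotalOrder; tri<; tri≈; tri>)
open import Relation.Binary.PropositionalEquality
open import Relation.Nullary using (Dec; yes; no; ¬_; ¬?)
open import Relation.Nullary.Decidable using (⌊_⌋; toWitness; fromWitness)

open import Defs

module _ {A : Set} where

  Unique-length≤ : {xs ys : List A} → Unique xs → xs ⊆ ys → length xs ≤ length ys
  Unique-length≤ {[]} _ _ = z≤n
  Unique-length≤ {x ∷ xs} {ys} (x∉xs ∷ xs!) xs⊆ys with ys₁ , ys₂ , refl ← ∈-∃++ (xs⊆ys (here refl)) =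
    subst (suc (length xs) ≤_) (sym length-split) (s≤s (Unique-length≤ xs! xs⊆ys₁++ys₂))
    where
    length-split : length (ys₁ ++ x ∷ ys₂) ≡ suc (length (ys₁ ++ ys₂))
    length-split = begin
      length (ys₁ ++ x ∷ ys₂)         ≡⟨ length-++ ys₁ ⟩
      length ys₁ + suc (length ys₂)   ≡⟨ NP.+-suc (length ys₁) (length ys₂) ⟩
      suc (length ys₁ + length ys₂)   ≡⟨ cong suc (length-++ ys₁) ⟨
      suc (length (ys₁ ++ ys₂))       ∎
      where open ≡-Reasoning
    xs⊆ys₁++ys₂ : xs ⊆ ys₁ ++ ys₂
    xs⊆ys₁++ys₂ z∈xs with ∈-++⁻ ys₁ (xs⊆ys (there z∈xs))
    ... | inj₁ z∈ys₁ = ∈-++⁺ˡ z∈ys₁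
    ... | inj₂ (here refl) = ⊥-elim (All.lookup x∉xs z∈xs refl)
    ... | inj₂ (there z∈ys₂) = ∈-++⁺ʳ ys₁ z∈ys₂

  ∈-middle-to-front : ∀ (xs : List A) {y ys z} → z ∈ xs ++ y ∷ ys → z ∈ y ∷ xs ++ ys
  ∈-middle-to-front [] z∈ = z∈
  ∈-middle-to-front (x ∷ xs) (here refl) = there (here refl)
  ∈-middle-to-front (x ∷ xs) (there z∈) with ∈-middle-to-front xs z∈
  ... | here refl = here refl
  ... | there z∈′ = there (there z∈′)

  ∈-front-to-middle : ∀ (xs : List A) {y ys z} → z ∈ y ∷ xs ++ ys → z ∈ xs ++ y ∷ ys
  ∈-front-to-middle [] z∈ = z∈
  ∈-front-to-middle (x ∷ xs) (here refl) = there (∈-front-to-middle xs (here refl))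
  ∈-front-to-middle (x ∷ xs) (there (here refl)) = here refl
  ∈-front-to-middle (x ∷ xs) (there (there z∈)) = there (∈-front-to-middle xs (there z∈))

  sublists : List A → List (List A)
  sublists [] = [] ∷ []
  sublists (x ∷ xs) = map (x ∷_) (sublists xs) ++ sublists xs

  filter∈sublists : ∀ {P : A → Set} (P? : ∀ x → Dec (P x)) xs → filter P? xs ∈ sublists xs
  filter∈sublists P? [] = here refl
  filter∈sublists P? (x ∷ xs) with P? x
  ... | yes _ = ∈-++⁺ˡ (∈-map⁺ (x ∷_) (filter∈sublists P? xs))
  ... | no _ = ∈-++⁺ʳ (map (x ∷_) (sublists xs)) (filter∈sublists P? xs)

  ∈-concatMap-intro : ∀ {B : Set} (f : A → List B) {xs x y} → x ∈ xs → y ∈ f x → y ∈ concatMap f xs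
  ∈-concatMap-intro f x∈xs y∈fx = ∈-concatMap⁺ f (lose x∈xs y∈fx)

  ∈-concatMap-elim : ∀ {B : Set} (f : A → List B) xs {y} → y ∈ concatMap f xs → ∃[ x ] x ∈ xs × y ∈ f x
  ∈-concatMap-elim f xs y∈ = find (∈-concatMap⁻ f {xs = xs} y∈)

  ∈-mapMaybe⁺ : ∀ {B : Set} (f : A → Maybe B) {xs x y} → x ∈ xs → f x ≡ just y → y ∈ mapMaybe f xs
  ∈-mapMaybe⁺ f {x ∷ xs} (here refl) fx rewrite fx = here refl
  ∈-mapMaybe⁺ f {x ∷ xs} (there x∈xs) fx with f x
  ... | just _ = there (∈-mapMaybe⁺ f x∈xs fx)
  ... | nothing = ∈-mapMaybe⁺ f x∈xs fx

  ∈-mapMaybe⁻ : ∀ {B : Set} (f : A → Maybe B) xs {y} → y ∈ mapMaybe f xs → ∃[ x ] x ∈ xs × f x ≡ just y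
  ∈-mapMaybe⁻ f (x ∷ xs) y∈ with f x in fx
  ∈-mapMaybe⁻ f (x ∷ xs) (here refl) | just _ = x , here refl , fx
  ∈-mapMaybe⁻ f (x ∷ xs) (there y∈) | just _ =
    let x′ , x′∈ , fx′ = ∈-mapMaybe⁻ f xs y∈ in x′ , there x′∈ , fx′
  ∈-mapMaybe⁻ f (x ∷ xs) y∈ | nothing =
    let x′ , x′∈ , fx′ = ∈-mapMaybe⁻ f xs y∈ in x′ , there x′∈ , fx′

  if-true : ∀ {b : Bool} {x y : A} → b ≡ true → (if b then x else y) ≡ x
  if-true refl = refl

  if-false : ∀ {b : Bool} {x y : A} → b ≡ false → (if b then x else y) ≡ y
  if-false refl = refl

  any-true⁺ : ∀ (p : A → Bool) {xs x} → x ∈ xs → p x ≡ true → any p xs ≡ true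
  any-true⁺ p (here refl) px rewrite px = refl
  any-true⁺ p {y ∷ xs} (there x∈xs) px with p y
  ... | true = refl
  ... | false = any-true⁺ p x∈xs px

  any-true⁻ : ∀ (p : A → Bool) xs → any p xs ≡ true → ∃[ x ] x ∈ xs × p x ≡ true
  any-true⁻ p (x ∷ xs) e with p x in px
  ... | true = x , here refl , px
  ... | false = let y , y∈xs , py = any-true⁻ p xs e in y , there y∈xs , py

  any-false⁻ : ∀ (p : A → Bool) {xs x} → any p xs ≡ false → x ∈ xs → p x ≡ false
  any-false⁻ p {xs} {x} e x∈xs with p x in px
  ... | false = refl
  ... | true with () ← trans (sym (any-true⁺ p x∈xs px)) e

≈ˢ-refl : ∀ {A : Set} {S : List A} → S ≈ˢ S
≈ˢ-refl z = (λ z∈ → z∈) , (λ z∈ → z∈)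

≈ˢ-sym : ∀ {A : Set} {S T : List A} → S ≈ˢ T → T ≈ˢ S
≈ˢ-sym S≈T z = proj₂ (S≈T z) , proj₁ (S≈T z)

≈ˢ-trans : ∀ {A : Set} {S T U : List A} → S ≈ˢ T → T ≈ˢ U → S ≈ˢ U
≈ˢ-trans S≈T T≈U z = proj₁ (T≈U z) ∘ proj₁ (S≈T z) , proj₂ (S≈T z) ∘ proj₂ (T≈U z)

⊆-antisym-≈ˢ : ∀ {A : Set} {S T : List A} → S ⊆ T → T ⊆ S → S ≈ˢ T
⊆-antisym-≈ˢ S⊆T T⊆S z = S⊆T , T⊆S

≈ˢ⇒⊆ : ∀ {A : Set} {S T : List A} → S ≈ˢ T → S ⊆ T
≈ˢ⇒⊆ S≈T {z} = proj₁ (S≈T z)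

≈ˢ⇒⊇ : ∀ {A : Set} {S T : List A} → S ≈ˢ T → T ⊆ S
≈ˢ⇒⊇ S≈T {z} = proj₂ (S≈T z)

module _ {A : Set} where

  concatMap-⊆ : ∀ {B : Set} (f : A → List B) {S T} → S ⊆ T → concatMap f S ⊆ concatMap f T
  concatMap-⊆ f {S} S⊆T y∈ =
    let x , x∈S , y∈fx = ∈-concatMap-elim f S y∈ in ∈-concatMap-intro f (S⊆T x∈S) y∈fx

  concatMap-≈ˢ : ∀ {B : Set} (f : A → List B) {S T} → S ≈ˢ T → concatMap f S ≈ˢ concatMap f T
  concatMap-≈ˢ f S≈T = ⊆-antisym-≈ˢ (concatMap-⊆ f (≈ˢ⇒⊆ S≈T)) (concatMap-⊆ f (≈ˢ⇒⊇ S≈T))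

  concatMap-cong-≈ˢ : ∀ {B : Set} {f g : A → List B} S → (∀ {x} → x ∈ S → f x ≈ˢ g x) →
                      concatMap f S ≈ˢ concatMap g S
  concatMap-cong-≈ˢ {f = f} {g} S f≈g = ⊆-antisym-≈ˢ (pointwise f g (≈ˢ⇒⊆ ∘ f≈g)) (pointwise g f (≈ˢ⇒⊇ ∘ f≈g))
    where
    pointwise : ∀ {B : Set} (f g : A → List B) → (∀ {x} → x ∈ S → f x ⊆ g x) → concatMap f S ⊆ concatMap g S
    pointwise f g f⊆g y∈ = let x , x∈S , y∈fx = ∈-concatMap-elim f S y∈ in ∈-concatMap-intro g x∈S (f⊆g x∈S y∈fx)

module _ {n : ℕ} (p : Fin n → Bool) where

  search : List (Fin n) → Maybe (Fin n)
  search [] = nothing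
  search (x ∷ xs) = if p x then just x else search xs

  search-just : ∀ xs {x} → search xs ≡ just x → p x ≡ true
  search-just (y ∷ xs) e with p y in py
  search-just (y ∷ xs) refl | true = py
  ... | false = search-just xs e

  search-nothing : ∀ xs {x} → search xs ≡ nothing → x ∈ xs → p x ≡ false
  search-nothing (y ∷ xs) e x∈ with p y in py
  search-nothing (y ∷ xs) () x∈ | true
  search-nothing (y ∷ xs) e (here refl) | false = py
  search-nothing (y ∷ xs) e (there x∈) | false = search-nothing xs e x∈

  search-unique : (g : List (Fin n) → Maybe (Fin n)) → g [] ≡ nothing →
                  (∀ x xs → g (x ∷ xs) ≡ (if p x then just x else g xs)) → ∀ xs → g xs ≡ search xs
  search-unique g g[] g∷ [] = g[]
  search-unique g g[] g∷ (x ∷ xs) rewrite g∷ x xs | search-unique g g[] g∷ xs = refl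

-- findFin runs a local search function; the metavariable is solved by that function,
-- which makes it available to search-unique.
mutual
  private
    findFin-loop : ∀ {n} → (Fin n → Bool) → List (Fin n) → Maybe (Fin n)
    findFin-loop = _

  findFin≡search : ∀ {n} (p : Fin n → Bool) → findFin p ≡ search p (allFin n)
  findFin≡search {n} p with allFin n
  ... | xs = search-unique p (findFin-loop p) refl (λ _ _ → refl) xs

findFin-just : ∀ {n} (p : Fin n → Bool) {x} → findFin p ≡ just x → p x ≡ true
findFin-just {n} p e = search-just p (allFin n) (trans (sym (findFin≡search p)) e)

findFin-nothing : ∀ {n} (p : Fin n → Bool) {x} → findFin p ≡ nothing → p x ≡ false
findFin-nothing {n} p {x} e = search-nothing p (allFin n) (trans (sym (findFin≡search p)) e) (∈-allFin x)

x∈p─q⇒x∉q : ∀ {n} {x : Fin n} {p q : Subset n} → x ∈ₛ p ─ q → x ∉ₛ q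
x∈p─q⇒x∉q {x = zero} {_ ∷ _} {true ∷ _} () _
x∈p─q⇒x∉q {x = zero} {_ ∷ _} {false ∷ _} _ ()
x∈p─q⇒x∉q {x = suc x} {_ ∷ _} {_ ∷ _} (there x∈) (there x∈q) = x∈p─q⇒x∉q x∈ x∈q

module _ {n : ℕ} where

  T-lookup⇒∈ₛ : ∀ {b : Subset n} {x} → T (lookup b x) → x ∈ₛ b
  T-lookup⇒∈ₛ {b} {x} t = VP.lookup⇒[]= x b (Equivalence.to T-≡ t)

  ∈ₛ⇒T-lookup : ∀ {b : Subset n} {x} → x ∈ₛ b → T (lookup b x)
  ∈ₛ⇒T-lookup x∈b = Equivalence.from T-≡ (VP.[]=⇒lookup x∈b)

  x∈p-y⁻ : ∀ {x y : Fin n} {p : Subset n} → x ∈ₛ p - y → x ∈ₛ p × x ≢ y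
  x∈p-y⁻ {y = y} {p} x∈ = p─q⊆p p ⁅ y ⁆ x∈ , λ { refl → x∈p─q⇒x∉q x∈ (x∈⁅x⁆ y) }

-- Relabelings

module _ {k : ℕ} where

  Total : Relabel k → Set
  Total f = ∀ x → ∃[ y ] lookup f x ≡ just y

  ∈-dom⁺ : ∀ (f : Relabel k) {x y} → lookup f x ≡ just y → x ∈ₛ dom f
  ∈-dom⁺ f {x} fx = VP.lookup⇒[]= x (dom f) (trans (VP.lookup-map x is-just f) (cong is-just fx))

  ∈-dom⁻ : ∀ (f : Relabel k) {x} → x ∈ₛ dom f → ∃[ y ] lookup f x ≡ just y
  ∈-dom⁻ f {x} x∈ with lookup f x in fx | trans (sym (VP.lookup-map x is-just f)) (VP.[]=⇒lookup x∈)
  ... | just y | _ = y , refl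
  ... | nothing | ()

  Total⇒∈-dom : ∀ {f : Relabel k} → Total f → ∀ x → x ∈ₛ dom f
  Total⇒∈-dom {f} f-total x = ∈-dom⁺ f (proj₂ (f-total x))

  hits⇒≡just : ∀ {m : Maybe (Fin (suc k))} {y} → T (hits m y) → m ≡ just y
  hits⇒≡just {just x} h = cong just (toWitness h)

  hits-refl : ∀ (y : Fin (suc k)) → T (hits (just y) y)
  hits-refl y = fromWitness {a? = y F.≟ y} refl

  image-test : Relabel k → Subset (suc k) → Fin (suc k) → Fin (suc k) → Bool
  image-test f b y x = ⌊ x ∈? b ⌋ ∧ hits (lookup f x) y

  lookup-image : ∀ (f : Relabel k) b y → lookup (image f b) y ≡ any (image-test f b y) (allFin (suc k))
  lookup-image f b y = VP.lookup∘tabulate (λ y → any (image-test f b y) (allFin (suc k))) y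

  ∈-image⁺ : ∀ (f : Relabel k) {b x y} → x ∈ₛ b → lookup f x ≡ just y → y ∈ₛ image f b
  ∈-image⁺ f {b} {x} {y} x∈b fx =
    T-lookup⇒∈ₛ (subst T (sym (lookup-image f b y)) (any⁺ (image-test f b y) (lose (∈-allFin x) test)))
    where
    test : T (image-test f b y x)
    test rewrite fx = Equivalence.from T-∧ (fromWitness x∈b , hits-refl y)

  ∈-image⁻ : ∀ (f : Relabel k) {b y} → y ∈ₛ image f b → ∃[ x ] x ∈ₛ b × lookup f x ≡ just y
  ∈-image⁻ f {b} {y} y∈ =
    let x , _ , test = find (any⁻ (image-test f b y) (allFin (suc k))
                              (subst T (lookup-image f b y) (∈ₛ⇒T-lookup y∈)))
        x∈b , hit = Equivalence.to T-∧ test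
    in x , toWitness x∈b , hits⇒≡just hit

  image-mono : ∀ (f : Relabel k) {b c} → b ⊆ₛ c → image f b ⊆ₛ image f c
  image-mono f b⊆c y∈ = let x , x∈b , fx = ∈-image⁻ f y∈ in ∈-image⁺ f (b⊆c x∈b) fx

  image-∅ : ∀ (f : Relabel k) → image f ∅ₛ ≡ ∅ₛ
  image-∅ f = ⊆-antisym (λ y∈ → ⊥-elim (∉⊥ (proj₁ (proj₂ (∈-image⁻ f y∈))))) (λ y∈ → ⊥-elim (∉⊥ y∈))

  image-∪⁅⁆ : ∀ (f : Relabel k) b {u v} → lookup f u ≡ just v → image f (b ∪ ⁅ u ⁆) ≡ image f b ∪ ⁅ v ⁆
  image-∪⁅⁆ f b {u} {v} fu = ⊆-antisym forth back
    where
    forth : image f (b ∪ ⁅ u ⁆) ⊆ₛ image f b ∪ ⁅ v ⁆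
    forth y∈ with x , x∈ , fx ← ∈-image⁻ f y∈ with x∈p∪q⁻ b ⁅ u ⁆ x∈
    ... | inj₁ x∈b = x∈p∪q⁺ (inj₁ (∈-image⁺ f x∈b fx))
    ... | inj₂ x∈u with refl ← x∈⁅y⁆⇒x≡y u x∈u with refl ← trans (sym fu) fx = x∈p∪q⁺ (inj₂ (x∈⁅x⁆ v))
    back : image f b ∪ ⁅ v ⁆ ⊆ₛ image f (b ∪ ⁅ u ⁆)
    back y∈ with x∈p∪q⁻ (image f b) ⁅ v ⁆ y∈
    ... | inj₁ y∈fb = image-mono f (p⊆p∪q ⁅ u ⁆) y∈fb
    ... | inj₂ y∈v with refl ← x∈⁅y⁆⇒x≡y v y∈v = ∈-image⁺ f (x∈p∪q⁺ (inj₂ (x∈⁅x⁆ u))) fu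

  ∉-image : ∀ (f : Relabel k) {b u v} → Injective f → u ∉ₛ b → lookup f u ≡ just v → v ∉ₛ image f b
  ∉-image f f-inj u∉b fu v∈ with x , x∈b , fx ← ∈-image⁻ f v∈ with refl ← f-inj fx fu = u∉b x∈b

  image-─⁅⁆ : ∀ (f : Relabel k) b {u v} → Injective f → lookup f u ≡ just v → image f (b - u) ≡ image f b - v
  image-─⁅⁆ f b {u} {v} f-inj fu = ⊆-antisym forth back
    where
    forth : image f (b - u) ⊆ₛ image f b - v
    forth y∈ with x , x∈ , fx ← ∈-image⁻ f y∈ with x∈b , x≢u ← x∈p-y⁻ x∈ =
      x∈p∧x≢y⇒x∈p-y (∈-image⁺ f x∈b fx) λ { refl → x≢u (f-inj fx fu) }
    back : image f b - v ⊆ₛ image f (b - u)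
    back y∈ with y∈fb , y≢v ← x∈p-y⁻ y∈ with x , x∈b , fx ← ∈-image⁻ f y∈fb =
      ∈-image⁺ f (x∈p∧x≢y⇒x∈p-y x∈b λ { refl → y≢v (just-injective (trans (sym fx) fu)) }) fx

  image-extends : ∀ {f g : Relabel k} {b} → Extends g f → dom f ≡ b → image g b ≡ image f b
  image-extends {f} {g} g⊇f refl = ⊆-antisym forth back
    where
    forth : image g (dom f) ⊆ₛ image f (dom f)
    forth y∈ with x , x∈ , gx ← ∈-image⁻ g y∈ with z , fx ← ∈-dom⁻ f x∈ with refl ← trans (sym gx) (g⊇f fx) =
      ∈-image⁺ f x∈ fx
    back : image f (dom f) ⊆ₛ image g (dom f)
    back y∈ = let x , x∈ , fx = ∈-image⁻ f y∈ in ∈-image⁺ g x∈ (g⊇f fx)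

  lookup-comp : ∀ (g f : Relabel k) x → lookup (comp g f) x ≡ (lookup f x >>= lookup g)
  lookup-comp g f x = VP.lookup∘tabulate (λ x → lookup f x >>= lookup g) x

  comp-just⁺ : ∀ (g f : Relabel k) {x y z} → lookup f x ≡ just y → lookup g y ≡ just z → lookup (comp g f) x ≡ just z
  comp-just⁺ g f {x} fx gy rewrite lookup-comp g f x | fx = gy

  comp-just⁻ : ∀ (g f : Relabel k) {x z} → lookup (comp g f) x ≡ just z → ∃[ y ] lookup f x ≡ just y × lookup g y ≡ just z
  comp-just⁻ g f {x} gfx rewrite lookup-comp g f x with lookup f x
  ... | just y = y , refl , gfx

  comp-injective : ∀ {g f : Relabel k} → Injective g → Injective f → Injective (comp g f)
  comp-injective {g} {f} g-inj f-inj gfx gfx′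
    with y , fx , gy ← comp-just⁻ g f gfx | y′ , fx′ , gy′ ← comp-just⁻ g f gfx′
    with refl ← g-inj gy gy′ = f-inj fx fx′

  image-comp : ∀ (g f : Relabel k) b → image (comp g f) b ≡ image g (image f b)
  image-comp g f b = ⊆-antisym forth back
    where
    forth : image (comp g f) b ⊆ₛ image g (image f b)
    forth z∈ with x , x∈b , gfx ← ∈-image⁻ (comp g f) z∈ with y , fx , gy ← comp-just⁻ g f gfx =
      ∈-image⁺ g (∈-image⁺ f x∈b fx) gy
    back : image g (image f b) ⊆ₛ image (comp g f) b
    back z∈ with y , y∈ , gy ← ∈-image⁻ g z∈ with x , x∈b , fx ← ∈-image⁻ f y∈ =
      ∈-image⁺ (comp g f) x∈b (comp-just⁺ g f fx gy)

  dom-comp : ∀ (g f : Relabel k) b → Injective f → Total f → dom g ≡ image f b → dom (comp g f) ≡ b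
  dom-comp g f b f-inj f-total dom-g = ⊆-antisym forth back
    where
    forth : dom (comp g f) ⊆ₛ b
    forth {x} x∈ with z , gfx ← ∈-dom⁻ (comp g f) x∈ with y , fx , gy ← comp-just⁻ g f gfx
      with x′ , x′∈b , fx′ ← ∈-image⁻ f (subst (_ ∈ₛ_) dom-g (∈-dom⁺ g gy)) with refl ← f-inj fx fx′ = x′∈b
    back : b ⊆ₛ dom (comp g f)
    back {x} x∈b with y , fx ← f-total x with z , gy ← ∈-dom⁻ g (subst (_ ∈ₛ_) (sym dom-g) (∈-image⁺ f x∈b fx)) =
      ∈-dom⁺ (comp g f) (comp-just⁺ g f fx gy)

  lookup-inv : ∀ (f : Relabel k) y → lookup (inv f) y ≡ findFin (λ x → hits (lookup f x) y)
  lookup-inv f y = VP.lookup∘tabulate (λ y → findFin (λ x → hits (lookup f x) y)) y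

  inv-just⁻ : ∀ (f : Relabel k) {x y} → lookup (inv f) y ≡ just x → lookup f x ≡ just y
  inv-just⁻ f {x} {y} e =
    hits⇒≡just (Equivalence.from T-≡ (findFin-just (λ x → hits (lookup f x) y) (trans (sym (lookup-inv f y)) e)))

  inv-just⁺ : ∀ (f : Relabel k) {x y} → Injective f → lookup f x ≡ just y → lookup (inv f) y ≡ just x
  inv-just⁺ f {x} {y} f-inj fx with findFin (λ x → hits (lookup f x) y) in e
  ... | just x′ = trans (lookup-inv f y) (trans e (cong just (f-inj (inv-just⁻ f (trans (lookup-inv f y) e)) fx)))
  ... | nothing with () ← trans (sym (findFin-nothing (λ x → hits (lookup f x) y) {x} e))
                               (Equivalence.to T-≡ (subst (λ m → T (hits m y)) (sym fx) (hits-refl y)))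

  dom-comp-inv : ∀ (g f : Relabel k) b → Injective f → dom g ≡ b → dom (comp g (inv f)) ≡ image f b
  dom-comp-inv g f b f-inj refl = ⊆-antisym forth back
    where
    forth : dom (comp g (inv f)) ⊆ₛ image f (dom g)
    forth {y} y∈ with z , gf⁻¹y ← ∈-dom⁻ (comp g (inv f)) y∈ with x , f⁻¹y , gx ← comp-just⁻ g (inv f) {y} gf⁻¹y =
      ∈-image⁺ f (∈-dom⁺ g gx) (inv-just⁻ f f⁻¹y)
    back : image f (dom g) ⊆ₛ dom (comp g (inv f))
    back {y} y∈ with x , x∈ , fx ← ∈-image⁻ f y∈ with z , gx ← ∈-dom⁻ g x∈ =
      ∈-dom⁺ (comp g (inv f)) {y} (comp-just⁺ g (inv f) {y} (inv-just⁺ f f-inj fx) gx)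

  comp-inv-injective : ∀ (g f : Relabel k) → Injective g → Injective (comp g (inv f))
  comp-inv-injective g f g-inj {y} {y′} gf⁻¹y gf⁻¹y′
    with x , f⁻¹y , gx ← comp-just⁻ g (inv f) {y} gf⁻¹y | x′ , f⁻¹y′ , gx′ ← comp-just⁻ g (inv f) {y′} gf⁻¹y′
    with refl ← g-inj gx gx′ = just-injective (trans (sym (inv-just⁻ f f⁻¹y)) (inv-just⁻ f f⁻¹y′))

  comp-inv-comp : ∀ (g f : Relabel k) → Injective f → Total f → comp (comp g (inv f)) f ≡ g
  comp-inv-comp g f f-inj f-total = trans (VP.tabulate-cong pointwise) (VP.tabulate∘lookup g)
    where
    pointwise : ∀ x → (lookup f x >>= lookup (comp g (inv f))) ≡ lookup g x
    pointwise x with y , fx ← f-total x rewrite fx | lookup-comp g (inv f) y | inv-just⁺ f f-inj fx = refl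

  restrict : Relabel k → Subset (suc k) → Relabel k
  restrict f b = tabulate λ x → if ⌊ x ∈? b ⌋ then lookup f x else nothing

  lookup-restrict : ∀ (f : Relabel k) b x → lookup (restrict f b) x ≡ (if ⌊ x ∈? b ⌋ then lookup f x else nothing)
  lookup-restrict f b x = VP.lookup∘tabulate (λ x → if ⌊ x ∈? b ⌋ then lookup f x else nothing) x

  restrict-just⁺ : ∀ (f : Relabel k) {b x y} → x ∈ₛ b → lookup f x ≡ just y → lookup (restrict f b) x ≡ just y
  restrict-just⁺ f {b} {x} x∈b fx rewrite lookup-restrict f b x with x ∈? b
  ... | yes _ = fx
  ... | no x∉b = ⊥-elim (x∉b x∈b)

  restrict-just⁻ : ∀ (f : Relabel k) {b x y} → lookup (restrict f b) x ≡ just y → x ∈ₛ b × lookup f x ≡ just y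
  restrict-just⁻ f {b} {x} fx rewrite lookup-restrict f b x with x ∈? b
  ... | yes x∈b = x∈b , fx

  restrict-injective : ∀ (f : Relabel k) b → Injective f → Injective (restrict f b)
  restrict-injective f b f-inj fx fx′ = f-inj (proj₂ (restrict-just⁻ f fx)) (proj₂ (restrict-just⁻ f fx′))

  restrict-extends : ∀ (f : Relabel k) b → Extends f (restrict f b)
  restrict-extends f b fx = proj₂ (restrict-just⁻ f fx)

  dom-restrict : ∀ (f : Relabel k) b → Total f → dom (restrict f b) ≡ b
  dom-restrict f b f-total = ⊆-antisym
    (λ x∈ → let _ , fx = ∈-dom⁻ (restrict f b) x∈ in proj₁ (restrict-just⁻ f fx))
    (λ {x} x∈b → ∈-dom⁺ (restrict f b) (restrict-just⁺ f x∈b (proj₂ (f-total x))))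

  identity : Relabel k
  identity = tabulate just

  identity-injective : Injective identity
  identity-injective {x} {x′} ix ix′ =
    just-injective (trans (trans (sym (VP.lookup∘tabulate just x)) ix) (sym (trans (sym (VP.lookup∘tabulate just x′)) ix′)))

  identity-total : Total identity
  identity-total x = x , VP.lookup∘tabulate just x

  idOn : Subset (suc k) → Relabel k
  idOn = restrict identity

  idOn-injective : ∀ b → Injective (idOn b)
  idOn-injective b = restrict-injective identity b identity-injective

  dom-idOn : ∀ b → dom (idOn b) ≡ b
  dom-idOn b = dom-restrict identity b identity-total

  free-label : ∀ {f : Relabel k} {x} → Injective f → lookup f x ≡ nothing → ∃[ y ] ∀ z → lookup f z ≢ just y
  free-label {f} {x} f-inj fx =
    let y , unhit = FP.¬∀⟶∃¬ (suc k) Hit (λ y → FP.any? (λ z → ≡-dec-Maybe F._≟_ (lookup f z) (just y)))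
                             surjective-impossible
    in y , λ z fz → unhit (z , fz)
    where
    Hit : Fin (suc k) → Set
    Hit y = ∃[ z ] lookup f z ≡ just y
    surjective-impossible : ¬ (∀ y → Hit y)
    surjective-impossible hit = NP.<-irrefl refl (FP.injective⇒≤ {f = squeeze} squeeze-injective)
      where
      preimage≢x : ∀ y → x ≢ proj₁ (hit y)
      preimage≢x y refl with () ← trans (sym fx) (proj₂ (hit y))
      squeeze : Fin (suc k) → Fin k
      squeeze y = punchOut (preimage≢x y)
      squeeze-injective : ∀ {y y′} → squeeze y ≡ squeeze y′ → y ≡ y′
      squeeze-injective {y} {y′} e =
        just-injective (trans (sym (proj₂ (hit y)))
          (trans (cong (lookup f) (FP.punchOut-injective (preimage≢x y) (preimage≢x y′) e)) (proj₂ (hit y′))))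

  extend-at : ∀ {f : Relabel k} → Injective f → ∀ x →
              ∃[ g ] Injective g × Extends g f × ∃[ y ] lookup g x ≡ just y
  extend-at {f} f-inj x with lookup f x in fx
  ... | just y = f , f-inj , (λ e → e) , y , fx
  ... | nothing = g , g-inj , g⊇f , y , g-x
    where
    y = proj₁ (free-label {f} f-inj fx)
    y-free : ∀ z → lookup f z ≢ just y
    y-free = proj₂ (free-label {f} f-inj fx)
    g : Relabel k
    g = f V.[ x ]≔ just y
    g-x : lookup g x ≡ just y
    g-x = VP.lookup∘update x f (just y)
    lookup-g : ∀ z → x ≢ z → lookup g z ≡ lookup f z
    lookup-g z x≢z = VP.lookup∘update′ (x≢z ∘ sym) f (just y)
    g-inj : Injective g
    g-inj {z} {z′} gz gz′ with x F.≟ z | x F.≟ z′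
    ... | yes refl | yes refl = refl
    ... | yes refl | no x≢z′ = ⊥-elim (y-free z′ (trans (sym (lookup-g z′ x≢z′)) (trans gz′ (sym (trans (sym g-x) gz)))))
    ... | no x≢z | yes refl = ⊥-elim (y-free z (trans (sym (lookup-g z x≢z)) (trans gz (sym (trans (sym g-x) gz′)))))
    ... | no x≢z | no x≢z′ = f-inj (trans (sym (lookup-g z x≢z)) gz) (trans (sym (lookup-g z′ x≢z′)) gz′)
    g⊇f : Extends g f
    g⊇f {z} fz with x F.≟ z
    ... | yes refl with () ← trans (sym fx) fz
    ... | no x≢z = trans (lookup-g z x≢z) fz

  total-extension : ∀ {f : Relabel k} → Injective f → ∃[ σ ] Injective σ × Extends σ f × Total σ
  total-extension {f} f-inj =
    let σ , σ-inj , σ⊇f , σ-def = extend-all (allFin (suc k)) in σ , σ-inj , σ⊇f , λ x → σ-def (∈-allFin x)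
    where
    extend-all : ∀ xs → ∃[ σ ] Injective σ × Extends σ f × (∀ {x} → x ∈ xs → ∃[ y ] lookup σ x ≡ just y)
    extend-all [] = f , f-inj , (λ e → e) , λ ()
    extend-all (x ∷ xs) with σ , σ-inj , σ⊇f , σ-def ← extend-all xs with τ , τ-inj , τ⊇σ , τx ← extend-at {σ} σ-inj x =
      τ , τ-inj , τ⊇σ ∘ σ⊇f , λ { (here refl) → τx ; (there x∈) → let y , σx = σ-def x∈ in y , τ⊇σ σx }

  restrict∘inv-isPerm : ∀ {σ₁ σ₂ : Relabel k} b → Injective σ₁ → Total σ₁ → Injective σ₂ → Total σ₂ →
                        image σ₁ b ≡ image σ₂ b → IsPerm (comp (restrict σ₁ b) (inv σ₂)) (image σ₁ b)
  restrict∘inv-isPerm {σ₁} {σ₂} b σ₁-inj σ₁-total σ₂-inj σ₂-total same-image =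
    comp-inv-injective g σ₂ (restrict-injective σ₁ b σ₁-inj) ,
    trans (dom-comp-inv g σ₂ b σ₂-inj dom-g) (sym same-image) ,
    (begin
      image π (image σ₁ b)   ≡⟨ cong (image π) same-image ⟩
      image π (image σ₂ b)   ≡⟨ image-comp π σ₂ b ⟨
      image (comp π σ₂) b    ≡⟨ cong (λ f → image f b) (comp-inv-comp g σ₂ σ₂-inj σ₂-total) ⟩
      image g b              ≡⟨ image-extends {f = g} {g = σ₁} (restrict-extends σ₁ b) dom-g ⟨
      image σ₁ b             ∎)
    where
    g = restrict σ₁ b
    dom-g = dom-restrict σ₁ b σ₁-total
    π = comp g (inv σ₂)
    open ≡-Reasoning

∈-allVecs : ∀ {A : Set} (xs : List A) {m} (v : Vec A m) → (∀ i → lookup v i ∈ xs) → v ∈ allVecs xs m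
∈-allVecs xs [] _ = here refl
∈-allVecs xs (a ∷ v) v⊆xs =
  ∈-concatMap-intro (λ x → map (x ∷_) (allVecs xs _)) (v⊆xs zero) (∈-map⁺ (a ∷_) (∈-allVecs xs v (v⊆xs ∘ suc)))

module _ {k : ℕ} where

  injB⇒Injective : ∀ (f : Relabel k) → T (injB f) → Injective f
  injB⇒Injective f t {x} {x′} {y} fx fx′ =
    separated (All.lookup (all⁺ (separated? x) _ (All.lookup (all⁺ (λ x → all (separated? x) all-labels) _ t) (∈-allFin x)))
                          (∈-allFin x′))
    where
    all-labels = allFin (suc k)
    separated? : Fin (suc k) → Fin (suc k) → Bool
    separated? x x′ = ⌊ x F.≟ x′ ⌋ ∨ not (eqMF (lookup f x) (lookup f x′))
    separated : T (separated? x x′) → x ≡ x′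
    separated t′ with x F.≟ x′
    ... | yes x≡x′ = x≡x′
    ... | no _ rewrite fx | fx′ with y F.≟ y
    ...   | yes _ = ⊥-elim t′
    ...   | no y≢y = ⊥-elim (y≢y refl)

  Injective⇒injB : ∀ (f : Relabel k) → Injective f → T (injB f)
  Injective⇒injB f f-inj =
    all⁻ (λ x → all (separated? x) (allFin (suc k)))
      (All.tabulate {xs = allFin (suc k)} λ {x} _ →
        all⁻ (separated? x) (All.tabulate {xs = allFin (suc k)} λ {x′} _ → separated x x′))
    where
    separated? : Fin (suc k) → Fin (suc k) → Bool
    separated? x x′ = ⌊ x F.≟ x′ ⌋ ∨ not (eqMF (lookup f x) (lookup f x′))
    separated : ∀ x x′ → T (⌊ x F.≟ x′ ⌋ ∨ not (eqMF (lookup f x) (lookup f x′)))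
    separated x x′ with x F.≟ x′ | lookup f x in fx | lookup f x′ in fx′
    ... | yes _ | _ | _ = _
    ... | no _ | nothing | _ = _
    ... | no _ | just y | nothing = _
    ... | no x≢x′ | just y | just y′ with y F.≟ y′
    ...   | yes refl = ⊥-elim (x≢x′ (f-inj fx fx′))
    ...   | no _ = _

  all-relabelings : List (Relabel k)
  all-relabelings = allVecs (nothing ∷ map just (allFin (suc k))) (suc k)

  ∈-relabelsWithDom⁺ : ∀ (f : Relabel k) {b} → dom f ≡ b → Injective f → f ∈ relabelsWithDom b
  ∈-relabelsWithDom⁺ f refl f-inj =
    ∈-filter⁺ (λ g → T? (eqSub (dom g) (dom f) ∧ injB g))
      (∈-allVecs _ f (λ i → any-label (lookup f i)))
      (Equivalence.from (T-∧ {eqSub (dom f) (dom f)} {injB f}) (fromWitness refl , Injective⇒injB f f-inj))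
    where
    any-label : ∀ m → m ∈ nothing ∷ map just (allFin (suc k))
    any-label nothing = here refl
    any-label (just y) = there (∈-map⁺ just (∈-allFin y))

  ∈-relabelsWithDom⁻ : ∀ {f : Relabel k} b → f ∈ relabelsWithDom b → dom f ≡ b × Injective f
  ∈-relabelsWithDom⁻ {f} b f∈ =
    let dom-ok , inj-ok = Equivalence.to (T-∧ {eqSub (dom f) b} {injB f})
                            (proj₂ (∈-filter⁻ (λ f → T? (eqSub (dom f) b ∧ injB f)) {xs = all-relabelings} f∈))
    in toWitness dom-ok , injB⇒Injective f inj-ok

  ∈-permsOf⁺ : ∀ (π : Relabel k) {b} → IsPerm π b → π ∈ permsOf b
  ∈-permsOf⁺ π {b} (π-inj , dom-π , image-π) =
    ∈-filter⁺ (λ f → T? (eqSub (image f b) b)) (∈-relabelsWithDom⁺ π dom-π π-inj) (fromWitness image-π)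

  ∈-permsOf⁻ : ∀ {π : Relabel k} b → π ∈ permsOf b → IsPerm π b
  ∈-permsOf⁻ b π∈ =
    let π∈′ , image-ok = ∈-filter⁻ (λ f → T? (eqSub (image f b) b)) {xs = relabelsWithDom b} π∈
        dom-π , π-inj = ∈-relabelsWithDom⁻ b π∈′
    in π-inj , dom-π , toWitness image-ok

record IsComparison {A : Set} (c : A → A → Cmp) : Set where
  field
    eq⇒≡ : ∀ {x y} → c x y ≡ eq → x ≡ y
    eq-refl : ∀ x → c x x ≡ eq
    lt⇒gt : ∀ {x y} → c x y ≡ lt → c y x ≡ gt
    gt⇒lt : ∀ {x y} → c x y ≡ gt → c y x ≡ lt
    lt-trans : ∀ {x y z} → c x y ≡ lt → c y z ≡ lt → c x z ≡ lt

cmp-irrefl : ∀ {A : Set} {c : A → A → Cmp} → IsComparison c → ∀ {x} → c x x ≢ lt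
cmp-irrefl c-ok {x} e with () ← trans (sym (IsComparison.eq-refl c-ok x)) e

module _ {A : Set} {_<_ : A → A → Set} (cmp : Trichotomous _≡_ _<_) (<-trans : Transitive _<_) where

  private
    c : A → A → Cmp
    c x y = fromTri (cmp x y)

    lt⇒< : ∀ {x y} → c x y ≡ lt → x < y
    lt⇒< {x} {y} e with cmp x y
    ... | tri< x<y _ _ = x<y

    gt⇒> : ∀ {x y} → c x y ≡ gt → y < x
    gt⇒> {x} {y} e with cmp x y
    ... | tri> _ _ y<x = y<x

    <⇒lt : ∀ {x y} → x < y → c x y ≡ lt
    <⇒lt {x} {y} x<y with cmp x y
    ... | tri< _ _ _ = refl
    ... | tri≈ x≮y _ _ = ⊥-elim (x≮y x<y)
    ... | tri> x≮y _ _ = ⊥-elim (x≮y x<y)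

  fromTri-isComparison : IsComparison (λ x y → fromTri (cmp x y))
  fromTri-isComparison = record
    { eq⇒≡ = eq⇒≡ ; eq-refl = eq-refl ; lt⇒gt = lt⇒gt ; gt⇒lt = <⇒lt ∘ gt⇒> ; lt-trans = λ e e′ → <⇒lt (<-trans (lt⇒< e) (lt⇒< e′)) }
    where
    eq⇒≡ : ∀ {x y} → c x y ≡ eq → x ≡ y
    eq⇒≡ {x} {y} e with cmp x y
    ... | tri≈ _ x≡y _ = x≡y
    eq-refl : ∀ x → c x x ≡ eq
    eq-refl x with cmp x x
    ... | tri< _ x≢x _ = ⊥-elim (x≢x refl)
    ... | tri≈ _ _ _ = refl
    ... | tri> _ x≢x _ = ⊥-elim (x≢x refl)
    lt⇒gt : ∀ {x y} → c x y ≡ lt → c y x ≡ gt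
    lt⇒gt {x} {y} e with lt⇒< {x} {y} e | cmp y x
    ... | x<y | tri< _ _ x≮y = ⊥-elim (x≮y x<y)
    ... | x<y | tri≈ _ _ x≮y = ⊥-elim (x≮y x<y)
    ... | x<y | tri> _ _ _ = refl

lexCmp-isComparison : ∀ {A : Set} {c : A → A → Cmp} → IsComparison c → IsComparison (lexCmp c)
lexCmp-isComparison {A} {c} c-ok = record
  { eq⇒≡ = λ {xs} {ys} → eq⇒≡ {xs} {ys} ; eq-refl = eq-refl ; lt⇒gt = λ {xs} {ys} → lt⇒gt {xs} {ys}
  ; gt⇒lt = λ {xs} {ys} → gt⇒lt {xs} {ys} ; lt-trans = λ {xs} {ys} {zs} → lt-trans {xs} {ys} {zs} }
  where
  module C = IsComparison c-ok
  eq⇒≡ : ∀ {xs ys} → lexCmp c xs ys ≡ eq → xs ≡ ys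
  eq⇒≡ {[]} {[]} e = refl
  eq⇒≡ {x ∷ xs} {y ∷ ys} e with c x y in exy
  ... | eq = cong₂ _∷_ (C.eq⇒≡ exy) (eq⇒≡ e)
  eq-refl : ∀ xs → lexCmp c xs xs ≡ eq
  eq-refl [] = refl
  eq-refl (x ∷ xs) rewrite C.eq-refl x = eq-refl xs
  lt⇒gt : ∀ {xs ys} → lexCmp c xs ys ≡ lt → lexCmp c ys xs ≡ gt
  lt⇒gt {[]} {_ ∷ _} e = refl
  lt⇒gt {x ∷ xs} {y ∷ ys} e with c x y in exy
  ... | lt rewrite C.lt⇒gt exy = refl
  ... | eq rewrite C.eq⇒≡ exy | C.eq-refl y = lt⇒gt {xs} {ys} e
  gt⇒lt : ∀ {xs ys} → lexCmp c xs ys ≡ gt → lexCmp c ys xs ≡ lt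
  gt⇒lt {_ ∷ _} {[]} e = refl
  gt⇒lt {x ∷ xs} {y ∷ ys} e with c x y in exy
  ... | gt rewrite C.gt⇒lt exy = refl
  ... | eq rewrite C.eq⇒≡ exy | C.eq-refl y = gt⇒lt {xs} {ys} e
  lt-trans : ∀ {xs ys zs} → lexCmp c xs ys ≡ lt → lexCmp c ys zs ≡ lt → lexCmp c xs zs ≡ lt
  lt-trans {[]} {_ ∷ _} {_ ∷ _} e e′ = refl
  lt-trans {x ∷ xs} {y ∷ ys} {z ∷ zs} e e′ with c x y in exy | c y z in eyz
  ... | lt | lt rewrite C.lt-trans exy eyz = refl
  ... | lt | eq rewrite sym (C.eq⇒≡ eyz) | exy = refl
  ... | eq | lt rewrite C.eq⇒≡ exy | eyz = refl
  ... | eq | eq rewrite C.eq⇒≡ exy | C.eq⇒≡ eyz | C.eq-refl z = lt-trans {xs} {ys} {zs} e e′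

_then_ : Cmp → Cmp → Cmp
lt then _ = lt
eq then c = c
gt then _ = gt

then-isComparison : ∀ {A B : Set} {c : A → A → Cmp} {d : B → B → Cmp} → IsComparison c → IsComparison d →
                    IsComparison (λ (p q : A × B) → c (proj₁ p) (proj₁ q) then d (proj₂ p) (proj₂ q))
then-isComparison {c = c} {d} c-ok d-ok = record
  { eq⇒≡ = λ {p} {q} → eq⇒≡ p q ; eq-refl = eq-refl ; lt⇒gt = λ {p} {q} → lt⇒gt p q ; gt⇒lt = λ {p} {q} → gt⇒lt p q
  ; lt-trans = λ {p} {q} {r} → lt-trans p q r }
  where
  module C = IsComparison c-ok
  module D = IsComparison d-ok
  eq⇒≡ : ∀ p q → (c (proj₁ p) (proj₁ q) then d (proj₂ p) (proj₂ q)) ≡ eq → p ≡ q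
  eq⇒≡ (a , s) (a′ , s′) e with c a a′ in e₁
  ... | eq = cong₂ _,_ (C.eq⇒≡ e₁) (D.eq⇒≡ e)
  eq-refl : ∀ p → (c (proj₁ p) (proj₁ p) then d (proj₂ p) (proj₂ p)) ≡ eq
  eq-refl (a , s) rewrite C.eq-refl a = D.eq-refl s
  lt⇒gt : ∀ p q → (c (proj₁ p) (proj₁ q) then d (proj₂ p) (proj₂ q)) ≡ lt →
          (c (proj₁ q) (proj₁ p) then d (proj₂ q) (proj₂ p)) ≡ gt
  lt⇒gt (a , s) (a′ , s′) e with c a a′ in e₁
  ... | lt rewrite C.lt⇒gt e₁ = refl
  ... | eq rewrite C.eq⇒≡ e₁ | C.eq-refl a′ = D.lt⇒gt e
  gt⇒lt : ∀ p q → (c (proj₁ p) (proj₁ q) then d (proj₂ p) (proj₂ q)) ≡ gt →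
          (c (proj₁ q) (proj₁ p) then d (proj₂ q) (proj₂ p)) ≡ lt
  gt⇒lt (a , s) (a′ , s′) e with c a a′ in e₁
  ... | gt rewrite C.gt⇒lt e₁ = refl
  ... | eq rewrite C.eq⇒≡ e₁ | C.eq-refl a′ = D.gt⇒lt e
  lt-trans : ∀ p q r → (c (proj₁ p) (proj₁ q) then d (proj₂ p) (proj₂ q)) ≡ lt →
             (c (proj₁ q) (proj₁ r) then d (proj₂ q) (proj₂ r)) ≡ lt →
             (c (proj₁ p) (proj₁ r) then d (proj₂ p) (proj₂ r)) ≡ lt
  lt-trans (a , s) (a′ , s′) (a″ , s″) e e′ with c a a′ in e₁ | c a′ a″ in e₂
  ... | lt | lt rewrite C.lt-trans e₁ e₂ = refl
  ... | lt | eq rewrite sym (C.eq⇒≡ e₂) | e₁ = refl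
  ... | eq | lt rewrite C.eq⇒≡ e₁ | e₂ = refl
  ... | eq | eq rewrite C.eq⇒≡ e₁ | C.eq⇒≡ e₂ | C.eq-refl a″ = D.lt-trans e e′

pullback-isComparison : ∀ {A B : Set} {c : B → B → Cmp} {c′ : A → A → Cmp} (e : A → B) →
                        (∀ {x y} → e x ≡ e y → x ≡ y) → (∀ x y → c′ x y ≡ c (e x) (e y)) →
                        IsComparison c → IsComparison c′
pullback-isComparison {c = c} {c′} e e-inj c′≡c c-ok = record
  { eq⇒≡ = λ {x} {y} ex → e-inj (C.eq⇒≡ (trans (sym (c′≡c x y)) ex))
  ; eq-refl = λ x → trans (c′≡c x x) (C.eq-refl (e x))
  ; lt⇒gt = λ {x} {y} ex → trans (c′≡c y x) (C.lt⇒gt (trans (sym (c′≡c x y)) ex))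
  ; gt⇒lt = λ {x} {y} ex → trans (c′≡c y x) (C.gt⇒lt (trans (sym (c′≡c x y)) ex))
  ; lt-trans = λ {x} {y} {z} ex ey → trans (c′≡c x z) (C.lt-trans (trans (sym (c′≡c x y)) ex) (trans (sym (c′≡c y z)) ey)) }
  where module C = IsComparison c-ok

module NotAbove {A : Set} {c : A → A → Cmp} (c-ok : IsComparison c) where
  open IsComparison c-ok

  record _≼_ (x y : A) : Set where
    constructor ≼-intro
    field ≢gt : c x y ≢ gt

  ≼-refl : ∀ x → x ≼ x
  ≼-refl x = ≼-intro λ e → case (trans (sym (eq-refl x)) e)
    where case : eq ≢ gt
          case ()

  lt⇒≼ : ∀ {x y} → c x y ≡ lt → x ≼ y
  lt⇒≼ e = ≼-intro λ e′ → case (trans (sym e) e′)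
    where case : lt ≢ gt
          case ()

  ≼-cases : ∀ {x y} → x ≼ y → c x y ≡ lt ⊎ x ≡ y
  ≼-cases {x} {y} (≼-intro x≯y) with c x y in e
  ... | lt = inj₁ refl
  ... | eq = inj₂ (eq⇒≡ e)
  ... | gt = ⊥-elim (x≯y refl)

  ≼-trans : ∀ {x y z} → x ≼ y → y ≼ z → x ≼ z
  ≼-trans x≼y y≼z with ≼-cases x≼y | ≼-cases y≼z
  ... | inj₂ refl | _ = y≼z
  ... | inj₁ _ | inj₂ refl = x≼y
  ... | inj₁ x<y | inj₁ y<z = lt⇒≼ (lt-trans x<y y<z)

  ≼-antisym : ∀ {x y} → x ≼ y → y ≼ x → x ≡ y
  ≼-antisym x≼y (≼-intro y≯x) with ≼-cases x≼y
  ... | inj₁ x<y = ⊥-elim (y≯x (lt⇒gt x<y))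
  ... | inj₂ x≡y = x≡y

-- G(τ) is a graph

≤maxL : ∀ {x xs} → x ∈ xs → x ≤ maxL xs
≤maxL {xs = y ∷ ys} (here refl) = NP.m≤m⊔n y (maxL ys)
≤maxL {xs = y ∷ ys} (there x∈) = NP.≤-trans (≤maxL x∈) (NP.m≤n⊔m y (maxL ys))

<fresh : ∀ {x xs} → x ∈ xs → x < fresh xs
<fresh x∈ = s≤s (≤maxL x∈)

fresh∉ : ∀ xs → fresh xs ∉ xs
fresh∉ xs x∈ = NP.<-irrefl refl (<fresh x∈)

+fresh≢ : ∀ {x y zs} → y ∈ zs → x + fresh zs ≢ y
+fresh≢ {x} y∈ refl = NP.<-irrefl refl (NP.<-≤-trans (<fresh y∈) (NP.m≤n+m _ x))

hitsℕ-just⁻ : ∀ {m x} → hitsℕ m x ≡ true → m ≡ just x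
hitsℕ-just⁻ {just y} {x} e with y ℕ.≟ x
... | yes refl = refl

update-≢ : ∀ {k} (l : Labeling k) u m {v} → v ≢ u → update l u m v ≡ l v
update-≢ l u m {v} v≢u with v F.≟ u
... | yes v≡u = ⊥-elim (v≢u v≡u)
... | no _ = refl

record WellLabelled {k} (b : Subset (suc k)) (G : Graph) (l : Labeling k) : Set where
  field
    isGraph : IsGraph G
    label∈V : ∀ {u x} → l u ≡ just x → x ∈ V G
    label-injective : ∀ {u u′ x} → l u ≡ just x → l u′ ≡ just x → u ≡ u′
    labelled : ∀ {u} → u ∈ₛ b → ∃[ x ] l u ≡ just x
    unlabelled : ∀ {u} → u ∉ₛ b → l u ≡ nothing

open IsGraph

module _ {k : ℕ} where

  leaf-wellLabelled : WellLabelled {k} ∅ₛ (mkGraph [] [] []) (λ _ → nothing)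
  leaf-wellLabelled = record
    { isGraph = record { inc-dom = λ () ; two-ends = λ () }
    ; label∈V = λ () ; label-injective = λ () ; labelled = λ u∈ → ⊥-elim (∉⊥ u∈) ; unlabelled = λ _ → refl }

  introV-wellLabelled : ∀ {b : Subset (suc k)} {Vs Es ρs l u} → WellLabelled b (mkGraph Vs Es ρs) l → u ∉ₛ b →
                        WellLabelled (b ∪ ⁅ u ⁆) (mkGraph (fresh Vs ∷ Vs) Es ρs) (update l u (just (fresh Vs)))
  introV-wellLabelled {b} {Vs} {Es} {ρs} {l} {u} wl u∉b = record
    { isGraph = record { inc-dom = λ e∈ → let e∈E , v∈V = inc-dom isGraph e∈ in e∈E , there v∈V
                       ; two-ends = two-ends isGraph }
    ; label∈V = label∈V′ ; label-injective = label-injective′ ; labelled = labelled′ ; unlabelled = unlabelled′ }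
    where
    open WellLabelled wl
    l′ = update l u (just (fresh Vs))
    label∈V′ : ∀ {v x} → l′ v ≡ just x → x ∈ fresh Vs ∷ Vs
    label∈V′ {v} e with v F.≟ u
    label∈V′ refl | yes _ = here refl
    ... | no _ = there (label∈V e)
    label-injective′ : ∀ {v v′ x} → l′ v ≡ just x → l′ v′ ≡ just x → v ≡ v′
    label-injective′ {v} {v′} e e′ with v F.≟ u | v′ F.≟ u
    ... | yes refl | yes refl = refl
    label-injective′ refl e′ | yes _ | no _ = ⊥-elim (fresh∉ Vs (label∈V e′))
    label-injective′ e refl | no _ | yes _ = ⊥-elim (fresh∉ Vs (label∈V e))
    ... | no _ | no _ = label-injective e e′
    labelled′ : ∀ {v} → v ∈ₛ b ∪ ⁅ u ⁆ → ∃[ x ] l′ v ≡ just x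
    labelled′ {v} v∈ with v F.≟ u | x∈p∪q⁻ b ⁅ u ⁆ v∈
    ... | yes _ | _ = fresh Vs , refl
    ... | no _ | inj₁ v∈b = labelled v∈b
    ... | no v≢u | inj₂ v∈u = ⊥-elim (v≢u (x∈⁅y⁆⇒x≡y u v∈u))
    unlabelled′ : ∀ {v} → v ∉ₛ b ∪ ⁅ u ⁆ → l′ v ≡ nothing
    unlabelled′ {v} v∉ with v F.≟ u
    ... | yes refl = ⊥-elim (v∉ (x∈p∪q⁺ (inj₂ (x∈⁅x⁆ u))))
    ... | no _ = unlabelled (v∉ ∘ x∈p∪q⁺ ∘ inj₁)

  forgetV-wellLabelled : ∀ {b : Subset (suc k)} {G l u} → WellLabelled b G l → WellLabelled (b - u) G (update l u nothing)
  forgetV-wellLabelled {b} {G} {l} {u} wl = record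
    { isGraph = isGraph ; label∈V = label∈V′ ; label-injective = label-injective′
    ; labelled = labelled′ ; unlabelled = unlabelled′ }
    where
    open WellLabelled wl
    l′ = update l u nothing
    label∈V′ : ∀ {v x} → l′ v ≡ just x → x ∈ V G
    label∈V′ {v} e with v F.≟ u
    ... | no _ = label∈V e
    label-injective′ : ∀ {v v′ x} → l′ v ≡ just x → l′ v′ ≡ just x → v ≡ v′
    label-injective′ {v} {v′} e e′ with v F.≟ u | v′ F.≟ u
    ... | no _ | no _ = label-injective e e′
    labelled′ : ∀ {v} → v ∈ₛ b - u → ∃[ x ] l′ v ≡ just x
    labelled′ {v} v∈ with v∈b , v≢u ← x∈p-y⁻ v∈ rewrite update-≢ l u nothing v≢u = labelled v∈b
    unlabelled′ : ∀ {v} → v ∉ₛ b - u → l′ v ≡ nothing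
    unlabelled′ {v} v∉ with v F.≟ u
    ... | yes _ = refl
    ... | no v≢u = unlabelled (λ v∈b → v∉ (x∈p∧x≢y⇒x∈p-y v∈b v≢u))

  introE-wellLabelled : ∀ {b : Subset (suc k)} {Vs Es ρs l u v x y} → WellLabelled b (mkGraph Vs Es ρs) l → u ≢ v →
                        l u ≡ just x → l v ≡ just y →
                        WellLabelled b (mkGraph Vs (fresh Es ∷ Es) ((fresh Es , x) ∷ (fresh Es , y) ∷ ρs)) l
  introE-wellLabelled {b} {Vs} {Es} {ρs} {l} {u} {v} {x} {y} wl u≢v lu lv = record
    { isGraph = record { inc-dom = inc-dom′ ; two-ends = two-ends′ }
    ; label∈V = label∈V ; label-injective = label-injective ; labelled = labelled ; unlabelled = unlabelled }
    where
    open WellLabelled wl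
    e₀ = fresh Es
    ρ′ = (e₀ , x) ∷ (e₀ , y) ∷ ρs
    inc-dom′ : ∀ {e w} → (e , w) ∈ ρ′ → (e ∈ e₀ ∷ Es) × (w ∈ Vs)
    inc-dom′ (here refl) = here refl , label∈V lu
    inc-dom′ (there (here refl)) = here refl , label∈V lv
    inc-dom′ (there (there ew∈)) = let e∈ , w∈ = inc-dom isGraph ew∈ in there e∈ , w∈
    two-ends′ : ∀ {e} → e ∈ e₀ ∷ Es → ∃[ a ] ∃[ c ] (a ≢ c) × ((e , a) ∈ ρ′) × ((e , c) ∈ ρ′)
                  × (∀ z → (e , z) ∈ ρ′ → (z ≡ a) ⊎ (z ≡ c))
    two-ends′ (here refl) = x , y , (λ { refl → u≢v (label-injective lu lv) }) , here refl , there (here refl) , only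
      where
      only : ∀ z → (e₀ , z) ∈ ρ′ → (z ≡ x) ⊎ (z ≡ y)
      only z (here refl) = inj₁ refl
      only z (there (here refl)) = inj₂ refl
      only z (there (there e₀z∈)) = ⊥-elim (fresh∉ Es (proj₁ (inc-dom isGraph e₀z∈)))
    two-ends′ {e} (there e∈) with a , c , a≢c , a∈ , c∈ , only ← two-ends isGraph e∈ =
      a , c , a≢c , there (there a∈) , there (there c∈) , only′
      where
      only′ : ∀ z → (e , z) ∈ ρ′ → (z ≡ a) ⊎ (z ≡ c)
      only′ z (here refl) = ⊥-elim (fresh∉ Es e∈)
      only′ z (there (here refl)) = ⊥-elim (fresh∉ Es e∈)
      only′ z (there (there ez∈)) = only z ez∈

-- A nameable copy of the vertex renaming local to the join clause of build.
joinVertex : ∀ {k} → Labeling k → Labeling k → ℕ → ℕ → ℕ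
joinVertex l₁ l₂ oV x with findFin (λ u → hitsℕ (l₂ u) x)
... | nothing = x + oV
... | just u with l₁ u
...   | just y = y
...   | nothing = x + oV

module JoinWellLabelled {k : ℕ} {b : Subset (suc k)} {V₁ E₁ V₂ E₂ : List ℕ} {ρ₁ ρ₂ : List (ℕ × ℕ)} {l₁ l₂ : Labeling k}
  (wl₁ : WellLabelled b (mkGraph V₁ E₁ ρ₁) l₁) (wl₂ : WellLabelled b (mkGraph V₂ E₂ ρ₂) l₂)
  (F : ℕ × ℕ → ℕ × ℕ) (F-spec : ∀ e z → F (e , z) ≡ (e + fresh E₁ , joinVertex l₁ l₂ (fresh V₁) z)) where

  private
    module W₁ = WellLabelled wl₁
    module W₂ = WellLabelled wl₂
    oV = fresh V₁
    oE = fresh E₁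
    labelOf : ℕ → Maybe (Fin (suc k))
    labelOf x = findFin (λ u → hitsℕ (l₂ u) x)
    unshared? : (x : ℕ) → Dec (¬ T (is-just (labelOf x)))
    unshared? x = ¬? (T? (is-just (labelOf x)))
    ren = joinVertex l₁ l₂ oV
    V′ = V₁ ++ map (_+ oV) (filter unshared? V₂)
    E′ = E₁ ++ map (_+ oE) E₂
    ρ′ = ρ₁ ++ map F ρ₂

    data RenView (x : ℕ) : ℕ → Set where
      unshared : labelOf x ≡ nothing → RenView x (x + oV)
      shared : ∀ {u y} → l₂ u ≡ just x → l₁ u ≡ just y → RenView x y

    ren-view : ∀ x → RenView x (ren x)
    ren-view x with findFin (λ u → hitsℕ (l₂ u) x) in e
    ... | nothing = unshared e
    ... | just u with l₂u ← hitsℕ-just⁻ (findFin-just (λ u → hitsℕ (l₂ u) x) e) with l₁ u in l₁u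
    ...   | just y = shared l₂u l₁u
    ...   | nothing with u ∈? b
    ...     | yes u∈b with () ← trans (sym l₁u) (proj₂ (W₁.labelled u∈b))
    ...     | no u∉b with () ← trans (sym (W₂.unlabelled u∉b)) l₂u

    ren∈V′ : ∀ {x} → x ∈ V₂ → ren x ∈ V′
    ren∈V′ {x} x∈ with ren x | ren-view x
    ... | _ | unshared e = ∈-++⁺ʳ V₁ (∈-map⁺ (_+ oV) (∈-filter⁺ unshared? x∈ (subst (λ m → ¬ T (is-just m)) (sym e) λ ())))
    ... | _ | shared _ l₁u = ∈-++⁺ˡ (W₁.label∈V l₁u)

    ren-injective : ∀ {x x′} → ren x ≡ ren x′ → x ≡ x′
    ren-injective {x} {x′} e with ren x | ren-view x | ren x′ | ren-view x′
    ... | _ | unshared _ | _ | unshared _ = NP.+-cancelʳ-≡ oV x x′ e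
    ... | _ | unshared _ | _ | shared _ l₁u = ⊥-elim (+fresh≢ (W₁.label∈V l₁u) e)
    ... | _ | shared _ l₁u | _ | unshared _ = ⊥-elim (+fresh≢ (W₁.label∈V l₁u) (sym e))
    ... | _ | shared l₂u l₁u | _ | shared l₂u′ l₁u′ with refl ← e with refl ← W₁.label-injective l₁u l₁u′ =
      just-injective (trans (sym l₂u) l₂u′)

    F∈ρ′ : ∀ {e z} → (e , z) ∈ ρ₂ → (e + oE , ren z) ∈ ρ′
    F∈ρ′ {e} {z} ez∈ = ∈-++⁺ʳ ρ₁ (subst (_∈ map F ρ₂) (F-spec e z) (∈-map⁺ F ez∈))

    F∈ρ′⁻ : ∀ {e w} → (e , w) ∈ map F ρ₂ → ∃[ e₂ ] ∃[ z ] (e₂ , z) ∈ ρ₂ × e ≡ e₂ + oE × w ≡ ren z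
    F∈ρ′⁻ ew∈ with (e₂ , z) , e₂z∈ , ew≡ ← ∈-map⁻ F ew∈ with refl ← trans ew≡ (F-spec e₂ z) = e₂ , z , e₂z∈ , refl , refl

    inc-dom′ : ∀ {e w} → (e , w) ∈ ρ′ → (e ∈ E′) × (w ∈ V′)
    inc-dom′ ew∈ with ∈-++⁻ ρ₁ ew∈
    ... | inj₁ ew∈ρ₁ = let e∈ , w∈ = inc-dom W₁.isGraph ew∈ρ₁ in ∈-++⁺ˡ e∈ , ∈-++⁺ˡ w∈
    ... | inj₂ ew∈Fρ₂ with e₂ , z , e₂z∈ , refl , refl ← F∈ρ′⁻ ew∈Fρ₂ =
      let e₂∈ , z∈ = inc-dom W₂.isGraph e₂z∈ in ∈-++⁺ʳ E₁ (∈-map⁺ (_+ oE) e₂∈) , ren∈V′ z∈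

    two-ends′ : ∀ {e} → e ∈ E′ → ∃[ a ] ∃[ c ] (a ≢ c) × ((e , a) ∈ ρ′) × ((e , c) ∈ ρ′)
                  × (∀ z → (e , z) ∈ ρ′ → (z ≡ a) ⊎ (z ≡ c))
    two-ends′ {e} e∈ with ∈-++⁻ E₁ e∈
    ... | inj₁ e∈E₁ with a , c , a≢c , a∈ , c∈ , only ← two-ends W₁.isGraph e∈E₁ =
      a , c , a≢c , ∈-++⁺ˡ a∈ , ∈-++⁺ˡ c∈ , only′
      where
      only′ : ∀ z → (e , z) ∈ ρ′ → (z ≡ a) ⊎ (z ≡ c)
      only′ z ez∈ with ∈-++⁻ ρ₁ ez∈
      ... | inj₁ ez∈ρ₁ = only z ez∈ρ₁
      ... | inj₂ ez∈Fρ₂ with e₂ , _ , _ , refl , _ ← F∈ρ′⁻ ez∈Fρ₂ = ⊥-elim (+fresh≢ e∈E₁ refl)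
    two-ends′ e∈ | inj₂ e∈E₂ with e₂ , e₂∈ , refl ← ∈-map⁻ (_+ oE) e∈E₂
      with a , c , a≢c , a∈ , c∈ , only ← two-ends W₂.isGraph e₂∈ =
      ren a , ren c , a≢c ∘ ren-injective , F∈ρ′ a∈ , F∈ρ′ c∈ , only′
      where
      only′ : ∀ z → (e₂ + oE , z) ∈ ρ′ → (z ≡ ren a) ⊎ (z ≡ ren c)
      only′ z ez∈ with ∈-++⁻ ρ₁ ez∈
      ... | inj₁ ez∈ρ₁ = ⊥-elim (+fresh≢ (proj₁ (inc-dom W₁.isGraph ez∈ρ₁)) refl)
      ... | inj₂ ez∈Fρ₂ with e₃ , w , e₃w∈ , e₂≡e₃ , refl ← F∈ρ′⁻ ez∈Fρ₂
        with refl ← NP.+-cancelʳ-≡ oE e₂ e₃ e₂≡e₃ with only w e₃w∈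
      ...   | inj₁ refl = inj₁ refl
      ...   | inj₂ refl = inj₂ refl

  join-wellLabelled : WellLabelled b (mkGraph V′ E′ ρ′) l₁
  join-wellLabelled = record
    { isGraph = record { inc-dom = inc-dom′ ; two-ends = two-ends′ }
    ; label∈V = ∈-++⁺ˡ ∘ W₁.label∈V ; label-injective = W₁.label-injective
    ; labelled = W₁.labelled ; unlabelled = W₁.unlabelled }

-- The metavariable joinEdge is solved by the edge renaming local to the join clause of build;
-- naming it lets joinEdge-spec relate it to joinVertex.
mutual
  private
    joinEdge : ∀ {k} (t t′ : Term k) (V₁ E₁ : List ℕ) (ρ₁ : List (ℕ × ℕ)) (l₁ : Labeling k)
                 (V₂ E₂ : List ℕ) (ρ₂ : List (ℕ × ℕ)) (l₂ : Labeling k) → ℕ × ℕ → ℕ × ℕ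
    joinEdge = _

  build-wellLabelled : ∀ {k} {t : Term k} {b} → Legal t b → WellLabelled b (proj₁ (build t)) (proj₂ (build t))
  build-wellLabelled leaf = leaf-wellLabelled
  build-wellLabelled (introV {t} l u∉b) with build t | build-wellLabelled l
  ... | mkGraph Vs Es ρs , lab | wl = introV-wellLabelled wl u∉b
  build-wellLabelled (forgetV {t} l _) with build t | build-wellLabelled l
  ... | G , lab | wl = forgetV-wellLabelled wl
  build-wellLabelled (introE {t} {b} {u} {v} l u≢v u∈b v∈b) with build t | build-wellLabelled l
  ... | mkGraph Vs Es ρs , lab | wl with lab u in lu | lab v in lv
  ...   | just x | just y = introE-wellLabelled wl u≢v lu lv
  ...   | nothing | _ with () ← trans (sym lu) (proj₂ (WellLabelled.labelled wl u∈b))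
  ...   | just _ | nothing with () ← trans (sym lv) (proj₂ (WellLabelled.labelled wl v∈b))
  build-wellLabelled (join {t} {t′} l l′) with build t | build t′ | build-wellLabelled l | build-wellLabelled l′
  ... | mkGraph V₁ E₁ ρ₁ , l₁ | mkGraph V₂ E₂ ρ₂ , l₂ | wl₁ | wl₂ =
    JoinWellLabelled.join-wellLabelled wl₁ wl₂ (joinEdge t t′ V₁ E₁ ρ₁ l₁ V₂ E₂ ρ₂ l₂) (joinEdge-spec t t′ V₁ E₁ ρ₁ l₁ V₂ E₂ ρ₂ l₂)

  private
    joinEdge-spec : ∀ {k} (t t′ : Term k) (V₁ E₁ : List ℕ) (ρ₁ : List (ℕ × ℕ)) (l₁ : Labeling k)
                      (V₂ E₂ : List ℕ) (ρ₂ : List (ℕ × ℕ)) (l₂ : Labeling k) → ∀ e z →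
                      joinEdge t t′ V₁ E₁ ρ₁ l₁ V₂ E₂ ρ₂ l₂ (e , z) ≡ (e + fresh E₁ , joinVertex l₁ l₂ (fresh V₁) z)
    joinEdge-spec t t′ V₁ E₁ ρ₁ l₁ V₂ E₂ ρ₂ l₂ e z with findFin (λ u → hitsℕ (l₂ u) z)
    ... | nothing = refl
    ... | just u with l₁ u
    ...   | just y = refl
    ...   | nothing = refl

GraphOf-isGraph : ∀ {k} {t : Term k} {b} → Legal t b → IsGraph (GraphOf t)
GraphOf-isGraph l = WellLabelled.isGraph (build-wellLabelled l)

≅-refl : ∀ G → G ≅ G
≅-refl G = record
  { fV = λ x → x ; gV = λ x → x ; fE = λ x → x ; gE = λ x → x
  ; fV∈ = λ x∈ → x∈ ; gV∈ = λ x∈ → x∈ ; gfV = λ _ → refl ; fgV = λ _ → refl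
  ; fE∈ = λ e∈ → e∈ ; gE∈ = λ e∈ → e∈ ; gfE = λ _ → refl ; fgE = λ _ → refl
  ; inc→ = λ _ _ i → i ; inc← = λ _ _ i → i }

liftJ-≈ˢ : ∀ (D : DPCore) k {S S′ T T′} → S ≈ˢ S′ → T ≈ˢ T′ → liftJ D k S T ≈ˢ liftJ D k S′ T′
liftJ-≈ˢ D k {S′ = S′} {T} {T′} S≈S′ T≈T′ =
  ≈ˢ-trans (concatMap-≈ˢ (λ w → concatMap (Join D k w) T) S≈S′)
           (concatMap-cong-≈ˢ S′ (λ _ → concatMap-≈ˢ (Join D k _) T≈T′))

module ActionOnSets (D : DPCore) (A : WitnessAction D) (k : ℕ) where
  open WitnessAction A

  private
    W = Wit D k

  act-functional : ∀ f {w w₁ w₂} → act k f w ≡ just w₁ → act k f w ≡ just w₂ → w₁ ≡ w₂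
  act-functional f e₁ e₂ = just-injective (trans (sym e₁) e₂)

  actSet-∷⁻ : ∀ f {w S T} → actSet k f (w ∷ S) ≡ just T →
              ∃[ w′ ] ∃[ S′ ] act k f w ≡ just w′ × actSet k f S ≡ just S′ × T ≡ w′ ∷ S′
  actSet-∷⁻ f {w} {S} e with act k f w | actSet k f S
  actSet-∷⁻ f refl | just w′ | just S′ = w′ , S′ , refl , refl , refl

  ∈-actSet⁻ : ∀ f {S T w′} → actSet k f S ≡ just T → w′ ∈ T → ∃[ w ] w ∈ S × act k f w ≡ just w′
  ∈-actSet⁻ f {[]} refl ()
  ∈-actSet⁻ f {w ∷ S} e w′∈ with actSet-∷⁻ f {w} {S} e
  ∈-actSet⁻ f {w ∷ S} e (here refl) | _ , _ , fw , _ , refl = w , here refl , fw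
  ∈-actSet⁻ f {w ∷ S} e (there w′∈) | _ , _ , _ , fS , refl =
    let v , v∈ , fv = ∈-actSet⁻ f fS w′∈ in v , there v∈ , fv

  ∈-actSet⁺ : ∀ f {S T w} → actSet k f S ≡ just T → w ∈ S → ∃[ w′ ] act k f w ≡ just w′ × w′ ∈ T
  ∈-actSet⁺ f {w ∷ S} e w∈ with actSet-∷⁻ f {w} {S} e
  ∈-actSet⁺ f {w ∷ S} e (here refl) | w′ , _ , fw , _ , refl = w′ , fw , here refl
  ∈-actSet⁺ f {w ∷ S} e (there v∈) | _ , _ , _ , fS , refl =
    let v′ , fv , v′∈ = ∈-actSet⁺ f fS v∈ in v′ , fv , there v′∈

  actSet-defined : ∀ f S → (∀ {w} → w ∈ S → ∃[ w′ ] act k f w ≡ just w′) → ∃[ T ] actSet k f S ≡ just T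
  actSet-defined f [] _ = [] , refl
  actSet-defined f (w ∷ S) def with w′ , fw ← def (here refl) | T , fS ← actSet-defined f S (def ∘ there)
    rewrite fw | fS = w′ ∷ T , refl

  actSet-defined-⊆ : ∀ f {S S′ T} → S′ ⊆ S → actSet k f S ≡ just T → ∃[ T′ ] actSet k f S′ ≡ just T′
  actSet-defined-⊆ f S′⊆S fS = actSet-defined f _ λ w∈ → let w′ , fw , _ = ∈-actSet⁺ f fS (S′⊆S w∈) in w′ , fw

  actSet-extends : ∀ {f g S₁ S₂ T₁ T₂} → Injective f → Injective g → Extends g f → S₁ ≈ˢ S₂ →
                   actSet k f S₁ ≡ just T₁ → actSet k g S₂ ≡ just T₂ → T₁ ≈ˢ T₂
  actSet-extends {f} {g} f-inj g-inj g⊇f S₁≈S₂ fS₁ gS₂ = ⊆-antisym-≈ˢ forth back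
    where
    g-agrees : ∀ {w w′} → act k f w ≡ just w′ → act k g w ≡ just w′
    g-agrees {w} {w′} = extend k f g w w′ f-inj g-inj g⊇f
    forth : _ ⊆ _
    forth z∈ with w , w∈ , fw ← ∈-actSet⁻ f fS₁ z∈ with z′ , gw , z′∈ ← ∈-actSet⁺ g gS₂ (≈ˢ⇒⊆ S₁≈S₂ w∈)
      rewrite act-functional g (g-agrees fw) gw = z′∈
    back : _ ⊆ _
    back z∈ with w , w∈ , gw ← ∈-actSet⁻ g gS₂ z∈ with z′ , fw , z′∈ ← ∈-actSet⁺ f fS₁ (≈ˢ⇒⊇ S₁≈S₂ w∈)
      rewrite act-functional g gw (g-agrees fw) = z′∈

  actSet-≈ˢ : ∀ {f S₁ S₂ T₁ T₂} → Injective f → S₁ ≈ˢ S₂ → actSet k f S₁ ≡ just T₁ → actSet k f S₂ ≡ just T₂ → T₁ ≈ˢ T₂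
  actSet-≈ˢ f-inj = actSet-extends f-inj f-inj (λ e → e)

  actSet-comp : ∀ g f S → Injective g → Injective f → actSet k (comp g f) S ≡ (actSet k f S >>= actSet k g)
  actSet-comp g f [] g-inj f-inj = refl
  actSet-comp g f (w ∷ S) g-inj f-inj rewrite compose k g f w g-inj f-inj | actSet-comp g f S g-inj f-inj
    with act k f w
  ... | nothing = refl
  ... | just w₁ with actSet k f S
  ...   | just _ = refl
  ...   | nothing with act k g w₁
  ...     | just _ = refl
  ...     | nothing = refl

  actSet-comp-extends : ∀ {π σ σ′ S T X U} → Injective π → Injective σ → Injective σ′ → Extends σ′ (comp π σ) →
                        actSet k σ S ≡ just T → actSet k π T ≡ just X → actSet k σ′ S ≡ just U → X ≈ˢ U
  actSet-comp-extends {π} {σ} {σ′} {S} π-inj σ-inj σ′-inj σ′⊇πσ σS πT σ′S =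
    actSet-extends {comp π σ} {σ′} {S} {S} (comp-injective {g = π} {f = σ} π-inj σ-inj) σ′-inj σ′⊇πσ ≈ˢ-refl
      (trans (actSet-comp π σ S π-inj σ-inj) (trans (cong (_>>= actSet k π) σS) πT)) σ′S

  actSet-concatMap : ∀ f (F F′ : W → List W) {S S₀ T} →
    (∀ {w w′ X} → w ∈ S → act k f w ≡ just w′ → actSet k f (F w) ≡ just X → X ≈ˢ F′ w′) →
    actSet k f S ≡ just S₀ → actSet k f (concatMap F S) ≡ just T → T ≈ˢ concatMap F′ S₀
  actSet-concatMap f F F′ {S} {S₀} {T} F-comm fS fFS = ⊆-antisym-≈ˢ forth back
    where
    forth : T ⊆ concatMap F′ S₀
    forth z∈ with v , v∈ , fv ← ∈-actSet⁻ f fFS z∈ with w , w∈S , v∈Fw ← ∈-concatMap-elim F S v∈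
      with w′ , fw , w′∈ ← ∈-actSet⁺ f fS w∈S | X , fFw ← actSet-defined-⊆ f (∈-concatMap-intro F w∈S) fFS
      with z′ , fv′ , z′∈ ← ∈-actSet⁺ f fFw v∈Fw rewrite act-functional f fv fv′ =
      ∈-concatMap-intro F′ w′∈ (≈ˢ⇒⊆ (F-comm w∈S fw fFw) z′∈)
    back : concatMap F′ S₀ ⊆ T
    back z∈ with w′ , w′∈ , z∈F′w′ ← ∈-concatMap-elim F′ S₀ z∈ with w , w∈S , fw ← ∈-actSet⁻ f fS w′∈
      with X , fFw ← actSet-defined-⊆ f (∈-concatMap-intro F w∈S) fFS
      with v , v∈Fw , fv ← ∈-actSet⁻ f fFw (≈ˢ⇒⊇ (F-comm w∈S fw fFw) z∈F′w′)
      with z′ , fv′ , z′∈ ← ∈-actSet⁺ f fFS (∈-concatMap-intro F w∈S v∈Fw) rewrite act-functional f fv fv′ = z′∈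

  actSet-liftIV : ∀ f {u u′ S S₀ T} → Injective f → lookup f u ≡ just u′ → actSet k f S ≡ just S₀ →
                  actSet k f (liftIV D k u S) ≡ just T → T ≈ˢ liftIV D k u′ S₀
  actSet-liftIV f {u} {u′} {S} f-inj fu =
    actSet-concatMap f (IntroVertex D k u) (IntroVertex D k u′) {S} (λ _ fw → commIV k f u u′ _ _ _ f-inj fu fw)

  actSet-liftFV : ∀ f {u u′ S S₀ T} → Injective f → lookup f u ≡ just u′ → actSet k f S ≡ just S₀ →
                  actSet k f (liftFV D k u S) ≡ just T → T ≈ˢ liftFV D k u′ S₀
  actSet-liftFV f {u} {u′} {S} f-inj fu =
    actSet-concatMap f (ForgetVertex D k u) (ForgetVertex D k u′) {S} (λ _ fw → commFV k f u u′ _ _ _ f-inj fu fw)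

  actSet-liftIE : ∀ f {u v u′ v′ S S₀ T} → Injective f → u ≢ v → lookup f u ≡ just u′ → lookup f v ≡ just v′ →
                  actSet k f S ≡ just S₀ → actSet k f (liftIE D k u v S) ≡ just T → T ≈ˢ liftIE D k u′ v′ S₀
  actSet-liftIE f {u} {v} {u′} {v′} {S} f-inj u≢v fu fv =
    actSet-concatMap f (IntroEdge D k u v) (IntroEdge D k u′ v′) {S} (λ _ fw → commIE k f u v u′ v′ _ _ _ f-inj u≢v fu fv fw)

  actSet-liftJ : ∀ f {S₁ S₂ S₁′ S₂′ T} → Injective f → actSet k f S₁ ≡ just S₁′ → actSet k f S₂ ≡ just S₂′ →
                 actSet k f (liftJ D k S₁ S₂) ≡ just T → T ≈ˢ liftJ D k S₁′ S₂′
  actSet-liftJ f {S₁} {S₂} {S₁′} {S₂′} f-inj fS₁ fS₂ =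
    actSet-concatMap f (λ w → concatMap (Join D k w) S₂) (λ w′ → concatMap (Join D k w′) S₂′) {S₁} join-comm fS₁
    where
    join-comm : ∀ {w w′ X} → w ∈ S₁ → act k f w ≡ just w′ → actSet k f (concatMap (Join D k w) S₂) ≡ just X →
                X ≈ˢ concatMap (Join D k w′) S₂′
    join-comm {w} {w′} _ fw =
      actSet-concatMap f (Join D k w) (Join D k w′) {S₂} (λ {w₂} {w₂′} {Y} _ fw₂ → commJ k f w w₂ w′ w₂′ Y f-inj fw fw₂) fS₂

  LblIn-actSet : ∀ {b S T} f → LblIn D k S b → Injective f → actSet k f S ≡ just T → LblIn D k T (image f b)
  LblIn-actSet f S⊆b f-inj fS w′∈ with w , w∈ , fw ← ∈-actSet⁻ f fS w′∈ rewrite labels k f w _ f-inj fw =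
    image-mono f (S⊆b w∈)

  LblIn-≈ˢ : ∀ {b S T} → LblIn D k S b → T ≈ˢ S → LblIn D k T b
  LblIn-≈ˢ S⊆b T≈S w∈ = S⊆b (≈ˢ⇒⊆ T≈S w∈)

  actSet-defined-LblIn : ∀ {b S} f → LblIn D k S b → Injective f → dom f ≡ b → ∃[ T ] actSet k f S ≡ just T
  actSet-defined-LblIn {S = S} f S⊆b f-inj refl = actSet-defined f S λ {w} w∈ → defined k f w f-inj (S⊆b w∈)

  Unlabelled : W → Set
  Unlabelled w = ∀ {x} → x ∉ₛ Lbl D k w

  LblIn-∅ : ∀ {S} → LblIn D k S ∅ₛ → ∀ {w} → w ∈ S → Unlabelled w
  LblIn-∅ S⊆∅ w∈ x∈ = ∉⊥ (S⊆∅ w∈ x∈)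

  private
    empty : Relabel k
    empty = V.replicate (suc k) nothing

    lookup-empty : ∀ x → lookup empty x ≡ nothing
    lookup-empty x = VP.lookup-replicate x nothing

    empty-injective : Injective empty
    empty-injective {x} ex with () ← trans (sym (lookup-empty x)) ex

    inv-empty : inv empty ≡ empty
    inv-empty = trans (VP.tabulate-cong unhit) (VP.tabulate∘lookup empty)
      where
      unhit : ∀ y → findFin (λ x → hits (lookup empty x) y) ≡ lookup empty y
      unhit y with findFin (λ x → hits (lookup empty x) y) in e
      ... | nothing = sym (lookup-empty y)
      ... | just x with () ← trans (sym (findFin-just (λ x → hits (lookup empty x) y) e)) (cong (λ m → hits m y) (lookup-empty x))

    comp-empty : comp empty empty ≡ empty
    comp-empty = trans (VP.tabulate-cong (λ x → trans (cong (_>>= lookup empty) (lookup-empty x)) (sym (lookup-empty x))))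
                       (VP.tabulate∘lookup empty)

    act-empty : ∀ w → Unlabelled w → act k empty w ≡ just w
    act-empty w w-unlabelled
      with w′ , ew ← defined k empty w empty-injective (λ x∈ → ⊥-elim (w-unlabelled x∈)) =
      begin
        act k empty w                       ≡⟨ cong (λ g → act k g w) comp-empty ⟨
        act k (comp empty empty) w          ≡⟨ compose k empty empty w empty-injective empty-injective ⟩
        (act k empty w >>= act k empty)     ≡⟨ cong (_>>= act k empty) ew ⟩
        act k empty w′                      ≡⟨ cong (λ g → act k g w′) inv-empty ⟨
        act k (inv empty) w′                ≡⟨ inverse k empty w w′ empty-injective ew ⟩
        just w                              ∎
      where open ≡-Reasoning

  -- The empty relabeling is its own inverse and composes to itself, so it fixes unlabelled
  -- witnesses; every injective f extends it.
  act-unlabelled : ∀ f w → Injective f → Unlabelled w → act k f w ≡ just w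
  act-unlabelled f w f-inj w-unlabelled =
    extend k empty f w w empty-injective f-inj (λ {x} ex → ⊥-elim (case (trans (sym (lookup-empty x)) ex))) (act-empty w w-unlabelled)
    where
    case : ∀ {y} → nothing ≢ just y
    case ()

  actSet-unlabelled : ∀ f S → Injective f → (∀ {w} → w ∈ S → Unlabelled w) → actSet k f S ≡ just S
  actSet-unlabelled f [] _ _ = refl
  actSet-unlabelled f (w ∷ S) f-inj S-unlabelled
    rewrite act-unlabelled f w f-inj (S-unlabelled (here refl)) | actSet-unlabelled f S f-inj (S-unlabelled ∘ there) = refl

-- Dynamization under identity cleaning, and relabeled instructive terms

module Representation (D : DPCore) (A : WitnessAction D) (k : ℕ)
                      (ir : InterfaceRespecting D) (idc : IdentityCleaning D) where
  open WitnessAction A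
  open InterfaceRespecting ir
  open ActionOnSets D A k

  Dyn-introV : ∀ u t → Dyn D k (introV u t) ≡ liftIV D k u (Dyn D k t)
  Dyn-introV u t = idc k _

  Dyn-forgetV : ∀ u t → Dyn D k (forgetV u t) ≡ liftFV D k u (Dyn D k t)
  Dyn-forgetV u t = idc k _

  Dyn-introE : ∀ u v t → Dyn D k (introE u v t) ≡ liftIE D k u v (Dyn D k t)
  Dyn-introE u v t = idc k _

  Dyn-join : ∀ t t′ → Dyn D k (join t t′) ≡ liftJ D k (Dyn D k t) (Dyn D k t′)
  Dyn-join t t′ = idc k _

  Dyn-LblIn : ∀ {t b} → Legal t b → LblIn D k (Dyn D k t) b
  Dyn-LblIn leaf = leafLbl k
  Dyn-LblIn (introV {t} {b} {u} l u∉b) rewrite Dyn-introV u t = ivLbl k b _ u (Dyn-LblIn l) u∉b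
  Dyn-LblIn (forgetV {t} {b} {u} l u∈b) rewrite Dyn-forgetV u t = fvLbl k b _ u (Dyn-LblIn l) u∈b
  Dyn-LblIn (introE {t} {b} {u} {v} l u≢v u∈b v∈b) rewrite Dyn-introE u v t = ieLbl k b _ u v (Dyn-LblIn l) u≢v u∈b v∈b
  Dyn-LblIn (join {t} {t′} {b} l l′) rewrite Dyn-join t t′ = jLbl k b _ _ (Dyn-LblIn l) (Dyn-LblIn l′)

  rename : (Fin (suc k) → Fin (suc k)) → Term k → Term k
  rename g leaf = leaf
  rename g (introV u t) = introV (g u) (rename g t)
  rename g (forgetV u t) = forgetV (g u) (rename g t)
  rename g (introE u v t) = introE (g u) (g v) (rename g t)
  rename g (join t t′) = join (rename g t) (rename g t′)

  module Renaming (σ : Relabel k) (σ-inj : Injective σ) (σ-total : Total σ) where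

    σ̂ : Fin (suc k) → Fin (suc k)
    σ̂ x = proj₁ (σ-total x)

    σσ̂ : ∀ x → lookup σ x ≡ just (σ̂ x)
    σσ̂ x = proj₂ (σ-total x)

    Legal-rename : ∀ {t b} → Legal t b → Legal (rename σ̂ t) (image σ b)
    Legal-rename leaf = subst (Legal leaf) (sym (image-∅ σ)) leaf
    Legal-rename (introV {b = b} {u} l u∉b) =
      subst (Legal _) (sym (image-∪⁅⁆ σ b (σσ̂ u))) (introV (Legal-rename l) (∉-image σ σ-inj u∉b (σσ̂ u)))
    Legal-rename (forgetV {b = b} {u} l u∈b) =
      subst (Legal _) (sym (image-─⁅⁆ σ b σ-inj (σσ̂ u))) (forgetV (Legal-rename l) (∈-image⁺ σ u∈b (σσ̂ u)))
    Legal-rename (introE {u = u} {v} l u≢v u∈b v∈b) =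
      introE (Legal-rename l) (λ σ̂u≡σ̂v → u≢v (σ-inj (σσ̂ u) (subst (λ y → lookup σ v ≡ just y) (sym σ̂u≡σ̂v) (σσ̂ v))))
             (∈-image⁺ σ u∈b (σσ̂ u)) (∈-image⁺ σ v∈b (σσ̂ v))
    Legal-rename (join l l′) = join (Legal-rename l) (Legal-rename l′)

    actSet-total : ∀ S → ∃[ T ] actSet k σ S ≡ just T
    actSet-total S = actSet-defined σ S λ {w} _ → defined k σ w σ-inj (λ {x} _ → Total⇒∈-dom σ-total x)

    Dyn-rename : ∀ {t b T} → Legal t b → actSet k σ (Dyn D k t) ≡ just T → Dyn D k (rename σ̂ t) ≈ˢ T
    Dyn-rename leaf σS
      with refl ← trans (sym σS) (actSet-unlabelled σ (Leaf D k) σ-inj (LblIn-∅ (leafLbl k))) = ≈ˢ-refl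
    Dyn-rename {introV u t} (introV l _) σS rewrite Dyn-introV u t | Dyn-introV (σ̂ u) (rename σ̂ t)
      with S₀ , σS₀ ← actSet-total (Dyn D k t) =
      ≈ˢ-trans (concatMap-≈ˢ _ (Dyn-rename l σS₀)) (≈ˢ-sym (actSet-liftIV σ {S = Dyn D k t} σ-inj (σσ̂ u) σS₀ σS))
    Dyn-rename {forgetV u t} (forgetV l _) σS rewrite Dyn-forgetV u t | Dyn-forgetV (σ̂ u) (rename σ̂ t)
      with S₀ , σS₀ ← actSet-total (Dyn D k t) =
      ≈ˢ-trans (concatMap-≈ˢ _ (Dyn-rename l σS₀)) (≈ˢ-sym (actSet-liftFV σ {S = Dyn D k t} σ-inj (σσ̂ u) σS₀ σS))
    Dyn-rename {introE u v t} (introE l u≢v _ _) σS rewrite Dyn-introE u v t | Dyn-introE (σ̂ u) (σ̂ v) (rename σ̂ t)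
      with S₀ , σS₀ ← actSet-total (Dyn D k t) =
      ≈ˢ-trans (concatMap-≈ˢ _ (Dyn-rename l σS₀)) (≈ˢ-sym (actSet-liftIE σ {S = Dyn D k t} σ-inj u≢v (σσ̂ u) (σσ̂ v) σS₀ σS))
    Dyn-rename {join t t′} (join l l′) σS rewrite Dyn-join t t′ | Dyn-join (rename σ̂ t) (rename σ̂ t′)
      with S₁ , σS₁ ← actSet-total (Dyn D k t) | S₂ , σS₂ ← actSet-total (Dyn D k t′) =
      ≈ˢ-trans (liftJ-≈ˢ D k (Dyn-rename l σS₁) (Dyn-rename l′ σS₂)) (≈ˢ-sym (actSet-liftJ σ {Dyn D k t} {Dyn D k t′} σ-inj σS₁ σS₂ σS))

  Represents : Subset (suc k) → List (Wit D k) → Set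
  Represents b S = ∃[ t ] Legal t b × S ≈ˢ Dyn D k t

  Represents-≈ˢ : ∀ {b S S′} → Represents b S → S′ ≈ˢ S → Represents b S′
  Represents-≈ˢ (t , l , S≈) S′≈S = t , l , ≈ˢ-trans S′≈S S≈

  Represents-leaf : Represents ∅ₛ (Leaf D k)
  Represents-leaf = leaf , leaf , ≈ˢ-refl

  Represents-introV : ∀ {b S u} → Represents b S → u ∉ₛ b → Represents (b ∪ ⁅ u ⁆) (liftIV D k u S)
  Represents-introV {u = u} (t , l , S≈) u∉b =
    introV u t , introV l u∉b , subst (_ ≈ˢ_) (sym (Dyn-introV u t)) (concatMap-≈ˢ _ S≈)

  Represents-forgetV : ∀ {b S u} → Represents b S → u ∈ₛ b → Represents (b - u) (liftFV D k u S)
  Represents-forgetV {u = u} (t , l , S≈) u∈b =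
    forgetV u t , forgetV l u∈b , subst (_ ≈ˢ_) (sym (Dyn-forgetV u t)) (concatMap-≈ˢ _ S≈)

  Represents-introE : ∀ {b S u v} → Represents b S → u ≢ v → u ∈ₛ b → v ∈ₛ b → Represents b (liftIE D k u v S)
  Represents-introE {u = u} {v} (t , l , S≈) u≢v u∈b v∈b =
    introE u v t , introE l u≢v u∈b v∈b , subst (_ ≈ˢ_) (sym (Dyn-introE u v t)) (concatMap-≈ˢ _ S≈)

  Represents-join : ∀ {b S S′} → Represents b S → Represents b S′ → Represents b (liftJ D k S S′)
  Represents-join (t , l , S≈) (t′ , l′ , S′≈) =
    join t t′ , join l l′ , subst (_ ≈ˢ_) (sym (Dyn-join t t′)) (liftJ-≈ˢ D k S≈ S′≈)

  -- Relabeling a represented state amounts to renaming the term along a total extension.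
  Represents-act : ∀ {b S S′} f → Represents b S → Injective f → dom f ≡ b → actSet k f S ≡ just S′ →
                   Represents (image f b) S′
  Represents-act f (t , l , S≈) f-inj dom-f fS
    with σ , σ-inj , σ⊇f , σ-total ← total-extension {f = f} f-inj
    with T , σT ← Renaming.actSet-total σ σ-inj σ-total (Dyn D k t) =
    rename (Renaming.σ̂ σ σ-inj σ-total) t ,
    subst (Legal _) (image-extends {f = f} {g = σ} σ⊇f dom-f) (Renaming.Legal-rename σ σ-inj σ-total l) ,
    ≈ˢ-trans (actSet-extends f-inj σ-inj σ⊇f S≈ fS σT) (≈ˢ-sym (Renaming.Dyn-rename σ σ-inj σ-total l σT))

-- Canonization

module Canonization (D : DPCore) (O : WitOrder D) (A : WitnessAction D) (k : ℕ) where
  open WitOrder O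
  open WitnessAction A
  open Canon D O A k
  open ActionOnSets D A k

  private
    W = Wit D k
    St = State D k

  cmpW-isComparison : IsComparison cmpW
  cmpW-isComparison = fromTri-isComparison (IsStrictTotalOrder.compare (isSTO k)) (IsStrictTotalOrder.trans (isSTO k))

  cmpBag-isComparison : IsComparison (lexCmp (cmpFin {suc k}))
  cmpBag-isComparison = lexCmp-isComparison (fromTri-isComparison FP.<-cmp FP.<-trans)

  ∈-enum⁺ : ∀ {b : Subset (suc k)} {x} → x ∈ₛ b → x ∈ enum b
  ∈-enum⁺ {b} {x} x∈b = ∈-filter⁺ (_∈? b) (∈-allFin x) x∈b

  ∈-enum⁻ : ∀ (b : Subset (suc k)) {x} → x ∈ enum b → x ∈ₛ b
  ∈-enum⁻ b x∈ = proj₂ (∈-filter⁻ (_∈? b) {xs = allFin (suc k)} x∈)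

  enum-injective : ∀ {b b′ : Subset (suc k)} → enum b ≡ enum b′ → b ≡ b′
  enum-injective {b} {b′} e = ⊆-antisym (λ x∈ → ∈-enum⁻ b′ (subst (_ ∈_) e (∈-enum⁺ x∈)))
                                        (λ x∈ → ∈-enum⁻ b (subst (_ ∈_) (sym e) (∈-enum⁺ x∈)))

  cmpState-then : ∀ (s s′ : St) →
    cmpState s s′ ≡ (lexCmp cmpFin (enum (proj₁ s)) (enum (proj₁ s′)) then lexCmp cmpW (proj₂ s) (proj₂ s′))
  cmpState-then (b , S) (b′ , S′) with lexCmp cmpFin (enum b) (enum b′)
  ... | lt = refl
  ... | eq = refl
  ... | gt = refl

  cmpState-isComparison : IsComparison cmpState
  cmpState-isComparison =
    pullback-isComparison (λ s → enum (proj₁ s) , proj₂ s)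
      (λ e → cong₂ _,_ (enum-injective (cong proj₁ e)) (cong proj₂ e)) cmpState-then
      (then-isComparison cmpBag-isComparison (lexCmp-isComparison cmpW-isComparison))

  open NotAbove cmpState-isComparison public

  private
    module CW = IsComparison cmpW-isComparison
    module CS = IsComparison cmpState-isComparison

  Sorted : List W → Set
  Sorted = AllPairs (λ x y → cmpW x y ≡ lt)

  ∈-insertW⁻ : ∀ x ys {z} → z ∈ insertW x ys → z ≡ x ⊎ z ∈ ys
  ∈-insertW⁻ x [] (here z≡x) = inj₁ z≡x
  ∈-insertW⁻ x (y ∷ ys) z∈ with cmpW x y
  ∈-insertW⁻ x (y ∷ ys) (here z≡x) | lt = inj₁ z≡x
  ∈-insertW⁻ x (y ∷ ys) (there z∈) | lt = inj₂ z∈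
  ∈-insertW⁻ x (y ∷ ys) z∈ | eq = inj₂ z∈
  ∈-insertW⁻ x (y ∷ ys) (here z≡y) | gt = inj₂ (here z≡y)
  ∈-insertW⁻ x (y ∷ ys) (there z∈) | gt with ∈-insertW⁻ x ys z∈
  ... | inj₁ z≡x = inj₁ z≡x
  ... | inj₂ z∈ys = inj₂ (there z∈ys)

  x∈insertW : ∀ x ys → x ∈ insertW x ys
  x∈insertW x [] = here refl
  x∈insertW x (y ∷ ys) with cmpW x y in e
  ... | lt = here refl
  ... | eq = here (CW.eq⇒≡ e)
  ... | gt = there (x∈insertW x ys)

  ∈-insertW⁺ : ∀ x ys {z} → z ∈ ys → z ∈ insertW x ys
  ∈-insertW⁺ x (y ∷ ys) z∈ with cmpW x y
  ... | lt = there z∈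
  ... | eq = z∈
  ∈-insertW⁺ x (y ∷ ys) (here z≡y) | gt = here z≡y
  ∈-insertW⁺ x (y ∷ ys) (there z∈) | gt = there (∈-insertW⁺ x ys z∈)

  insertW-sorted : ∀ x ys → Sorted ys → Sorted (insertW x ys)
  insertW-sorted x [] [] = [] ∷ []
  insertW-sorted x (y ∷ ys) (y<ys ∷ ys-sorted) with cmpW x y in e
  ... | lt = (e ∷ All.map (CW.lt-trans e) y<ys) ∷ y<ys ∷ ys-sorted
  ... | eq = y<ys ∷ ys-sorted
  ... | gt = All.tabulate y<insert ∷ insertW-sorted x ys ys-sorted
    where
    y<insert : ∀ {z} → z ∈ insertW x ys → cmpW y z ≡ lt
    y<insert z∈ with ∈-insertW⁻ x ys z∈
    ... | inj₁ refl = CW.gt⇒lt e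
    ... | inj₂ z∈ys = All.lookup y<ys z∈ys

  normalize-≈ˢ : ∀ S → normalize S ≈ˢ S
  normalize-≈ˢ S = ⊆-antisym-≈ˢ (forth S) (back S)
    where
    forth : ∀ S → normalize S ⊆ S
    forth (x ∷ S) z∈ with ∈-insertW⁻ x (normalize S) z∈
    ... | inj₁ refl = here refl
    ... | inj₂ z∈′ = there (forth S z∈′)
    back : ∀ S → S ⊆ normalize S
    back (x ∷ S) (here refl) = x∈insertW x (normalize S)
    back (x ∷ S) (there z∈) = ∈-insertW⁺ x (normalize S) (back S z∈)

  normalize-sorted : ∀ S → Sorted (normalize S)
  normalize-sorted [] = []
  normalize-sorted (x ∷ S) = insertW-sorted x (normalize S) (normalize-sorted S)

  Sorted-≈ˢ⇒≡ : ∀ {xs ys} → Sorted xs → Sorted ys → xs ≈ˢ ys → xs ≡ ys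
  Sorted-≈ˢ⇒≡ {[]} {[]} _ _ _ = refl
  Sorted-≈ˢ⇒≡ {[]} {y ∷ ys} _ _ xs≈ys with () ← ≈ˢ⇒⊇ xs≈ys (here refl)
  Sorted-≈ˢ⇒≡ {x ∷ xs} {[]} _ _ xs≈ys with () ← ≈ˢ⇒⊆ xs≈ys (here refl)
  Sorted-≈ˢ⇒≡ {x ∷ xs} {y ∷ ys} (x<xs ∷ xs-sorted) (y<ys ∷ ys-sorted) xs≈ys
    with ≈ˢ⇒⊆ xs≈ys (here refl) | ≈ˢ⇒⊇ xs≈ys (here refl)
  ... | here refl | _ = cong (x ∷_) (Sorted-≈ˢ⇒≡ xs-sorted ys-sorted (⊆-antisym-≈ˢ (tail x<xs (≈ˢ⇒⊆ xs≈ys)) (tail y<ys (≈ˢ⇒⊇ xs≈ys))))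
    where
    tail : ∀ {as bs} → All (λ z → cmpW x z ≡ lt) as → x ∷ as ⊆ x ∷ bs → as ⊆ bs
    tail x<as as⊆bs z∈ with as⊆bs (there z∈)
    ... | here refl = ⊥-elim (cmp-irrefl cmpW-isComparison (All.lookup x<as z∈))
    ... | there z∈′ = z∈′
  ... | there x∈ys | here refl = ⊥-elim (cmp-irrefl cmpW-isComparison (All.lookup y<ys x∈ys))
  ... | there x∈ys | there y∈xs with () ← trans (sym (CW.lt⇒gt (All.lookup y<ys x∈ys))) (All.lookup x<xs y∈xs)

  normalize-cong : ∀ {S S′} → S ≈ˢ S′ → normalize S ≡ normalize S′
  normalize-cong {S} {S′} S≈S′ = Sorted-≈ˢ⇒≡ (normalize-sorted S) (normalize-sorted S′)
    (≈ˢ-trans (normalize-≈ˢ S) (≈ˢ-trans S≈S′ (≈ˢ-sym (normalize-≈ˢ S′))))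

  minStep : St → St → St
  minStep m z with cmpState z m
  ... | lt = z
  ... | _ = m

  minStep-cases : ∀ m z → (minStep m z ≡ z × z ≼ m) ⊎ (minStep m z ≡ m × m ≼ z)
  minStep-cases m z with cmpState z m in e
  ... | lt = inj₁ (refl , lt⇒≼ {z} {m} e)
  ... | eq = inj₂ (refl , subst (m ≼_) (sym (CS.eq⇒≡ {z} {m} e)) (≼-refl m))
  ... | gt = inj₂ (refl , lt⇒≼ {m} {z} (CS.gt⇒lt {z} {m} e))

  -- minState folds a step function local to its definition; the metavariable is solved by it.
  mutual
    private
      minStateStep : St → St → List St → St → St → St
      minStateStep = _

    minState≡foldl : ∀ d a as → minState d (a ∷ as) ≡ foldl minStep a as
    minState≡foldl d a as = foldl-cong (minStateStep-spec d a as) a as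

    private
      minStateStep-spec : ∀ d a as m z → minStateStep d a as m z ≡ minStep m z
      minStateStep-spec d a as m z with cmpState z m
      ... | lt = refl
      ... | eq = refl
      ... | gt = refl

  foldl-minStep-∈ : ∀ a as → foldl minStep a as ∈ a ∷ as
  foldl-minStep-∈ a [] = here refl
  foldl-minStep-∈ a (y ∷ ys) with minStep-cases a y
  ... | inj₁ (step≡y , _) rewrite step≡y with foldl-minStep-∈ y ys
  ...   | here e = there (here e)
  ...   | there m∈ = there (there m∈)
  foldl-minStep-∈ a (y ∷ ys) | inj₂ (step≡a , _) rewrite step≡a with foldl-minStep-∈ a ys
  ...   | here e = here e
  ...   | there m∈ = there (there m∈)

  foldl-minStep-≼ : ∀ a as {z} → z ∈ a ∷ as → foldl minStep a as ≼ z
  foldl-minStep-≼ a [] (here refl) = ≼-refl a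
  foldl-minStep-≼ a (y ∷ ys) z∈ with minStep-cases a y
  ... | inj₁ (step≡y , y≼a) rewrite step≡y with z∈
  ...   | here refl = ≼-trans (foldl-minStep-≼ y ys (here refl)) y≼a
  ...   | there z∈′ = foldl-minStep-≼ y ys z∈′
  foldl-minStep-≼ a (y ∷ ys) z∈ | inj₂ (step≡a , a≼y) rewrite step≡a with z∈
  ...   | here refl = foldl-minStep-≼ a ys (here refl)
  ...   | there (here refl) = ≼-trans (foldl-minStep-≼ a ys (here refl)) a≼y
  ...   | there (there z∈ys) = foldl-minStep-≼ a ys (there z∈ys)

  minState-∈ : ∀ d {L z} → z ∈ L → minState d L ∈ L
  minState-∈ d {a ∷ as} _ rewrite minState≡foldl d a as = foldl-minStep-∈ a as

  minState-≼ : ∀ d {L z} → z ∈ L → minState d L ≼ z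
  minState-≼ d {a ∷ as} z∈ rewrite minState≡foldl d a as = foldl-minStep-≼ a as z∈

  minState-≈ˢ : ∀ d d′ {L L′ z} → L ⊆ L′ → L′ ⊆ L → z ∈ L → minState d L ≡ minState d′ L′
  minState-≈ˢ d d′ L⊆L′ L′⊆L z∈ =
    ≼-antisym (minState-≼ d (L′⊆L (minState-∈ d′ (L⊆L′ z∈)))) (minState-≼ d′ (L⊆L′ (minState-∈ d z∈)))

  candidate : Subset (suc k) → List W → Relabel k → Maybe St
  candidate b S g = M.map (λ T → image g b , normalize T) (actSet k g S)

  candidates : Subset (suc k) → List W → List St
  candidates b S = mapMaybe (candidate b S) (relabelsWithDom b)

  candidate-just : ∀ {b S} g {T} → actSet k g S ≡ just T → candidate b S g ≡ just (image g b , normalize T)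
  candidate-just g gS rewrite gS = refl

  ∈-candidates⁺ : ∀ {b S} g {T} → dom g ≡ b → Injective g → actSet k g S ≡ just T →
                  (image g b , normalize T) ∈ candidates b S
  ∈-candidates⁺ {b} {S} g dom-g g-inj gS =
    ∈-mapMaybe⁺ (candidate b S) (∈-relabelsWithDom⁺ g dom-g g-inj) (candidate-just {b} {S} g gS)

  ∈-candidates⁻ : ∀ {b S s} → s ∈ candidates b S →
                  ∃[ g ] dom g ≡ b × Injective g × ∃[ T ] actSet k g S ≡ just T × s ≡ (image g b , normalize T)
  ∈-candidates⁻ {b} {S} s∈ with g , g∈ , gs ← ∈-mapMaybe⁻ (candidate b S) (relabelsWithDom b) s∈
    with dom-g , g-inj ← ∈-relabelsWithDom⁻ b g∈ with actSet k g S in gS | gs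
  ... | just T | refl = g , dom-g , g-inj , T , gS , refl

  candidates-nonempty : ∀ {b S} → LblIn D k S b → ∃[ s ] s ∈ candidates b S
  candidates-nonempty {b} {S} wf with T , idS ← actSet-defined-LblIn (idOn b) wf (idOn-injective b) (dom-idOn b) =
    _ , ∈-candidates⁺ {b} {S} (idOn b) (dom-idOn b) (idOn-injective b) idS

  CanonizedBy : Subset (suc k) → List W → Relabel k → Set
  CanonizedBy b S g = Injective g × ∃[ T ] actSet k g S ≡ just T × CAN (b , S) ≡ (image g b , normalize T)

  CAN-canonizedBy : ∀ {b S} → LblIn D k S b → ∃[ g ] dom g ≡ b × CanonizedBy b S g
  CAN-canonizedBy {b} {S} wf =
    ∈-candidates⁻ {b} {S} (minState-∈ (b , normalize S) {candidates b S} (proj₂ (candidates-nonempty {b} {S} wf)))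

  CAN-canonizedBy-total : ∀ {b S} → LblIn D k S b → ∃[ σ ] Total σ × CanonizedBy b S σ
  CAN-canonizedBy-total {b} {S} wf = totalize (CAN-canonizedBy {b} {S} wf)
    where
    totalize : ∃[ g ] dom g ≡ b × CanonizedBy b S g → ∃[ σ ] Total σ × CanonizedBy b S σ
    totalize (g , dom-g , g-inj , T , gS , e) = via (total-extension {f = g} g-inj)
      where
      via : ∃[ σ ] Injective σ × Extends σ g × Total σ → ∃[ σ ] Total σ × CanonizedBy b S σ
      via (σ , σ-inj , σ⊇g , σ-total) =
        let T′ , σS = actSet-defined σ S (λ {w} _ → defined k σ w σ-inj (λ {x} _ → Total⇒∈-dom σ-total x))
        in σ , σ-total , σ-inj , T′ , σS ,
           trans e (cong₂ _,_ (sym (image-extends {f = g} {g = σ} σ⊇g dom-g))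
                              (normalize-cong (actSet-extends {g} {σ} {S} {S} g-inj σ-inj σ⊇g ≈ˢ-refl gS σS)))

  -- g ↦ g ∘ σ⁻¹ identifies the relabelings with domain b and those with domain σ(b), so both
  -- candidate lists contain the same states.
  CAN-invariant : ∀ {b S T T′} σ → Injective σ → Total σ → LblIn D k S b →
                  actSet k σ S ≡ just T′ → T ≈ˢ T′ → CAN (b , S) ≡ CAN (image σ b , T)
  CAN-invariant {b} {S} {T} {T′} σ σ-inj σ-total wf σS T≈T′ =
    minState-≈ˢ (b , normalize S) (image σ b , normalize T) {candidates b S} {candidates (image σ b) T}
      forth back (proj₂ (candidates-nonempty {b} {S} wf))
    where
    wfT′ : LblIn D k T′ (image σ b)
    wfT′ = LblIn-actSet σ wf σ-inj σS
    candidate-comp : ∀ h → Injective h → dom h ≡ image σ b → candidate b S (comp h σ) ≡ candidate (image σ b) T h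
    candidate-comp h h-inj dom-h
      with U , hT ← actSet-defined-LblIn h (LblIn-≈ˢ wfT′ T≈T′) h-inj dom-h
      with U′ , hT′ ← actSet-defined-LblIn h wfT′ h-inj dom-h
      = trans (candidate-just {b} {S} (comp h σ) (trans (actSet-comp h σ S h-inj σ-inj) (trans (cong (_>>= actSet k h) σS) hT′)))
              (trans (cong just (cong₂ _,_ (image-comp h σ b) (normalize-cong (actSet-≈ˢ {h} {T′} {T} h-inj (≈ˢ-sym T≈T′) hT′ hT))))
                     (sym (candidate-just {image σ b} {T} h hT)))
    forth : candidates b S ⊆ candidates (image σ b) T
    forth s∈ with g , g∈ , gs ← ∈-mapMaybe⁻ (candidate b S) (relabelsWithDom b) s∈
      with dom-g , g-inj ← ∈-relabelsWithDom⁻ b g∈ =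
      ∈-mapMaybe⁺ (candidate (image σ b) T) (∈-relabelsWithDom⁺ h dom-h h-inj)
        (trans (sym (candidate-comp h h-inj dom-h)) (trans (cong (candidate b S) (comp-inv-comp g σ σ-inj σ-total)) gs))
      where
      h = comp g (inv σ)
      dom-h = dom-comp-inv g σ b σ-inj dom-g
      h-inj = comp-inv-injective g σ g-inj
    back : candidates (image σ b) T ⊆ candidates b S
    back s∈ with h , h∈ , hs ← ∈-mapMaybe⁻ (candidate (image σ b) T) (relabelsWithDom (image σ b)) s∈
      with dom-h , h-inj ← ∈-relabelsWithDom⁻ (image σ b) h∈ =
      ∈-mapMaybe⁺ (candidate b S) (∈-relabelsWithDom⁺ (comp h σ) (dom-comp h σ b σ-inj σ-total dom-h) (comp-injective {g = h} {f = σ} h-inj σ-inj))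
        (trans (candidate-comp h h-inj dom-h) hs)

  CAN-canonical : ∀ {b S} → LblIn D k S b → Canonical (CAN (b , S))
  CAN-canonical {b} {S} wf = canonical (CAN-canonizedBy-total {b} {S} wf)
    where
    canonical : ∃[ σ ] Total σ × CanonizedBy b S σ → Canonical (CAN (b , S))
    canonical (σ , σ-total , σ-inj , T , σS , e) =
      trans (cong CAN e) (sym (CAN-invariant {b} {S} {normalize T} σ σ-inj σ-total wf σS (normalize-≈ˢ T)))

  bag-≼ : ∀ {b b′ S S′} → (b , S) ≼ (b′ , S′) → NotAbove._≼_ cmpBag-isComparison (enum b) (enum b′)
  bag-≼ {b} {b′} {S} {S′} (≼-intro ≢gt) =
    NotAbove.≼-intro λ e → ≢gt (trans (cmpState-then (b , S) (b′ , S′)) (cong (_then lexCmp cmpW S S′) e))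

  -- The bag of CAN (b , S) is the least image of b over all injections, whatever S is.
  CAN-bag : ∀ {b S₁ S₂} → LblIn D k S₁ b → LblIn D k S₂ b → proj₁ (CAN (b , S₁)) ≡ proj₁ (CAN (b , S₂))
  CAN-bag {b} {S₁} {S₂} wf₁ wf₂ = same-bag (CAN-canonizedBy {b} {S₁} wf₁) (CAN-canonizedBy {b} {S₂} wf₂)
    where
    open NotAbove cmpBag-isComparison using () renaming (_≼_ to _≼ᵇ_; ≼-antisym to ≼ᵇ-antisym)
    below : ∀ {S g T} g′ → LblIn D k S b → dom g′ ≡ b → Injective g′ → CAN (b , S) ≡ (image g b , normalize T) →
            enum (image g b) ≼ᵇ enum (image g′ b)
    below {S} g′ wf dom-g′ g′-inj e with U , g′S ← actSet-defined-LblIn g′ wf g′-inj dom-g′ =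
      bag-≼ (subst (_≼ _) e (minState-≼ (b , normalize S) {candidates b S} (∈-candidates⁺ {b} {S} g′ dom-g′ g′-inj g′S)))
    same-bag : ∃[ g ] dom g ≡ b × CanonizedBy b S₁ g → ∃[ g ] dom g ≡ b × CanonizedBy b S₂ g →
               proj₁ (CAN (b , S₁)) ≡ proj₁ (CAN (b , S₂))
    same-bag (g₁ , dom-g₁ , g₁-inj , T₁ , _ , e₁) (g₂ , dom-g₂ , g₂-inj , T₂ , _ , e₂) =
      trans (cong proj₁ e₁) (trans (enum-injective (≼ᵇ-antisym g₁≼g₂ g₂≼g₁)) (sym (cong proj₁ e₂)))
      where
      g₁≼g₂ : enum (image g₁ b) ≼ᵇ enum (image g₂ b)
      g₁≼g₂ = below {S₁} {g₁} {T₁} g₂ wf₁ dom-g₂ g₂-inj e₁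
      g₂≼g₁ : enum (image g₂ b) ≼ᵇ enum (image g₁ b)
      g₂≼g₁ = below {S₂} {g₂} {T₂} g₁ wf₂ dom-g₁ g₁-inj e₂

module Successors (D : DPCore) (O : WitOrder D) (A : WitnessAction D) (k : ℕ) where
  open WitnessAction A
  open Canon D O A k
  open Canonization D O A k using (∈-enum⁺; ∈-enum⁻)

  private
    W = Wit D k
    St = State D k

  data Successor (R : List St) : St → St → Set where
    viaIntroV : ∀ {b S} u → u ∉ₛ b → Successor R (b , S) (b ∪ ⁅ u ⁆ , liftIV D k u S)
    viaForgetV : ∀ {b S} u → u ∈ₛ b → Successor R (b , S) (b - u , liftFV D k u S)
    viaIntroE : ∀ {b S} u v → u ≢ v → u ∈ₛ b → v ∈ₛ b → Successor R (b , S) (b , liftIE D k u v S)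
    viaJoinˡ : ∀ {b S S′ T} π → (b , S′) ∈ R → IsPerm π b → actSet k π S′ ≡ just T →
               Successor R (b , S) (b , liftJ D k S T)
    viaJoinʳ : ∀ {b S S′ T} π → (b , S′) ∈ R → IsPerm π b → actSet k π S ≡ just T →
               Successor R (b , S) (b , liftJ D k S′ T)

  private
    introVs forgetVs introEs : Subset (suc k) → List W → List St
    introVs b S = map (λ u → b ∪ ⁅ u ⁆ , liftIV D k u S) (filter (λ u → ¬? (u ∈? b)) (allFin (suc k)))
    forgetVs b S = map (λ u → b - u , liftFV D k u S) (enum b)
    introEs b S = concatMap (λ u → concatMap (λ v → if ⌊ u F.≟ v ⌋ then [] else ((b , liftIE D k u v S) ∷ [])) (enum b)) (enum b)

    joinsVia : Subset (suc k) → List W → List W → Relabel k → List St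
    joinsVia b S S′ π = toList (M.map (λ T → b , liftJ D k S T) (actSet k π S′))
                     ++ toList (M.map (λ T → b , liftJ D k S′ T) (actSet k π S))

    joinsWith : Subset (suc k) → List W → St → List St
    joinsWith b S (b′ , S′) = if eqSub b′ b then concatMap (joinsVia b S S′) (permsOf b) else []

    eqSub-refl : ∀ (b : Subset (suc k)) → eqSub b b ≡ true
    eqSub-refl b = Equivalence.to T-≡ (fromWitness refl)

    ∈-toList-map⁻ : ∀ {X Y : Set} {f : X → Y} m {y} → y ∈ toList (M.map f m) → ∃[ x ] m ≡ just x × y ≡ f x
    ∈-toList-map⁻ (just x) (here refl) = x , refl , refl

    ∈-joinsVia⁺ˡ : ∀ b S S′ π {T} → actSet k π S′ ≡ just T → (b , liftJ D k S T) ∈ joinsVia b S S′ π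
    ∈-joinsVia⁺ˡ b S S′ π πS′ rewrite πS′ = here refl

    ∈-joinsVia⁺ʳ : ∀ b S S′ π {T} → actSet k π S ≡ just T → (b , liftJ D k S′ T) ∈ joinsVia b S S′ π
    ∈-joinsVia⁺ʳ b S S′ π πS = ∈-++⁺ʳ (toList (M.map (λ T → b , liftJ D k S T) (actSet k π S′))) (subst (λ m → _ ∈ toList (M.map _ m)) (sym πS) (here refl))

    ∈-joinsWith⁺ : ∀ R b S S′ π {x} → (b , S′) ∈ R → IsPerm π b → x ∈ joinsVia b S S′ π → x ∈ concatMap (joinsWith b S) R
    ∈-joinsWith⁺ R b S S′ π s′∈ π-perm x∈ =
      ∈-concatMap-intro (joinsWith b S) s′∈
        (subst (λ c → _ ∈ (if c then concatMap (joinsVia b S S′) (permsOf b) else [])) (sym (eqSub-refl b))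
          (∈-concatMap-intro (joinsVia b S S′) (∈-permsOf⁺ π π-perm) x∈))

  ∈-successors⁺ : ∀ {R s x} → Successor R s x → x ∈ successors R s
  ∈-successors⁺ {R} {b , S} (viaIntroV u u∉b) =
    ∈-++⁺ˡ (∈-map⁺ (λ u → b ∪ ⁅ u ⁆ , liftIV D k u S) (∈-filter⁺ (λ u → ¬? (u ∈? b)) (∈-allFin u) u∉b))
  ∈-successors⁺ {R} {b , S} (viaForgetV u u∈b) =
    ∈-++⁺ʳ (introVs b S) (∈-++⁺ˡ (∈-map⁺ (λ u → b - u , liftFV D k u S) (∈-enum⁺ u∈b)))
  ∈-successors⁺ {R} {b , S} (viaIntroE u v u≢v u∈b v∈b) =
    ∈-++⁺ʳ (introVs b S) (∈-++⁺ʳ (forgetVs b S) (∈-++⁺ˡ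
      (∈-concatMap-intro _ (∈-enum⁺ u∈b) (∈-concatMap-intro _ (∈-enum⁺ v∈b) edge))))
    where
    edge : (b , liftIE D k u v S) ∈ (if ⌊ u F.≟ v ⌋ then [] else ((b , liftIE D k u v S) ∷ []))
    edge with u F.≟ v
    ... | yes u≡v = ⊥-elim (u≢v u≡v)
    ... | no _ = here refl
  ∈-successors⁺ {R} {b , S} (viaJoinˡ {S′ = S′} π s′∈ π-perm πS′) =
    ∈-++⁺ʳ (introVs b S) (∈-++⁺ʳ (forgetVs b S) (∈-++⁺ʳ (introEs b S)
      (∈-joinsWith⁺ R b S S′ π s′∈ π-perm (∈-joinsVia⁺ˡ b S S′ π πS′))))
  ∈-successors⁺ {R} {b , S} (viaJoinʳ {S′ = S′} π s′∈ π-perm πS) =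
    ∈-++⁺ʳ (introVs b S) (∈-++⁺ʳ (forgetVs b S) (∈-++⁺ʳ (introEs b S)
      (∈-joinsWith⁺ R b S S′ π s′∈ π-perm (∈-joinsVia⁺ʳ b S S′ π πS))))

  ∈-successors⁻ : ∀ R s {x} → x ∈ successors R s → Successor R s x
  ∈-successors⁻ R (b , S) x∈ with ∈-++⁻ (introVs b S) x∈
  ... | inj₁ x∈IV with u , u∈ , refl ← ∈-map⁻ (λ u → b ∪ ⁅ u ⁆ , liftIV D k u S) x∈IV =
    viaIntroV u (proj₂ (∈-filter⁻ (λ u → ¬? (u ∈? b)) {xs = allFin (suc k)} u∈))
  ... | inj₂ x∈′ with ∈-++⁻ (forgetVs b S) x∈′
  ... | inj₁ x∈FV with u , u∈ , refl ← ∈-map⁻ (λ u → b - u , liftFV D k u S) x∈FV = viaForgetV u (∈-enum⁻ b u∈)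
  ... | inj₂ x∈″ with ∈-++⁻ (introEs b S) x∈″
  ... | inj₁ x∈IE with u , u∈ , x∈u ← ∈-concatMap-elim _ (enum b) x∈IE with v , v∈ , x∈uv ← ∈-concatMap-elim _ (enum b) x∈u
    with u F.≟ v | x∈uv
  ...   | no u≢v | here refl = viaIntroE u v u≢v (∈-enum⁻ b u∈) (∈-enum⁻ b v∈)
  ∈-successors⁻ R (b , S) x∈ | inj₂ x∈′ | inj₂ x∈″ | inj₂ x∈J
    with (b′ , S′) , s′∈ , x∈joins ← ∈-concatMap-elim (joinsWith b S) R x∈J with eqSub b′ b in b′≟b
  ... | true with refl ← toWitness (Equivalence.from T-≡ b′≟b)
    with π , π∈ , x∈via ← ∈-concatMap-elim (joinsVia b S S′) (permsOf b) x∈joins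
    with ∈-++⁻ (toList (M.map (λ T → b , liftJ D k S T) (actSet k π S′))) x∈via
  ...   | inj₁ x∈ˡ with T , πS′ , refl ← ∈-toList-map⁻ (actSet k π S′) x∈ˡ = viaJoinˡ π s′∈ (∈-permsOf⁻ b π∈) πS′
  ...   | inj₂ x∈ʳ with T , πS , refl ← ∈-toList-map⁻ (actSet k π S) x∈ʳ = viaJoinʳ π s′∈ (∈-permsOf⁻ b π∈) πS

-- The Relabeled Inclusion Test

module InclusionTest (D : DPCore) (O : WitOrder D) (A : WitnessAction D) (k : ℕ)
                     (ir : InterfaceRespecting D) (idc : IdentityCleaning D) where
  open WitnessAction A
  open InterfaceRespecting ir
  open Canon D O A k
  open ActionOnSets D A k
  open Representation D A k ir idc
  open Canonization D O A k
  open Successors D O A k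

  private
    W = Wit D k
    St = State D k
    _≟ʷ_ = IsStrictTotalOrder._≟_ (WitOrder.isSTO O k)

  -- The properties shared by all states the test ever sees.
  record Good (s : St) : Set where
    field
      canonical : Canonical s
      wellFormed : WellFormed s
      represents : Represents (proj₁ s) (proj₂ s)
      normalized : ∃[ T ] proj₂ s ≡ normalize T

  Good-CAN : ∀ {s} → WellFormed s → Represents (proj₁ s) (proj₂ s) → Good (CAN s)
  Good-CAN {b , S} wf rep = good (CAN-canonizedBy {b} {S} wf)
    where
    good : ∃[ g ] dom g ≡ b × CanonizedBy b S g → Good (CAN (b , S))
    good (g , dom-g , g-inj , T , gS , e) = record
      { canonical = CAN-canonical {b} {S} wf
      ; wellFormed = subst WellFormed (sym e) (LblIn-≈ˢ (LblIn-actSet g wf g-inj gS) (normalize-≈ˢ T))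
      ; represents = subst (λ s → Represents (proj₁ s) (proj₂ s)) (sym e)
                           (Represents-≈ˢ (Represents-act g rep g-inj dom-g gS) (normalize-≈ˢ T))
      ; normalized = T , cong proj₂ e }

  LblIn-perm : ∀ {π b S T} → IsPerm π b → LblIn D k S b → actSet k π S ≡ just T → LblIn D k T b
  LblIn-perm (π-inj , _ , image-π) wf πS = subst (LblIn D k _) image-π (LblIn-actSet _ wf π-inj πS)

  Represents-perm : ∀ {π b S T} → IsPerm π b → Represents b S → actSet k π S ≡ just T → Represents b T
  Represents-perm (π-inj , dom-π , image-π) rep πS = subst (λ c → Represents c _) image-π (Represents-act _ rep π-inj dom-π πS)

  Successor-wellFormed : ∀ {R s x} → (∀ {r} → r ∈ R → WellFormed r) → WellFormed s → Successor R s x → WellFormed x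
  Successor-wellFormed {s = b , S} _ wf (viaIntroV u u∉b) = ivLbl k b S u wf u∉b
  Successor-wellFormed {s = b , S} _ wf (viaForgetV u u∈b) = fvLbl k b S u wf u∈b
  Successor-wellFormed {s = b , S} _ wf (viaIntroE u v u≢v u∈b v∈b) = ieLbl k b S u v wf u≢v u∈b v∈b
  Successor-wellFormed {s = b , S} wfR wf (viaJoinˡ π s′∈ π-perm πS′) = jLbl k b S _ wf (LblIn-perm π-perm (wfR s′∈) πS′)
  Successor-wellFormed {s = b , S} wfR wf (viaJoinʳ π s′∈ π-perm πS) = jLbl k b _ _ (wfR s′∈) (LblIn-perm π-perm wf πS)

  Successor-represents : ∀ {R s x} → (∀ {r} → r ∈ R → Represents (proj₁ r) (proj₂ r)) → Represents (proj₁ s) (proj₂ s) →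
                         Successor R s x → Represents (proj₁ x) (proj₂ x)
  Successor-represents _ rep (viaIntroV u u∉b) = Represents-introV rep u∉b
  Successor-represents _ rep (viaForgetV u u∈b) = Represents-forgetV rep u∈b
  Successor-represents _ rep (viaIntroE u v u≢v u∈b v∈b) = Represents-introE rep u≢v u∈b v∈b
  Successor-represents repR rep (viaJoinˡ π s′∈ π-perm πS′) = Represents-join rep (Represents-perm π-perm (repR s′∈) πS′)
  Successor-represents repR rep (viaJoinʳ π s′∈ π-perm πS) = Represents-join (repR s′∈) (Represents-perm π-perm rep πS)

  Successor-derived : ∀ {R s x prev} → s ∈ prev → R ⊆ prev → WellFormed x → Successor R s x → Derived prev (CAN x)
  Successor-derived {R} {s} {x} {prev} s∈ R⊆prev wf succ = derived succ (CAN-canonizedBy {proj₁ x} {proj₂ x} wf)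
    where
    derived : ∀ {y} → Successor R s y → ∃[ g ] dom g ≡ proj₁ y × CanonizedBy (proj₁ y) (proj₂ y) g → Derived prev (CAN y)
    derived (viaIntroV u u∉b) (g , dom-g , g-inj , T , gS , e) =
      subst (Derived prev) (sym e) (viaIV g u s∈ u∉b g-inj dom-g gS refl (normalize-≈ˢ T))
    derived (viaForgetV u u∈b) (g , dom-g , g-inj , T , gS , e) =
      subst (Derived prev) (sym e) (viaFV g u s∈ u∈b g-inj dom-g gS refl (normalize-≈ˢ T))
    derived (viaIntroE u v u≢v u∈b v∈b) (g , dom-g , g-inj , T , gS , e) =
      subst (Derived prev) (sym e) (viaIE g u v s∈ u≢v u∈b v∈b g-inj dom-g gS refl (normalize-≈ˢ T))
    derived (viaJoinˡ π s′∈ π-perm πS′) (g , dom-g , g-inj , T , gS , e) =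
      subst (Derived prev) (sym e) (viaJ g π s∈ (R⊆prev s′∈) π-perm πS′ g-inj dom-g gS refl (normalize-≈ˢ T))
    derived (viaJoinʳ π s′∈ π-perm πS) (g , dom-g , g-inj , T , gS , e) =
      subst (Derived prev) (sym e) (viaJ g π (R⊆prev s′∈) s∈ π-perm πS g-inj dom-g gS refl (normalize-≈ˢ T))

  Derived-mono : ∀ {p q x} → p ⊆ q → Derived p x → Derived q x
  Derived-mono p⊆q (viaIV f u j∈ u∉ f-inj dom-f fS b≡ S≈) = viaIV f u (p⊆q j∈) u∉ f-inj dom-f fS b≡ S≈
  Derived-mono p⊆q (viaFV f u j∈ u∈ f-inj dom-f fS b≡ S≈) = viaFV f u (p⊆q j∈) u∈ f-inj dom-f fS b≡ S≈
  Derived-mono p⊆q (viaIE f u v j∈ u≢v u∈ v∈ f-inj dom-f fS b≡ S≈) = viaIE f u v (p⊆q j∈) u≢v u∈ v∈ f-inj dom-f fS b≡ S≈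
  Derived-mono p⊆q (viaJ f π j∈ l∈ π-perm πS f-inj dom-f fS b≡ S≈) = viaJ f π (p⊆q j∈) (p⊆q l∈) π-perm πS f-inj dom-f fS b≡ S≈

  Chain-all : ∀ {Q} p xs → (∀ {x} → x ∈ xs → Derived Q x) → Q ⊆ p → Chain p xs
  Chain-all p [] _ _ = tt
  Chain-all p (x ∷ xs) derived Q⊆p =
    Derived-mono Q⊆p (derived (here refl)) , Chain-all (p ++ x ∷ []) xs (derived ∘ there) (∈-++⁺ˡ ∘ Q⊆p)

  Chain-++ : ∀ {Q} p xs ys → Chain p xs → (∀ {y} → y ∈ ys → Derived Q y) → Q ⊆ p ++ xs → Chain p (xs ++ ys)
  Chain-++ p [] ys _ derived Q⊆ = Chain-all p ys derived (subst (_ ∈_) (++-identityʳ p) ∘ Q⊆)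
  Chain-++ p (x ∷ xs) ys (d , chain) derived Q⊆ =
    d , Chain-++ (p ++ x ∷ []) xs ys chain derived (subst (_ ∈_) (sym (++-assoc p (x ∷ []) xs)) ∘ Q⊆)

  Chain-prefix : ∀ p xs ys → Chain p (xs ++ ys) → Chain p xs
  Chain-prefix p [] ys _ = tt
  Chain-prefix p (x ∷ xs) ys (d , chain) = d , Chain-prefix (p ++ x ∷ []) xs ys chain

  lastOf-snoc : ∀ a xs s → lastOf a (xs ++ s ∷ []) ≡ s
  lastOf-snoc a [] s = refl
  lastOf-snoc a (x ∷ xs) s = lastOf-snoc x xs s

  eqState-true⁻ : ∀ x y → eqState x y ≡ true → x ≡ y
  eqState-true⁻ (b , S) (b′ , S′) e =
    let b≡ , S≡ = Equivalence.to (T-∧ {eqSub b b′} {⌊ ≡-dec-List _≟ʷ_ S S′ ⌋}) (Equivalence.from T-≡ e)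
    in cong₂ _,_ (toWitness b≡) (toWitness S≡)

  eqState-refl : ∀ x → eqState x x ≡ true
  eqState-refl (b , S) =
    Equivalence.to T-≡ (Equivalence.from (T-∧ {eqSub b b} {⌊ ≡-dec-List _≟ʷ_ S S ⌋}) (fromWitness refl , fromWitness refl))

  memState-true⁻ : ∀ x Seen → memState x Seen ≡ true → x ∈ Seen
  memState-true⁻ x Seen e with y , y∈ , x≟y ← any-true⁻ (eqState x) Seen e rewrite eqState-true⁻ x y x≟y = y∈

  memState-false⁻ : ∀ x Seen → memState x Seen ≡ false → x ∉ Seen
  memState-false⁻ x Seen e x∈ with () ← trans (sym (any-false⁻ (eqState x) e x∈)) (eqState-refl x)

  record AddAll (xs Y Seen : List St) (r : List St × List St) : Set where
    field
      new : List St
      queue≡ : proj₁ r ≡ Y ++ new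
      new⊆xs : new ⊆ xs
      seen⊆ : proj₂ r ⊆ new ++ Seen
      ⊆seen : new ++ Seen ⊆ proj₂ r
      xs⊆seen : xs ⊆ proj₂ r
      unique : Unique Seen → Unique (proj₂ r)
      length≡ : length (proj₂ r) ≡ length new + length Seen

  addAll-spec : ∀ xs Y Seen → AddAll xs Y Seen (addAll xs (Y , Seen))
  addAll-spec [] Y Seen = record
    { new = [] ; queue≡ = sym (++-identityʳ Y) ; new⊆xs = λ () ; seen⊆ = λ z∈ → z∈ ; ⊆seen = λ z∈ → z∈
    ; xs⊆seen = λ () ; unique = λ u → u ; length≡ = refl }
  addAll-spec (x ∷ xs) Y Seen with memState x Seen in x?
  ... | true = record
    { new = new ; queue≡ = queue≡ ; new⊆xs = there ∘ new⊆xs ; seen⊆ = seen⊆ ; ⊆seen = ⊆seen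
    ; xs⊆seen = λ { (here refl) → ⊆seen (∈-++⁺ʳ new (memState-true⁻ x Seen x?)) ; (there z∈) → xs⊆seen z∈ }
    ; unique = unique ; length≡ = length≡ }
    where open AddAll (addAll-spec xs Y Seen)
  ... | false = record
    { new = x ∷ new
    ; queue≡ = trans queue≡ (++-assoc Y (x ∷ []) new)
    ; new⊆xs = λ { (here refl) → here refl ; (there z∈) → there (new⊆xs z∈) }
    ; seen⊆ = ∈-middle-to-front new ∘ seen⊆
    ; ⊆seen = ⊆seen ∘ ∈-front-to-middle new
    ; xs⊆seen = λ { (here refl) → ⊆seen (∈-++⁺ʳ new (here refl)) ; (there z∈) → xs⊆seen z∈ }
    ; unique = λ u → unique (¬Any⇒All¬ Seen (memState-false⁻ x Seen x?) ∷ u)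
    ; length≡ = trans length≡ (NP.+-suc (length new) (length Seen)) }
    where open AddAll (addAll-spec xs (Y ++ x ∷ []) (x ∷ Seen))

  Successor-snoc : ∀ {R r s x} → s ∈ R ++ r ∷ [] → Successor (R ++ r ∷ []) s x →
                   Successor R s x ⊎ Successor (R ++ r ∷ []) r x
  Successor-snoc _ (viaIntroV u u∉b) = inj₁ (viaIntroV u u∉b)
  Successor-snoc _ (viaForgetV u u∈b) = inj₁ (viaForgetV u u∈b)
  Successor-snoc _ (viaIntroE u v u≢v u∈b v∈b) = inj₁ (viaIntroE u v u≢v u∈b v∈b)
  Successor-snoc {R} s∈ (viaJoinˡ π s′∈ π-perm πS′) with ∈-++⁻ R s′∈
  ... | inj₁ s′∈R = inj₁ (viaJoinˡ π s′∈R π-perm πS′)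
  ... | inj₂ (here refl) = inj₂ (viaJoinʳ π s∈ π-perm πS′)
  Successor-snoc {R} s∈ (viaJoinʳ π s′∈ π-perm πS) with ∈-++⁻ R s′∈
  ... | inj₁ s′∈R = inj₁ (viaJoinʳ π s′∈R π-perm πS)
  ... | inj₂ (here refl) = inj₂ (viaJoinˡ π s∈ π-perm πS)

  record Invariant (R Y Seen : List St) : Set where
    field
      good : ∀ {s} → s ∈ Seen → Good s
      visited⊆seen : R ++ Y ⊆ Seen
      seen⊆visited : Seen ⊆ R ++ Y
      seen-unique : Unique Seen
      history : List St
      history≡ : R ++ Y ≡ initState ∷ history
      history-chain : Chain (initState ∷ []) history
      consistent : ∀ {s} → s ∈ R → hasFinal (proj₂ s) ≡ true
      closed : ∀ {s x} → s ∈ R → Successor R s x → CAN x ∈ Seen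

  initial-invariant : Invariant [] (initState ∷ []) (initState ∷ [])
  initial-invariant = record
    { good = λ { (here refl) → Good-CAN {∅ₛ , Leaf D k} (leafLbl k) Represents-leaf }
    ; visited⊆seen = λ s∈ → s∈ ; seen⊆visited = λ s∈ → s∈ ; seen-unique = [] ∷ []
    ; history = [] ; history≡ = refl ; history-chain = tt
    ; consistent = λ () ; closed = λ () }

  module Step {R s Y Seen} (inv : Invariant R (s ∷ Y) Seen) (s-consistent : hasFinal (proj₂ s) ≡ true) where
    open Invariant inv

    R′ : List St
    R′ = R ++ s ∷ []

    xs : List St
    xs = map CAN (successors R′ s)

    open AddAll (addAll-spec xs Y Seen) public

    Y′ Seen′ : List St
    Y′ = proj₁ (addAll xs (Y , Seen))
    Seen′ = proj₂ (addAll xs (Y , Seen))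

    reassociate : R′ ++ Y ++ new ≡ (R ++ s ∷ Y) ++ new
    reassociate = trans (++-assoc R (s ∷ []) (Y ++ new)) (sym (++-assoc R (s ∷ Y) new))

    R′⊆R++s∷Y : R′ ⊆ R ++ s ∷ Y
    R′⊆R++s∷Y = subst (_ ∈_) (++-assoc R (s ∷ []) Y) ∘ ∈-++⁺ˡ

    s∈R′ : s ∈ R′
    s∈R′ = ∈-++⁺ʳ R (here refl)

    good-R′ : ∀ {r} → r ∈ R′ → Good r
    good-R′ = good ∘ visited⊆seen ∘ R′⊆R++s∷Y

    successor-of-s : ∀ {z} → z ∈ xs → ∃[ x ] Successor R′ s x × z ≡ CAN x
    successor-of-s z∈ with x , x∈ , refl ← ∈-map⁻ CAN z∈ = x , ∈-successors⁻ R′ s x∈ , refl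

    successor-wellFormed : ∀ {x} → Successor R′ s x → WellFormed x
    successor-wellFormed = Successor-wellFormed (Good.wellFormed ∘ good-R′) (Good.wellFormed (good-R′ s∈R′))

    good-xs : ∀ {z} → z ∈ xs → Good z
    good-xs z∈ with x , succ , refl ← successor-of-s z∈ =
      Good-CAN {x} (successor-wellFormed succ)
               (Successor-represents (Good.represents ∘ good-R′) (Good.represents (good-R′ s∈R′)) succ)

    derived-xs : ∀ {z} → z ∈ xs → Derived R′ z
    derived-xs z∈ with x , succ , refl ← successor-of-s z∈ = Successor-derived s∈R′ (λ r∈ → r∈) (successor-wellFormed succ) succ

    closed-s : ∀ {x} → Successor R′ s x → CAN x ∈ Seen′
    closed-s succ = xs⊆seen (∈-map⁺ CAN (∈-successors⁺ succ))

    invariant : Invariant R′ Y′ Seen′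
    invariant = record
      { good = λ z∈ → [ good-xs ∘ new⊆xs , good ]′ (∈-++⁻ new (seen⊆ z∈))
      ; visited⊆seen = λ z∈ → [ ⊆seen ∘ ∈-++⁺ʳ new ∘ visited⊆seen , ⊆seen ∘ ∈-++⁺ˡ ]′
                                (∈-++⁻ (R ++ s ∷ Y) (subst (_ ∈_) reassociate (subst (λ Z → _ ∈ R′ ++ Z) queue≡ z∈)))
      ; seen⊆visited = λ z∈ → subst (λ Z → _ ∈ R′ ++ Z) (sym queue≡) (subst (_ ∈_) (sym reassociate)
                                ([ ∈-++⁺ʳ (R ++ s ∷ Y) , ∈-++⁺ˡ ∘ seen⊆visited ]′ (∈-++⁻ new (seen⊆ z∈))))
      ; seen-unique = unique seen-unique
      ; history = history ++ new
      ; history≡ = trans (cong (R′ ++_) queue≡) (trans reassociate (cong (_++ new) history≡))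
      ; history-chain = Chain-++ (initState ∷ []) history new history-chain (derived-xs ∘ new⊆xs)
                                 (subst (_ ∈_) history≡ ∘ R′⊆R++s∷Y)
      ; consistent = λ r∈ → [ consistent , (λ { (here refl) → s-consistent }) ]′ (∈-++⁻ R r∈)
      ; closed = λ r∈ succ → [ (λ r∈R → [ ⊆seen ∘ ∈-++⁺ʳ new ∘ closed r∈R , closed-s ]′ (Successor-snoc r∈ succ))
                             , (λ { (here refl) → closed-s succ }) ]′ (∈-++⁻ R r∈) }

  -- When the queue is empty, R is closed under successors, so it contains the canonized
  -- dynamization of every term: each construction step of the term, transported along the
  -- relabeling that canonizes its argument, is a successor of a state of R.
  module Closed {R : List St} (init∈R : initState ∈ R) (closed : ∀ {s x} → s ∈ R → Successor R s x → CAN x ∈ R) where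

    StepOf : Relabel k → St → Subset (suc k) → List W → Set
    StepOf σ s b′ S′ = ∃[ x ] Successor R s x × proj₁ x ≡ image σ b′ × (∀ {T′} → actSet k σ S′ ≡ just T′ → proj₂ x ≈ˢ T′)

    relabeled-step : ∀ {b S b′ S′} → LblIn D k S b → CAN (b , S) ∈ R → LblIn D k S′ b′ →
                     (∀ σ → Injective σ → Total σ → ∀ {T} → actSet k σ S ≡ just T → CAN (b , S) ≡ (image σ b , normalize T) →
                        StepOf σ (image σ b , normalize T) b′ S′) →
                     CAN (b′ , S′) ∈ R
    relabeled-step {b} {S} {b′} {S′} wf s∈ wf′ step = reach (CAN-canonizedBy-total {b} {S} wf)
      where
      reach : ∃[ σ ] Total σ × CanonizedBy b S σ → CAN (b′ , S′) ∈ R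
      reach (σ , σ-total , σ-inj , T , σS , e) = relabel (Renaming.actSet-total σ σ-inj σ-total S′) (step σ σ-inj σ-total σS e)
        where
        relabel : ∃[ T′ ] actSet k σ S′ ≡ just T′ → StepOf σ (image σ b , normalize T) b′ S′ → CAN (b′ , S′) ∈ R
        relabel (T′ , σS′) ((c , X) , succ , refl , X≈) =
          subst (_∈ R) (sym (CAN-invariant {b′} {S′} {X} {T′} σ σ-inj σ-total wf′ σS′ (X≈ σS′))) (closed (subst (_∈ R) e s∈) succ)

    -- The canonized arguments share their bag c = σ₁(b) = σ₂(b), and π = σ₁ ∘ σ₂⁻¹ (on c)
    -- is a permutation of c carrying the second one onto the σ₁-relabeling of Dyn t₂.
    join-step : ∀ {t₁ t₂ b} → Legal t₁ b → Legal t₂ b → CAN (b , Dyn D k t₂) ∈ R →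
                ∃[ σ₂ ] Total σ₂ × CanonizedBy b (Dyn D k t₂) σ₂ →
                ∀ σ₁ → Injective σ₁ → Total σ₁ → ∀ {T₁} → actSet k σ₁ (Dyn D k t₁) ≡ just T₁ →
                CAN (b , Dyn D k t₁) ≡ (image σ₁ b , normalize T₁) →
                StepOf σ₁ (image σ₁ b , normalize T₁) b (liftJ D k (Dyn D k t₁) (Dyn D k t₂))
    join-step {t₁} {t₂} {b} l₁ l₂ s₂∈ (σ₂ , σ₂-total , σ₂-inj , T₂ , σ₂S₂ , e₂) σ₁ σ₁-inj σ₁-total {T₁} σ₁S₁ e₁ =
      _ , viaJoinˡ π c,T₂∈R π-perm (proj₂ πT₂-def) , refl ,
      λ σ₁S′ → ≈ˢ-trans (liftJ-≈ˢ D k (normalize-≈ˢ T₁) πT₂≈U₂)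
                        (≈ˢ-sym (actSet-liftJ σ₁ {Dyn D k t₁} {Dyn D k t₂} σ₁-inj σ₁S₁ (proj₂ U₂-def) σ₁S′))
      where
      wf₂ = Dyn-LblIn l₂
      c = image σ₁ b
      same-bag : c ≡ image σ₂ b
      same-bag = trans (cong proj₁ (sym e₁)) (trans (CAN-bag {b} {Dyn D k t₁} {Dyn D k t₂} (Dyn-LblIn l₁) wf₂) (cong proj₁ e₂))
      g = restrict σ₁ b
      π = comp g (inv σ₂)
      π-perm : IsPerm π c
      π-perm = restrict∘inv-isPerm {σ₁ = σ₁} {σ₂ = σ₂} b σ₁-inj σ₁-total σ₂-inj σ₂-total same-bag
      π-inj : Injective π
      π-inj = proj₁ π-perm
      dom-π : dom π ≡ c
      dom-π = proj₁ (proj₂ π-perm)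
      c,T₂∈R : (c , normalize T₂) ∈ R
      c,T₂∈R = subst (λ d → (d , normalize T₂) ∈ R) (sym same-bag) (subst (_∈ R) e₂ s₂∈)
      wfT₂ : LblIn D k T₂ c
      wfT₂ = subst (LblIn D k T₂) (sym same-bag) (LblIn-actSet σ₂ wf₂ σ₂-inj σ₂S₂)
      πT₂-def = actSet-defined-LblIn π (LblIn-≈ˢ wfT₂ (normalize-≈ˢ T₂)) π-inj dom-π
      πT₂′-def = actSet-defined-LblIn π wfT₂ π-inj dom-π
      U₂-def = Renaming.actSet-total σ₁ σ₁-inj σ₁-total (Dyn D k t₂)
      σ₁⊇π∘σ₂ : Extends σ₁ (comp π σ₂)
      σ₁⊇π∘σ₂ = subst (Extends σ₁) (sym (comp-inv-comp g σ₂ σ₂-inj σ₂-total)) (restrict-extends σ₁ b)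
      πT₂≈U₂ : proj₁ πT₂-def ≈ˢ proj₁ U₂-def
      πT₂≈U₂ = ≈ˢ-trans (actSet-≈ˢ {π} {normalize T₂} {T₂} π-inj (normalize-≈ˢ T₂) (proj₂ πT₂-def) (proj₂ πT₂′-def))
                        (actSet-comp-extends {π} {σ₂} {σ₁} {Dyn D k t₂} π-inj σ₂-inj σ₁-inj σ₁⊇π∘σ₂
                          σ₂S₂ (proj₂ πT₂′-def) (proj₂ U₂-def))

    CAN-Dyn∈R : ∀ {t b} → Legal t b → CAN (b , Dyn D k t) ∈ R
    CAN-Dyn∈R leaf = init∈R
    CAN-Dyn∈R (introV {t} {b} {u} l u∉b) =
      subst (λ S → CAN (b ∪ ⁅ u ⁆ , S) ∈ R) (sym (Dyn-introV u t))
        (relabeled-step (Dyn-LblIn l) (CAN-Dyn∈R l) (ivLbl k b _ u (Dyn-LblIn l) u∉b) λ σ σ-inj σ-total {T} σS _ →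
          let v , σu = σ-total u in
          _ , viaIntroV v (∉-image σ σ-inj u∉b σu) , sym (image-∪⁅⁆ σ b σu) ,
          λ σS′ → ≈ˢ-trans (concatMap-≈ˢ _ (normalize-≈ˢ T)) (≈ˢ-sym (actSet-liftIV σ {S = Dyn D k t} σ-inj σu σS σS′)))
    CAN-Dyn∈R (forgetV {t} {b} {u} l u∈b) =
      subst (λ S → CAN (b - u , S) ∈ R) (sym (Dyn-forgetV u t))
        (relabeled-step (Dyn-LblIn l) (CAN-Dyn∈R l) (fvLbl k b _ u (Dyn-LblIn l) u∈b) λ σ σ-inj σ-total {T} σS _ →
          let v , σu = σ-total u in
          _ , viaForgetV v (∈-image⁺ σ u∈b σu) , sym (image-─⁅⁆ σ b σ-inj σu) ,
          λ σS′ → ≈ˢ-trans (concatMap-≈ˢ _ (normalize-≈ˢ T)) (≈ˢ-sym (actSet-liftFV σ {S = Dyn D k t} σ-inj σu σS σS′)))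
    CAN-Dyn∈R (introE {t} {b} {u} {v} l u≢v u∈b v∈b) =
      subst (λ S → CAN (b , S) ∈ R) (sym (Dyn-introE u v t))
        (relabeled-step (Dyn-LblIn l) (CAN-Dyn∈R l) (ieLbl k b _ u v (Dyn-LblIn l) u≢v u∈b v∈b) λ σ σ-inj σ-total {T} σS _ →
          let u′ , σu = σ-total u
              v′ , σv = σ-total v
          in _ , viaIntroE u′ v′ (λ u′≡v′ → u≢v (σ-inj σu (subst (λ y → lookup σ v ≡ just y) (sym u′≡v′) σv)))
                           (∈-image⁺ σ u∈b σu) (∈-image⁺ σ v∈b σv) , refl ,
             λ σS′ → ≈ˢ-trans (concatMap-≈ˢ _ (normalize-≈ˢ T)) (≈ˢ-sym (actSet-liftIE σ {S = Dyn D k t} σ-inj u≢v σu σv σS σS′)))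
    CAN-Dyn∈R (join {t₁} {t₂} {b} l₁ l₂) =
      subst (λ S → CAN (b , S) ∈ R) (sym (Dyn-join t₁ t₂))
        (relabeled-step (Dyn-LblIn l₁) (CAN-Dyn∈R l₁) (jLbl k b _ _ (Dyn-LblIn l₁) (Dyn-LblIn l₂))
          (join-step l₁ l₂ (CAN-Dyn∈R l₂) (CAN-canonizedBy-total {b} {Dyn D k t₂} (Dyn-LblIn l₂))))

  any-≈ˢ : ∀ (p : W → Bool) {S T} → S ≈ˢ T → any p S ≡ any p T
  any-≈ˢ p {S} {T} S≈T with any p S in pS | any p T in pT
  ... | true | true = refl
  ... | false | false = refl
  ... | true | false with x , x∈ , px ← any-true⁻ p S pS with () ← trans (sym (any-false⁻ p pT (≈ˢ⇒⊆ S≈T x∈))) px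
  ... | false | true with x , x∈ , px ← any-true⁻ p T pT with () ← trans (sym (any-false⁻ p pS (≈ˢ⇒⊇ S≈T x∈))) px

  hasFinal-actSet : ∀ {f S T} → Injective f → actSet k f S ≡ just T → hasFinal T ≡ hasFinal S
  hasFinal-actSet {f} {S} {T} f-inj fS with hasFinal T in final-T | hasFinal S in final-S
  ... | true | true = refl
  ... | false | false = refl
  ... | true | false with w′ , w′∈ , fw′ ← any-true⁻ (Final D k) T final-T with w , w∈ , fw ← ∈-actSet⁻ f {S} fS w′∈
    with () ← trans (sym (any-false⁻ (Final D k) final-S w∈)) (trans (sym (finality k f w w′ f-inj fw)) fw′)
  ... | false | true with w , w∈ , fw ← any-true⁻ (Final D k) S final-S with w′ , fw′ , w′∈ ← ∈-actSet⁺ f {S} fS w∈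
    with () ← trans (sym (any-false⁻ (Final D k) final-T w′∈)) (trans (finality k f w w′ f-inj fw′) fw)

  hasFinal-CAN : ∀ {b S} → LblIn D k S b → hasFinal (proj₂ (CAN (b , S))) ≡ hasFinal S
  hasFinal-CAN {b} {S} wf = via (CAN-canonizedBy {b} {S} wf)
    where
    via : ∃[ g ] dom g ≡ b × CanonizedBy b S g → hasFinal (proj₂ (CAN (b , S))) ≡ hasFinal S
    via (g , _ , g-inj , T , gS , e) =
      trans (cong (hasFinal ∘ proj₂) e) (trans (any-≈ˢ (Final D k) (normalize-≈ˢ T)) (hasFinal-actSet {g} {S} g-inj gS))

  hasFinal-Represents : ∀ {b S} → ((t , _ , S≈) : Represents b S) → hasFinal S ≡ accepts D k t
  hasFinal-Represents (t , _ , S≈) = any-≈ˢ (Final D k) S≈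

  accepted : ∀ {R} → initState ∈ R → (∀ {s x} → s ∈ R → Successor R s x → CAN x ∈ R) →
             (∀ {s} → s ∈ R → hasFinal (proj₂ s) ≡ true) → ∀ {t b} → Legal t b → accepts D k t ≡ true
  accepted init∈R closed consistent {t} l =
    trans (sym (hasFinal-CAN (Dyn-LblIn l))) (consistent (Closed.CAN-Dyn∈R init∈R closed l))

  AllInP : Set
  AllInP = ∀ G → IsGraph G → TreewidthAtMost k G → InP D G

  module Refutation {R s Y Seen} (inv : Invariant R (s ∷ Y) Seen) (s-inconsistent : hasFinal (proj₂ s) ≡ false) where
    open Invariant inv

    R′ : List St
    R′ = R ++ s ∷ []

    R′⊆seen : R′ ⊆ Seen
    R′⊆seen = visited⊆seen ∘ subst (_ ∈_) (++-assoc R (s ∷ []) Y) ∘ ∈-++⁺ˡ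

    R′-history : ∃[ h ] R′ ≡ initState ∷ h × Chain (initState ∷ []) h × lastOf initState h ≡ s
    R′-history = split R history≡ history-chain
      where
      split : ∀ R₀ {h} → R₀ ++ s ∷ Y ≡ initState ∷ h → Chain (initState ∷ []) h →
              ∃[ h′ ] R₀ ++ s ∷ [] ≡ initState ∷ h′ × Chain (initState ∷ []) h′ × lastOf initState h′ ≡ s
      split [] refl _ = [] , refl , tt , refl
      split (r ∷ R₀) e chain with refl , refl ← ∷-injective e =
        R₀ ++ s ∷ [] , refl ,
        Chain-prefix (initState ∷ []) (R₀ ++ s ∷ []) Y (subst (Chain (initState ∷ [])) (sym (++-assoc R₀ (s ∷ []) Y)) chain) ,
        lastOf-snoc initState R₀ s

    refutation : CanonRefutation R′
    refutation = record
      { first = initState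
      ; rest = proj₁ R′-history
      ; shape = proj₁ (proj₂ R′-history)
      ; allCanonical = Good.canonical ∘ good ∘ R′⊆seen
      ; allWellFormed = Good.wellFormed ∘ good ∘ R′⊆seen
      ; firstInitial = initial-state
      ; derivations = proj₁ (proj₂ (proj₂ R′-history))
      ; lastInconsistent = subst Inconsistent (sym (proj₂ (proj₂ (proj₂ R′-history)))) (any-false⁻ (Final D k) s-inconsistent) }
      where
      initial-state : Initial initState
      initial-state = via (CAN-canonizedBy {∅ₛ} {Leaf D k} (leafLbl k))
        where
        via : ∃[ g ] dom g ≡ ∅ₛ × CanonizedBy ∅ₛ (Leaf D k) g → Initial initState
        via (g , _ , g-inj , T , gS , e)
          with refl ← trans (sym gS) (actSet-unlabelled g (Leaf D k) g-inj (LblIn-∅ (leafLbl k))) =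
          subst Initial (sym e) (image-∅ g , normalize-≈ˢ (Leaf D k))

    -- A good inconsistent state represents a rejected term; by coherence, its graph is not in 𝒫(D).
    not-AllInP : Coherent D → ¬ AllInP
    not-AllInP coherent all-in with t , l , S≈ ← Good.represents (good (R′⊆seen (∈-++⁺ʳ R (here refl))))
      with k′ , t′ , t′∈ , accepted′ , iso ← all-in (GraphOf t) (GraphOf-isGraph l) (t , (_ , l) , ≅-refl (GraphOf t))
      with () ← trans (sym (trans (sym (hasFinal-Represents (t , l , S≈))) s-inconsistent))
                      (trans (coherent k k′ t t′ (_ , l) t′∈ iso) accepted′)

  module Run (fin : FiniteDP D) (coherent : Coherent D) where

    private
      module WitMembership = DecMembership (IsStrictTotalOrder._≟_ (WitOrder.isSTO O k))
      all-witnesses = proj₁ (fin k)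

    all-states : List St
    all-states = concatMap (λ b → map (λ L → b , normalize L) (sublists all-witnesses)) (allVecs (true ∷ false ∷ []) (suc k))

    normalized∈all-states : ∀ b T → (b , normalize T) ∈ all-states
    normalized∈all-states b T =
      ∈-concatMap-intro _ (∈-allVecs _ b (λ i → bool∈ (lookup b i)))
        (subst (λ L → (b , L) ∈ map (λ L → b , normalize L) (sublists all-witnesses)) (normalize-cong witnesses-of-T)
          (∈-map⁺ (λ L → b , normalize L) (filter∈sublists (WitMembership._∈? T) all-witnesses)))
      where
      bool∈ : ∀ x → x ∈ true ∷ false ∷ []
      bool∈ true = here refl
      bool∈ false = there (here refl)
      witnesses-of-T : filter (WitMembership._∈? T) all-witnesses ≈ˢ T
      witnesses-of-T = ⊆-antisym-≈ˢ (λ w∈ → proj₂ (∈-filter⁻ (WitMembership._∈? T) {xs = all-witnesses} w∈))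
                                    (λ {w} w∈T → ∈-filter⁺ (WitMembership._∈? T) (proj₂ (fin k) w) w∈T)

    good∈all-states : ∀ {s} → Good s → s ∈ all-states
    good∈all-states {b , S} good-s with T , refl ← Good.normalized good-s = normalized∈all-states b T

    Outcome : Output → Set
    Outcome o = (o ≡ inclusionHolds → AllInP) × (AllInP → o ≡ inclusionHolds) × (∀ R → o ≡ returns R → CanonRefutation R)

    runFrom-halt : ∀ n {c o} → step c ≡ halt o → runFrom (suc n) c ≡ just o
    runFrom-halt n {c} e with step c | e
    ... | _ | refl = refl

    runFrom-next : ∀ n {c c′} → step c ≡ next c′ → runFrom (suc n) c ≡ runFrom n c′
    runFrom-next n {c} e with step c | e
    ... | _ | refl = refl

    -- Each step moves one state from the queue to R and enqueues exactly the newly seen states,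
    -- so the queue length plus the number of unseen states in all-states strictly decreases.
    Bounded : ℕ → List St → List St → Set
    Bounded m Y Seen = length Y + length all-states < m + length Seen

    bounded-step : ∀ {m s Y Seen} new Seen′ → length Seen′ ≡ length new + length Seen →
                   Bounded (suc m) (s ∷ Y) Seen → Bounded m (Y ++ new) Seen′
    bounded-step {m} {s} {Y} {Seen} new Seen′ length-Seen′ bound = begin-strict
      length (Y ++ new) + length all-states       ≡⟨ cong (_+ length all-states) (trans (length-++ Y) (NP.+-comm (length Y) (length new))) ⟩
      length new + length Y + length all-states   ≡⟨ NP.+-assoc (length new) (length Y) (length all-states) ⟩
      length new + (length Y + length all-states) <⟨ NP.+-monoʳ-< (length new) (NP.≤-pred bound) ⟩
      length new + (m + length Seen)              ≡⟨ NP.+-assoc (length new) m (length Seen) ⟨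
      length new + m + length Seen                ≡⟨ cong (_+ length Seen) (NP.+-comm (length new) m) ⟩
      m + length new + length Seen                ≡⟨ NP.+-assoc m (length new) (length Seen) ⟩
      m + (length new + length Seen)              ≡⟨ cong (m +_) length-Seen′ ⟨
      m + length Seen′                            ∎
      where open NP.≤-Reasoning

    run : ∀ m {R Y Seen} → Invariant R Y Seen → Bounded m Y Seen →
          ∃[ n ] ∃[ o ] runFrom n (R , Y , Seen) ≡ just o × Outcome o
    run m {R} {[]} {Seen} inv _ =
      1 , inclusionHolds , refl ,
      (λ _ _ _ (t , (_ , l) , iso) → k , t , (_ , l) , accepted init∈R R-closed consistent l , iso) , (λ _ → refl) , (λ _ ())
      where
      open Invariant inv
      seen⊆R : Seen ⊆ R
      seen⊆R = subst (_ ∈_) (++-identityʳ R) ∘ seen⊆visited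
      init∈R : initState ∈ R
      init∈R = subst (initState ∈_) (sym (trans (sym (++-identityʳ R)) history≡)) (here refl)
      R-closed : ∀ {s x} → s ∈ R → Successor R s x → CAN x ∈ R
      R-closed s∈ succ = seen⊆R (closed s∈ succ)
    run zero {R} {s ∷ Y} {Seen} inv bound =
      ⊥-elim (NP.<-irrefl refl (NP.<-≤-trans bound (NP.≤-trans seen≤ (NP.m≤n+m _ _))))
      where
      seen≤ : length Seen ≤ length all-states
      seen≤ = Unique-length≤ (Invariant.seen-unique inv) (good∈all-states ∘ Invariant.good inv)
    run (suc m) {R} {s ∷ Y} {Seen} inv bound with hasFinal (proj₂ s) in s-final
    ... | false =
      1 , returns (R ++ s ∷ []) , runFrom-halt 0 (if-false s-final) ,
      (λ ()) , (λ all-in → ⊥-elim (not-AllInP coherent all-in)) , λ { _ refl → refutation }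
      where open Refutation inv s-final
    ... | true =
      let n , o , runs , outcome = run m invariant (subst (λ Z → Bounded m Z Seen′) (sym queue≡) (bounded-step {m} {s} {Y} {Seen} new Seen′ length≡ bound))
      in suc n , o , trans (runFrom-next n (if-true s-final)) runs , outcome
      where open Step inv s-final

theorem4 : (k : ℕ) (D : DPCore) (O : WitOrder D) (A : WitnessAction D) →
    FiniteDP D → Coherent D → InterfaceRespecting D → IdentityCleaning D →
    Σ (Canon.Output D O A k) λ o →
      -- the test terminates with output o
      (Σ ℕ λ n → Canon.RIT D O A k n ≡ just o)
      -- it returns "Inclusion Holds" iff every graph of treewidth ≤ k is in 𝒫(D)
      × ((o ≡ Canon.inclusionHolds → ∀ G → IsGraph G → TreewidthAtMost k G → InP D G)
        × ((∀ G → IsGraph G → TreewidthAtMost k G → InP D G) → o ≡ Canon.inclusionHolds))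
      -- otherwise it returns a canonized (k,D)-refutation
      × (∀ R → o ≡ Canon.returns R → Canon.CanonRefutation D O A k R)
theorem4 k D O A fin coherent ir idc =
  let n , o , terminates , holds⇒all-in , all-in⇒holds , refutes = run (suc (length all-states)) initial-invariant bounded
  in o , (n , terminates) , (holds⇒all-in , all-in⇒holds) , refutes
  where
  open InclusionTest D O A k ir idc
  open Run fin coherent
  bounded : Bounded (suc (length all-states)) (Canon.initState D O A k ∷ []) (Canon.initState D O A k ∷ [])
  bounded = NP.m<m+n (suc (length all-states)) (s≤s z≤n)
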